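{- Let $n\ge 3$ and $\mathbf c\in\mathbb R^n$ with $c_1<\dots<c_n$. The set of coherent monotone paths on the hypersimplex $\Delta(n,2)$ (with respect to $\mathbf c$) is in bijection with the set of coherent lattice paths of size $n$.
   Context: $\Delta(n,2)=\{\mathbf x\in[0,1]^n:\sum_ix_i=2\}$; vertices are $0/1$ vectors with two ones, $\operatorname{supp}(\mathbf v)=\{i:v_i=1\}$, vertices adjacent iff their supports share one element. A monotone path is $(\mathbf v_1,\dots,\mathbf v_r)$ from $\mathbf v_1=\mathbf e_1+\mathbf e_2$ to $\mathbf v_r=\mathbf e_{n-1}+\mathbf e_n$ along edges with $\langle\mathbf v_i,\mathbf c\rangle<\langle\mathbf v_{i+1},\mathbf c\rangle$. For $\boldsymbol\omega\in\mathbb R^n$ let $\pi^{\boldsymbol\omega}(\mathbf x)=(\langle\mathbf x,\mathbf c\rangle,\langle\mathbf x,\boldsymbol\omega\rangle)$; a proper face of the polygon $\pi^{\boldsymbol\omega}(\Delta(n,2))$ is upper if it has an outer normal with positive second coordinate. A monotone path is coherent if there is $\boldsymbol\omega$ such that the preimages in $\Delta(n,2)$ of the upper edges of $\pi^{\boldsymbol\omega}(\Delta(n,2))$ are exactly the edges $\mathbf v_i\mathbf v_{i+1}$ of the path (equivalently, it corresponds to a vertex of the monotone path polytope). A diagonal-avoiding lattice path of size $n$ (dimension 2) is a sequence of points $\boldsymbol\ell_1,\dots,\boldsymbol\ell_r\in[n]^2$ with $\boldsymbol\ell_1=(2,1)$, $\boldsymbol\ell_r\in\{(n-1,n),(n,n-1)\}$,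 the two coordinates of each point distinct, and consecutive points differing in exactly one coordinate, which strictly increases. The $i$-th enhanced step is $(a\to b;z)$ where the changing coordinate goes from $a$ to $b$ and the fixed coordinate is $z$; $\prec$ is the order of steps along the path. It is a coherent lattice path if for all enhanced steps $(i\to j;a)\prec(x\to y;z)$ with $x<j$ one has $j=z$ or $x=a$.
   Formalization: The vector $\mathbf c$, the vectors $\boldsymbol\omega$ and the outer normals of the upper faces have rational rather than real entries. -}

module Defs where

open import Data.Nat as ℕ using (ℕ; zero; suc; s≤s; z≤n)
open import Data.Nat.Properties using (≤-trans)
open import Data.Fin as Fin using (Fin; fromℕ<; opposite)
open import Data.Rational as ℚ using (ℚ)
open import Data.Product using (_×_; _,_; Σ; ∃; ∃-syntax; proj₁; proj₂)
open import Data.Sum using (_⊎_)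
open import Data.List using (List; []; _∷_; _++_; head; last)
open import Data.List.Relation.Unary.All using (All)
open import Data.List.Relation.Unary.Linked using (Linked)
open import Data.Maybe using (Maybe; just)
open import Data.Bool using (Bool; true; false; if_then_else_)
open import Relation.Nullary using (¬_; ⌊_⌋)
open import Relation.Binary.PropositionalEquality using (_≡_; _≢_)
open import Function.Bundles using (_⇔_)

-- Hypersimplex Δ(n,2)
-- A vertex e_a + e_b of Δ(n,2) is encoded by its support {a,b}, written
-- as the pair (a , b) with a < b (0-based indices in Fin n).

Vertex : ℕ → Set
Vertex n = Fin n × Fin n

ValidVertex : ∀ {n} → Vertex n → Set
ValidVertex (a , b) = a Fin.< b

memb : ∀ {n} → Fin n → Vertex n → Bool
memb x (c , d) = if ⌊ x Fin.≟ c ⌋ then true else ⌊ x Fin.≟ d ⌋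

sharedCount : ∀ {n} → Vertex n → Vertex n → ℕ
sharedCount (a , b) w = (if memb a w then 1 else 0) ℕ.+ (if memb b w then 1 else 0)

Adjacent : ∀ {n} → Vertex n → Vertex n → Set
Adjacent v w = sharedCount v w ≡ 1

⟪_,_⟫ : ∀ {n} → Vertex n → (Fin n → ℚ) → ℚ
⟪ (a , b) , x ⟫ = x a ℚ.+ x b

StrictlyIncreasing : ∀ {n} → (Fin n → ℚ) → Set
StrictlyIncreasing {n} c = ∀ (i j : Fin n) → i Fin.< j → c i ℚ.< c j

module _ (n : ℕ) (n≥3 : 3 ℕ.≤ n) where

  private
    i₁ : Fin n
    i₁ = fromℕ< (≤-trans (s≤s z≤n) n≥3)
    i₂ : Fin n
    i₂ = fromℕ< (≤-trans (s≤s (s≤s z≤n)) n≥3)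

  -- e₁ + e₂  (indices 0,1)
  startVertex : Vertex n
  startVertex = (i₁ , i₂)

  -- e_{n-1} + e_n  (indices n-2, n-1)
  endVertex : Vertex n
  endVertex = (opposite i₂ , opposite i₁)

  MonotonePath : (Fin n → ℚ) → List (Vertex n) → Set
  MonotonePath c p =
    All ValidVertex p ×
    head p ≡ just startVertex ×
    last p ≡ just endVertex ×
    Linked (λ v w → Adjacent v w × ⟪ v , c ⟫ ℚ.< ⟪ w , c ⟫) p

  proj : (Fin n → ℚ) → (Fin n → ℚ) → Vertex n → ℚ × ℚ
  proj c ω v = (⟪ v , c ⟫ , ⟪ v , ω ⟫)

  -- the linear functional with outer normal (λ , 1), pulled back
  height : (Fin n → ℚ) → (Fin n → ℚ) → ℚ → Vertex n → ℚ
  height c ω l v = l ℚ.* ⟪ v , c ⟫ ℚ.+ ⟪ v , ω ⟫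

  -- v is a vertex of Δ(n,2) in the preimage of the face of π^ω(Δ(n,2))
  -- with outer normal (λ , 1)
  InFace : (Fin n → ℚ) → (Fin n → ℚ) → ℚ → Vertex n → Set
  InFace c ω l v = ValidVertex v × (∀ w → ValidVertex w → height c ω l w ℚ.≤ height c ω l v)

  IsUpperEdge : (Fin n → ℚ) → (Fin n → ℚ) → ℚ → Set
  IsUpperEdge c ω l = ∃[ v ] ∃[ w ] (InFace c ω l v × InFace c ω l w × proj c ω v ≢ proj c ω w)

  PreimageIs : (Fin n → ℚ) → (Fin n → ℚ) → ℚ → Vertex n → Vertex n → Set
  PreimageIs c ω l u v = ∀ x → InFace c ω l x ⇔ (x ≡ u ⊎ x ≡ v)

  PathEdge : List (Vertex n) → Vertex n → Vertex n → Set
  PathEdge p u v = ∃[ xs ] ∃[ ys ] (p ≡ xs ++ u ∷ v ∷ ys)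

  Coherent : (Fin n → ℚ) → List (Vertex n) → Set
  Coherent c p = ∃[ ω ]
    ((∀ l → IsUpperEdge c ω l → ∃[ u ] ∃[ v ] (PathEdge p u v × PreimageIs c ω l u v)) ×
     (∀ u v → PathEdge p u v → ∃[ l ] (IsUpperEdge c ω l × PreimageIs c ω l u v)))

  CoherentMonotonePath : (Fin n → ℚ) → List (Vertex n) → Set
  CoherentMonotonePath c p = MonotonePath c p × Coherent c p

-- Lattice paths (1-based points of [n]²)

Point : Set
Point = ℕ × ℕ

record EStep : Set where
  constructor step
  field
    from to fixed : ℕ

IsStep : Point → Point → Set
IsStep (x , y) (x' , y') = (x ≡ x' × y ℕ.< y') ⊎ (y ≡ y' × x ℕ.< x')

enhanced : Point → Point → EStep
enhanced (x , y) (x' , y') =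
  if ⌊ x ℕ.≟ x' ⌋ then step y y' x else step x x' y

steps : List Point → List EStep
steps []              = []
steps (_ ∷ [])        = []
steps (p ∷ q ∷ rest)  = enhanced p q ∷ steps (q ∷ rest)

InGrid : ℕ → Point → Set
InGrid n (x , y) = (1 ℕ.≤ x × x ℕ.≤ n) × (1 ℕ.≤ y × y ℕ.≤ n) × x ≢ y

DiagonalAvoidingPath : ℕ → List Point → Set
DiagonalAvoidingPath n L =
  All (InGrid n) L ×
  head L ≡ just (2 , 1) ×
  (last L ≡ just (n ℕ.∸ 1 , n) ⊎ last L ≡ just (n , n ℕ.∸ 1)) ×
  Linked IsStep L

CoherentSteps : EStep → EStep → Set
CoherentSteps (step i j a) (step x y z) = x ℕ.< j → j ≡ z ⊎ x ≡ a

CoherentLatticePath : ℕ → List Point → Set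
CoherentLatticePath n L =
  DiagonalAvoidingPath n L ×
  (∀ xs s ys t zs → steps L ≡ xs ++ s ∷ ys ++ t ∷ zs → CoherentSteps s t)

-- A monotone path is recorded by the lattice path of its supports: from one vertex to the next one line of the
-- support stays and the other is replaced by a larger one, and decoding inverts taking vertices.
-- For ω ∈ ℚⁿ the height of e_a + e_b in direction (l , 1) is the sum of the values at l of the lines
-- t ↦ ω_a + c_a t and t ↦ ω_b + c_b t, so as l increases the upper edges of π^ω(Δ(n,2)) are the moments at which
-- the pair of highest lines changes. Necessity: if (i → j ; a) precedes (x → y ; z) with x < j, j ≠ z and x ≠ a,
-- the steeper line j is above x at the first moment and below it at the second. Sufficiency, by induction on n:
-- deleting the steepest line n turns a coherent lattice path into one for n - 1; realise that one by lines, then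
-- add line n with the intercept that makes it cross the line it replaces at the right moment.

module Submission where

open import Data.Bool.Base using (true; false; if_then_else_)
open import Data.Empty using (⊥; ⊥-elim)
open import Data.Fin.Base as Fin using (Fin; toℕ; fromℕ<)
import Data.Fin.Properties as Fin
open import Data.List.Base using (List; []; _∷_; _++_; [_]; head; last; map)
import Data.List.Properties as List
open import Data.List.Membership.Propositional using (_∈_)
open import Data.List.Membership.Propositional.Properties using (∈-∃++; ∈-++⁺ˡ; ∈-++⁺ʳ)
open import Data.List.Relation.Unary.All as All using (All; []; _∷_)
import Data.List.Relation.Unary.All.Properties as All
open import Data.List.Relation.Unary.AllPairs using (AllPairs; []; _∷_)
import Data.List.Relation.Unary.AllPairs.Properties as AllPairs
open import Data.List.Relation.Unary.Any using (here; there)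
open import Data.List.Relation.Unary.Linked using (Linked; []; [-]; _∷_)
open import Data.Maybe.Base as Maybe using (Maybe; just)
import Data.Maybe.Properties as Maybe
open import Data.Nat.Base as ℕ using (ℕ; zero; suc; pred; _∸_; z≤n; s≤s)
import Data.Nat.Properties as ℕ
open import Data.Product.Base using (_×_; _,_; Σ; ∃-syntax; proj₁; proj₂)
import Data.Product.Properties as Product
open import Data.Rational.Base as ℚ using (ℚ; 0ℚ; 1ℚ; ½)
import Data.Rational.Properties as ℚ
open import Data.Rational.Solver using (module +-*-Solver)
open import Data.Sum.Base using (_⊎_; inj₁; inj₂; [_,_]′)
open import Data.Unit.Base using (⊤; tt)
open import Function.Bundles using (Equivalence; mk⇔)
open import Relation.Binary.Definitions using (Tri; tri<; tri≈; tri>)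
open import Relation.Binary.PropositionalEquality using (_≡_; _≢_; refl; sym; trans; cong; cong₂; subst; subst₂; module ≡-Reasoning)
open import Relation.Nullary using (¬_; Dec; yes; no; ⌊_⌋)
open import Relation.Nullary.Decidable using (toWitness)

open import Defs

module AffineLines where

  open import Data.Rational.Base using (_<_; _≤_; _+_; _-_; _*_; -_)
  open +-*-Solver

  line : ℚ → ℚ → ℚ → ℚ
  line w s t = w + s * t

  0<q-p : ∀ {p q} → p < q → 0ℚ < q - p
  0<q-p {p} {q} p<q = subst (_< q - p) (ℚ.+-inverseʳ p) (ℚ.+-monoˡ-< (- p) p<q)

  0≤q-p : ∀ {p q} → p ≤ q → 0ℚ ≤ q - p
  0≤q-p {p} {q} p≤q = subst (_≤ q - p) (ℚ.+-inverseʳ p) (ℚ.+-monoˡ-≤ (- p) p≤q)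

  0<q-p⇒p<q : ∀ {p q} → 0ℚ < q - p → p < q
  0<q-p⇒p<q {p} {q} h = subst₂ _<_ (ℚ.+-identityˡ p) (solve 2 (λ p q → q :- p :+ p := q) refl p q) (ℚ.+-monoˡ-< p h)

  pos*pos : ∀ {x y} → 0ℚ < x → 0ℚ < y → 0ℚ < x * y
  pos*pos {x} {y} hx hy = ℚ.positive⁻¹ (x * y) {{ℚ.pos*pos⇒pos x {{ℚ.positive hx}} y {{ℚ.positive hy}}}}

  nonNeg*nonNeg : ∀ {x y} → 0ℚ ≤ x → 0ℚ ≤ y → 0ℚ ≤ x * y
  nonNeg*nonNeg {x} {y} hx hy =
    ℚ.nonNegative⁻¹ (x * y) {{ℚ.nonNeg*nonNeg⇒nonNeg x {{ℚ.nonNegative hx}} y {{ℚ.nonNegative hy}}}}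

  pos+nonNeg : ∀ {x y} → 0ℚ < x → 0ℚ ≤ y → 0ℚ < x + y
  pos+nonNeg hx hy = ℚ.+-mono-<-≤ hx hy

  nonNeg+pos : ∀ {x y} → 0ℚ ≤ x → 0ℚ < y → 0ℚ < x + y
  nonNeg+pos hx hy = ℚ.+-mono-≤-< hx hy

  pos*⁻¹ʳ : ∀ {r g} → 0ℚ < r → 0ℚ < r * g → 0ℚ < g
  pos*⁻¹ʳ {r} {g} hr h = ℚ.*-cancelˡ-<-nonNeg r {{ℚ.nonNegative (ℚ.<⇒≤ hr)}} (subst (_< r * g) (sym (ℚ.*-zeroʳ r)) h)

  line-pos-between : ∀ w s t₁ t t₂ → t₁ ≤ t → t ≤ t₂ → 0ℚ ≤ line w s t₁ → 0ℚ ≤ line w s t₂ →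
    (t < t₂ × 0ℚ < line w s t₁) ⊎ (t₁ < t × 0ℚ < line w s t₂) → 0ℚ < line w s t
  line-pos-between w s t₁ t t₂ t₁≤t t≤t₂ g₁ g₂ d = pos*⁻¹ʳ width>0 (subst (0ℚ <_) (sym combination) combination>0)
    where
      combination : (t₂ - t₁) * line w s t ≡ (t₂ - t) * line w s t₁ + (t - t₁) * line w s t₂
      combination = solve 5 (λ w s t₁ t t₂ → (t₂ :- t₁) :* (w :+ s :* t)
                                  := (t₂ :- t) :* (w :+ s :* t₁) :+ (t :- t₁) :* (w :+ s :* t₂)) refl w s t₁ t t₂
      width>0 : 0ℚ < t₂ - t₁
      width>0 = [ (λ q → 0<q-p (ℚ.≤-<-trans t₁≤t (proj₁ q))) , (λ q → 0<q-p (ℚ.<-≤-trans (proj₁ q) t≤t₂)) ]′ d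
      combination>0 : 0ℚ < (t₂ - t) * line w s t₁ + (t - t₁) * line w s t₂
      combination>0 = [ (λ q → pos+nonNeg (pos*pos (0<q-p (proj₁ q)) (proj₂ q)) (nonNeg*nonNeg (0≤q-p t₁≤t) g₂)) ,
                        (λ q → nonNeg+pos (nonNeg*nonNeg (0≤q-p t≤t₂) g₁) (pos*pos (0<q-p (proj₁ q)) (proj₂ q))) ]′ d

  line-diff : ∀ wp sp wq sq t → line wp sp t - line wq sq t ≡ line (wp - wq) (sp - sq) t
  line-diff = solve 5 (λ wp sp wq sq t → (wp :+ sp :* t) :- (wq :+ sq :* t) := (wp :- wq) :+ (sp :- sq) :* t) refl

  <⇒diff-pos : ∀ wp sp wq sq t → line wq sq t < line wp sp t → 0ℚ < line (wp - wq) (sp - sq) t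
  <⇒diff-pos wp sp wq sq t h = subst (0ℚ <_) (line-diff wp sp wq sq t) (0<q-p h)

  ≤⇒diff-nonNeg : ∀ wp sp wq sq t → line wq sq t ≤ line wp sp t → 0ℚ ≤ line (wp - wq) (sp - sq) t
  ≤⇒diff-nonNeg wp sp wq sq t h = subst (0ℚ ≤_) (line-diff wp sp wq sq t) (0≤q-p h)

  diff-pos⇒< : ∀ wp sp wq sq t → 0ℚ < line (wp - wq) (sp - sq) t → line wq sq t < line wp sp t
  diff-pos⇒< wp sp wq sq t h = 0<q-p⇒p<q (subst (0ℚ <_) (sym (line-diff wp sp wq sq t)) h)

  line-<-between : ∀ {wp sp wq sq t₁ t t₂} → t₁ ≤ t → t ≤ t₂ →
    line wq sq t₁ ≤ line wp sp t₁ → line wq sq t₂ ≤ line wp sp t₂ →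
    (t < t₂ × line wq sq t₁ < line wp sp t₁) ⊎ (t₁ < t × line wq sq t₂ < line wp sp t₂) →
    line wq sq t < line wp sp t
  line-<-between {wp} {sp} {wq} {sq} {t₁} {t} {t₂} t₁≤t t≤t₂ g₁ g₂ d =
    diff-pos⇒< wp sp wq sq t
      (line-pos-between (wp - wq) (sp - sq) t₁ t t₂ t₁≤t t≤t₂
        (≤⇒diff-nonNeg wp sp wq sq t₁ g₁) (≤⇒diff-nonNeg wp sp wq sq t₂ g₂)
        ([ (λ q → inj₁ (proj₁ q , <⇒diff-pos wp sp wq sq t₁ (proj₂ q))) ,
           (λ q → inj₂ (proj₁ q , <⇒diff-pos wp sp wq sq t₂ (proj₂ q))) ]′ d))

  line-forward : ∀ w s t₁ t → line w s t ≡ line w s t₁ + s * (t - t₁)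
  line-forward = solve 4 (λ w s t₁ t → w :+ s :* t := (w :+ s :* t₁) :+ s :* (t :- t₁)) refl

  line-backward : ∀ w s t₁ t → line w s t ≡ line w s t₁ + (- s) * (t₁ - t)
  line-backward = solve 4 (λ w s t₁ t → w :+ s :* t := (w :+ s :* t₁) :+ (:- s) :* (t₁ :- t)) refl

  steeper-above-after : ∀ {wp sp wq sq t₁ t} → sq < sp → line wq sq t₁ ≤ line wp sp t₁ → t₁ < t →
    line wq sq t < line wp sp t
  steeper-above-after {wp} {sp} {wq} {sq} {t₁} {t} s< h t₁<t =
    diff-pos⇒< wp sp wq sq t (subst (0ℚ <_) (sym (line-forward (wp - wq) (sp - sq) t₁ t))
      (nonNeg+pos (≤⇒diff-nonNeg wp sp wq sq t₁ h) (pos*pos (0<q-p s<) (0<q-p t₁<t))))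

  steeper-above-after′ : ∀ {wp sp wq sq t₁ t} → sq < sp → line wq sq t₁ < line wp sp t₁ → t₁ ≤ t →
    line wq sq t < line wp sp t
  steeper-above-after′ {wp} {sp} {wq} {sq} {t₁} {t} s< h t₁≤t =
    diff-pos⇒< wp sp wq sq t (subst (0ℚ <_) (sym (line-forward (wp - wq) (sp - sq) t₁ t))
      (pos+nonNeg (<⇒diff-pos wp sp wq sq t₁ h) (nonNeg*nonNeg (0≤q-p (ℚ.<⇒≤ s<)) (0≤q-p t₁≤t))))

  flatter-above-before : ∀ {wp sp wq sq t₁ t} → sp < sq → line wq sq t₁ ≤ line wp sp t₁ → t < t₁ →
    line wq sq t < line wp sp t
  flatter-above-before {wp} {sp} {wq} {sq} {t₁} {t} s< h t<t₁ =
    diff-pos⇒< wp sp wq sq t (subst (0ℚ <_) (sym (line-backward (wp - wq) (sp - sq) t₁ t))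
      (nonNeg+pos (≤⇒diff-nonNeg wp sp wq sq t₁ h) (pos*pos -[sp-sq]>0 (0<q-p t<t₁))))
    where
      -[sp-sq]>0 : 0ℚ < - (sp - sq)
      -[sp-sq]>0 = subst (0ℚ <_) (solve 2 (λ p q → q :- p := :- (p :- q)) refl sp sq) (0<q-p s<)

  steeper-meets-after : ∀ wp sp wq sq t₁ → sq < sp → line wp sp t₁ < line wq sq t₁ →
    Σ ℚ λ σ → t₁ < σ × line wp sp σ ≡ line wq sq σ
  steeper-meets-after wp sp wq sq t₁ s< below = t₁ + gap * 1/k , t₁<σ , meet
    where
      gap = line wq sq t₁ - line wp sp t₁
      k = sp - sq
      instance
        k-pos : ℚ.Positive k
        k-pos = ℚ.positive (0<q-p s<)
        k≢0 : ℚ.NonZero k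
        k≢0 = ℚ.pos⇒nonZero k
      1/k = ℚ.1/ k
      t₁<σ : t₁ < t₁ + gap * 1/k
      t₁<σ = 0<q-p⇒p<q (subst (0ℚ <_) (solve 2 (λ t₁ d → d := t₁ :+ d :- t₁) refl t₁ (gap * 1/k))
               (pos*pos (0<q-p below) (ℚ.positive⁻¹ 1/k {{ℚ.1/pos⇒pos k}})))
      meet : line wp sp (t₁ + gap * 1/k) ≡ line wq sq (t₁ + gap * 1/k)
      meet = begin
        line wp sp (t₁ + gap * 1/k)
          ≡⟨ solve 6 (λ wp sp wq sq t₁ i → wp :+ sp :* (t₁ :+ ((wq :+ sq :* t₁) :- (wp :+ sp :* t₁)) :* i)
               := (wq :+ sq :* (t₁ :+ ((wq :+ sq :* t₁) :- (wp :+ sp :* t₁)) :* i))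
                  :+ (((wq :+ sq :* t₁) :- (wp :+ sp :* t₁)) :* ((sp :- sq) :* i) :- ((wq :+ sq :* t₁) :- (wp :+ sp :* t₁))))
               refl wp sp wq sq t₁ 1/k ⟩
        line wq sq (t₁ + gap * 1/k) + (gap * (k * 1/k) - gap)
          ≡⟨ cong (λ e → line wq sq (t₁ + gap * 1/k) + (gap * e - gap)) (ℚ.*-inverseʳ k) ⟩
        line wq sq (t₁ + gap * 1/k) + (gap * 1ℚ - gap)
          ≡⟨ cong (λ e → line wq sq (t₁ + gap * 1/k) + (e - gap)) (ℚ.*-identityʳ gap) ⟩
        line wq sq (t₁ + gap * 1/k) + (gap - gap)
          ≡⟨ cong (line wq sq (t₁ + gap * 1/k) +_) (ℚ.+-inverseʳ gap) ⟩
        line wq sq (t₁ + gap * 1/k) + 0ℚ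
          ≡⟨ ℚ.+-identityʳ _ ⟩
        line wq sq (t₁ + gap * 1/k) ∎
        where open ≡-Reasoning

  midpoint : ℚ → ℚ → ℚ
  midpoint a b = a + (b - a) * ½

  <midpoint : ∀ {a b} → a < b → a < midpoint a b
  <midpoint {a} {b} h = 0<q-p⇒p<q (subst (0ℚ <_) (solve 3 (λ a b h → (b :- a) :* h := (a :+ (b :- a) :* h) :- a) refl a b ½)
                          (pos*pos (0<q-p h) (ℚ.positive⁻¹ ½)))

  midpoint< : ∀ {a b} → a < b → midpoint a b < b
  midpoint< {a} {b} h = 0<q-p⇒p<q (subst (0ℚ <_) (solve 3 (λ a b h → (b :- a) :* (con 1ℚ :- h) := b :- (a :+ (b :- a) :* h)) refl a b ½)
                          (pos*pos (0<q-p h) (ℚ.positive⁻¹ (1ℚ - ½))))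

  p<p+1 : ∀ p → p < p + 1ℚ
  p<p+1 p = 0<q-p⇒p<q (subst (0ℚ <_) (solve 1 (λ p → con 1ℚ := p :+ con 1ℚ :- p) refl p) (ℚ.positive⁻¹ 1ℚ))

  p-1<p : ∀ p → p - 1ℚ < p
  p-1<p p = 0<q-p⇒p<q (subst (0ℚ <_) (solve 1 (λ p → con 1ℚ := p :- (p :- con 1ℚ)) refl p) (ℚ.positive⁻¹ 1ℚ))

  +-cancelˡ-< : ∀ {a b d} → a + b < a + d → b < d
  +-cancelˡ-< {a} {b} {d} h = subst₂ _<_ (-a+[a+z]≡z b) (-a+[a+z]≡z d) (ℚ.+-monoʳ-< (- a) h)
    where -a+[a+z]≡z = solve 2 (λ a z → :- a :+ (a :+ z) := z) refl a

  +-cancelʳ-< : ∀ {a b d} → b + a < d + a → b < d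
  +-cancelʳ-< {a} {b} {d} h = +-cancelˡ-< {a} (subst₂ _<_ (ℚ.+-comm b a) (ℚ.+-comm d a) h)

  +-cancelˡ-≤ : ∀ {a b d} → a + b ≤ a + d → b ≤ d
  +-cancelˡ-≤ {a} {b} {d} h = subst₂ _≤_ (-a+[a+z]≡z b) (-a+[a+z]≡z d) (ℚ.+-monoʳ-≤ (- a) h)
    where -a+[a+z]≡z = solve 2 (λ a z → :- a :+ (a :+ z) := z) refl a

module StepChains where

  open import Data.Nat.Base using (_<_; _≤_)
  open import Data.List.Base using (_∷ʳ_; initLast; _∷ʳ′_)
  open EStep

  Ascending : ℕ → List ℕ → Set
  Ascending a []       = ⊤
  Ascending a (b ∷ hs) = a < b × Ascending b hs

  lastFrom : ℕ → List ℕ → ℕ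
  lastFrom a []       = a
  lastFrom a (b ∷ hs) = lastFrom b hs

  ascending-≤-last : ∀ {n} a hs → Ascending a hs → lastFrom a hs ≡ n → a ≤ n
  ascending-≤-last a []       _          e = ℕ.≤-reflexive e
  ascending-≤-last a (b ∷ hs) (a<b , ab) e = ℕ.<⇒≤ (ℕ.<-≤-trans a<b (ascending-≤-last b hs ab e))

  SamePair : ℕ → ℕ → ℕ × ℕ → Set
  SamePair a i (u , v) = (a ≡ u × i ≡ v) ⊎ (a ≡ v × i ≡ u)

  samePair-swap : ∀ {a i u v} → SamePair a i (u , v) → SamePair i a (u , v)
  samePair-swap (inj₁ (e₁ , e₂)) = inj₂ (e₂ , e₁)
  samePair-swap (inj₂ (e₁ , e₂)) = inj₁ (e₂ , e₁)

  samePair-∈₁ : ∀ {a i u v} → SamePair a i (u , v) → a ≡ u ⊎ a ≡ v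
  samePair-∈₁ (inj₁ (e , _)) = inj₁ e
  samePair-∈₁ (inj₂ (e , _)) = inj₂ e

  samePair-∈₂ : ∀ {a i u v} → SamePair a i (u , v) → i ≡ u ⊎ i ≡ v
  samePair-∈₂ (inj₁ (_ , e)) = inj₂ e
  samePair-∈₂ (inj₂ (_ , e)) = inj₁ e

  samePair-≤ : ∀ {n a i u v} → SamePair a i (u , v) → u ≤ n → v ≤ n → a ≤ n
  samePair-≤ (inj₁ (refl , refl)) u≤n v≤n = u≤n
  samePair-≤ (inj₂ (refl , refl)) u≤n v≤n = v≤n

  finalState : ℕ → ℕ → List EStep → ℕ × ℕ
  finalState u v []               = (u , v)
  finalState u v (step i j a ∷ S) = finalState a j S

  finalState-++ : ∀ u v P Q → finalState u v (P ++ Q) ≡ finalState (proj₁ (finalState u v P)) (proj₂ (finalState u v P)) Q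
  finalState-++ u v []               Q = refl
  finalState-++ u v (step i j a ∷ P) Q = finalState-++ a j P Q

  data Chain (n : ℕ) : ℕ → ℕ → List EStep → Set where
    nil  : ∀ {u v} → Chain n u v []
    cons : ∀ {u v i j a S} → SamePair a i (u , v) → i < j → j ≤ n → j ≢ a → Chain n a j S →
           Chain n u v (step i j a ∷ S)

  IsFinal : ℕ → ℕ × ℕ → Set
  IsFinal n (p , q) = (p ≡ pred n × q ≡ n) ⊎ (p ≡ n × q ≡ pred n)

  chain-++⁻ : ∀ {n} P {Q u v} → Chain n u v (P ++ Q) →
    Chain n u v P × Chain n (proj₁ (finalState u v P)) (proj₂ (finalState u v P)) Q
  chain-++⁻ []               c = nil , c
  chain-++⁻ (step i j a ∷ P) (cons o i<j j≤n j≢a c) with chain-++⁻ P c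
  ... | c₁ , c₂ = cons o i<j j≤n j≢a c₁ , c₂

  chain-++⁺ : ∀ {n} P {Q u v} → Chain n u v P →
    Chain n (proj₁ (finalState u v P)) (proj₂ (finalState u v P)) Q → Chain n u v (P ++ Q)
  chain-++⁺ []               nil                      c₂ = c₂
  chain-++⁺ (step i j a ∷ P) (cons o i<j j≤n j≢a c₁) c₂ = cons o i<j j≤n j≢a (chain-++⁺ P c₁ c₂)

  ValidState : ℕ → ℕ × ℕ → Set
  ValidState n (u , v) = 1 ≤ u × 1 ≤ v × u ≤ n × v ≤ n × u ≢ v

  record ValidStep (n : ℕ) (s : EStep) : Set where
    field
      1≤from     : 1 ≤ from s
      from<to    : from s < to s
      to≤n       : to s ≤ n
      from≢fixed : from s ≢ fixed s

  samePair-valid : ∀ {n a i u v} → SamePair a i (u , v) → ValidState n (u , v) →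
    1 ≤ a × 1 ≤ i × a ≤ n × i ≤ n × i ≢ a
  samePair-valid (inj₁ (refl , refl)) (h₁ , h₂ , h₃ , h₄ , h₅) = h₁ , h₂ , h₃ , h₄ , λ e → h₅ (sym e)
  samePair-valid (inj₂ (refl , refl)) (h₁ , h₂ , h₃ , h₄ , h₅) = h₂ , h₁ , h₄ , h₃ , h₅

  chain-valid : ∀ {n} P {u v} → Chain n u v P → ValidState n (u , v) →
    All (ValidStep n) P × ValidState n (finalState u v P)
  chain-valid []               nil                      valid = [] , valid
  chain-valid (step i j a ∷ P) (cons o i<j j≤n j≢a c) valid with samePair-valid o valid
  ... | 1≤a , 1≤i , a≤n , i≤n , i≢a with chain-valid P c (1≤a , ℕ.≤-trans 1≤i (ℕ.<⇒≤ i<j) , a≤n , j≤n , λ e → j≢a (sym e))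
  ... | valid-steps , valid′ = record { 1≤from = 1≤i ; from<to = i<j ; to≤n = j≤n ; from≢fixed = i≢a } ∷ valid-steps , valid′

  CoherentSequence : List EStep → Set
  CoherentSequence S = ∀ xs s ys t zs → S ≡ xs ++ s ∷ ys ++ t ∷ zs → CoherentSteps s t

  coherentSequence⇒allPairs : ∀ S → CoherentSequence S → AllPairs CoherentSteps S
  coherentSequence⇒allPairs []      h = []
  coherentSequence⇒allPairs (s ∷ S) h =
    All.tabulate later ∷ coherentSequence⇒allPairs S (λ xs s′ ys t zs e → h (s ∷ xs) s′ ys t zs (cong (s ∷_) e))
    where
      later : ∀ {t} → t ∈ S → CoherentSteps s t
      later t∈S with ∈-∃++ t∈S
      ... | ys , zs , e = h [] s ys _ zs (cong (s ∷_) e)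

  CoherentAcross : List EStep → List EStep → Set
  CoherentAcross P Q = All (λ s → All (CoherentSteps s) Q) P

  allPairs-++⁻ : ∀ P {Q} → AllPairs CoherentSteps (P ++ Q) →
    AllPairs CoherentSteps P × AllPairs CoherentSteps Q × CoherentAcross P Q
  allPairs-++⁻ []      h       = [] , h , []
  allPairs-++⁻ (s ∷ P) (a ∷ h) with allPairs-++⁻ P h
  ... | hP , hQ , across = All.++⁻ˡ P a ∷ hP , hQ , All.++⁻ʳ P a ∷ across

  topTail : ℕ → ℕ → List ℕ → List EStep
  topTail N a []       = []
  topTail N a (b ∷ hs) = step a b N ∷ topTail N b hs

  topTail-shape : ∀ {n} S {p q a} → Chain (suc n) p q S → SamePair a (suc n) (p , q) →
    IsFinal (suc n) (finalState p q S) → a ≤ n →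
    Σ (List ℕ) λ hs → S ≡ topTail (suc n) a hs × Ascending a hs × lastFrom a hs ≡ n
  topTail-shape [] nil (inj₁ (refl , refl)) (inj₁ (e , _)) a≤n = [] , refl , tt , e
  topTail-shape [] nil (inj₁ (refl , refl)) (inj₂ (e , _)) a≤n = ⊥-elim (ℕ.<⇒≢ (s≤s a≤n) e)
  topTail-shape [] nil (inj₂ (refl , refl)) (inj₁ (e , _)) a≤n = ⊥-elim (ℕ.<⇒≢ (ℕ.n<1+n _) (sym e))
  topTail-shape [] nil (inj₂ (refl , refl)) (inj₂ (_ , e)) a≤n = [] , refl , tt , e
  topTail-shape {n} (step i j b ∷ S) {p} {q} {a} (cons o i<j j≤N j≢b c) top final a≤n = continue (combine o top)
    where
      combine : SamePair b i (p , q) → SamePair a (suc n) (p , q) → SamePair b i (a , suc n)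
      combine (inj₁ (refl , refl)) (inj₁ (refl , refl)) = inj₁ (refl , refl)
      combine (inj₁ (refl , refl)) (inj₂ (refl , refl)) = inj₂ (refl , refl)
      combine (inj₂ (refl , refl)) (inj₁ (refl , refl)) = inj₂ (refl , refl)
      combine (inj₂ (refl , refl)) (inj₂ (refl , refl)) = inj₁ (refl , refl)
      continue : SamePair b i (a , suc n) →
        Σ (List ℕ) λ hs → step i j b ∷ S ≡ topTail (suc n) a hs × Ascending a hs × lastFrom a hs ≡ n
      continue (inj₁ (_ , refl)) = ⊥-elim (ℕ.<⇒≱ i<j j≤N)
      continue (inj₂ (refl , refl)) with topTail-shape S c (inj₂ (refl , refl)) final (ℕ.≤-pred (ℕ.≤∧≢⇒< j≤N j≢b))
      ... | hs , refl , asc , lst = j ∷ hs , refl , (i<j , asc) , lst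

  split-at-top-entry : ∀ {n} S {u v} → Chain (suc n) u v S → IsFinal (suc n) (finalState u v S) → u ≤ n → v ≤ n →
    Σ (List EStep) λ P → Σ ℕ λ x → Σ ℕ λ z → Σ (List ℕ) λ hs →
      S ≡ P ++ step x (suc n) z ∷ topTail (suc n) z hs × Chain n u v P × SamePair z x (finalState u v P) ×
      Ascending z hs × lastFrom z hs ≡ n
  split-at-top-entry [] nil (inj₁ (_ , e)) u≤n v≤n = ⊥-elim (ℕ.<⇒≢ (s≤s v≤n) e)
  split-at-top-entry [] nil (inj₂ (e , _)) u≤n v≤n = ⊥-elim (ℕ.<⇒≢ (s≤s u≤n) e)
  split-at-top-entry {n} (step i j a ∷ S) (cons o i<j j≤N j≢a c) final u≤n v≤n with j ℕ.≟ suc n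
  ... | yes refl with topTail-shape S c (inj₁ (refl , refl)) final (samePair-≤ o u≤n v≤n)
  ...   | hs , refl , asc , lst = [] , i , a , hs , refl , nil , o , asc , lst
  split-at-top-entry {n} (step i j a ∷ S) (cons o i<j j≤N j≢a c) final u≤n v≤n | no j≢N
    with split-at-top-entry S c final (samePair-≤ o u≤n v≤n) (ℕ.≤-pred (ℕ.≤∧≢⇒< j≤N j≢N))
  ... | P , x , z , hs , refl , chain , pair , asc , lst =
    step i j a ∷ P , x , z , hs , refl , cons o i<j (ℕ.≤-pred (ℕ.≤∧≢⇒< j≤N j≢N)) j≢a chain , pair , asc , lst

  zigzagEnd : ℕ → ℕ → ℕ → List EStep
  zigzagEnd n a b = if ⌊ a ℕ.≟ pred n ⌋ then [] else [ step a (pred n) b ]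

  zigzag : ℕ → ℕ → ℕ → List ℕ → List EStep
  zigzag n a b []       = zigzagEnd n a b
  zigzag n a b (c ∷ hs) = step a c b ∷ zigzag n b c hs

  replaceStep : ℕ → ℕ → ℕ → List EStep
  replaceStep z x h = if ⌊ x ℕ.≟ h ⌋ then [] else [ step x h z ]

  -- What the path becomes when the steepest line N is deleted, once N has replaced x next to z and
  -- then run through z < h₁ < h₂ < … < n: first h₁ replaces x, then the top two zigzag along the hᵢ.
  reducedTail : ℕ → ℕ → ℕ → List ℕ → List EStep
  reducedTail n z x []       = zigzagEnd n x z
  reducedTail n z x (h ∷ hs) = replaceStep z x h ++ zigzag n z h hs

  pred[n]≢n : ∀ {n} → 1 ≤ n → pred n ≢ n
  pred[n]≢n {suc n} _ = ℕ.<⇒≢ (ℕ.n<1+n n)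

  zigzag-chain : ∀ {n} a b hs {p q} → 1 ≤ n → SamePair b a (p , q) → a < b → Ascending b hs → lastFrom b hs ≡ n →
    Chain n p q (zigzag n a b hs) × IsFinal n (finalState p q (zigzag n a b hs))
  zigzag-chain {n} a b (c ∷ hs) 1≤n o a<b (b<c , asc) lst with zigzag-chain b c hs 1≤n (inj₂ (refl , refl)) b<c asc lst
  ... | chain , final = cons o (ℕ.<-trans a<b b<c) (ascending-≤-last c hs asc lst) (ℕ.>⇒≢ b<c) chain , final
  zigzag-chain {n} a b [] {p} {q} 1≤n o a<b _ refl with a ℕ.≟ pred n
  ... | yes refl = nil , final o
    where final : SamePair n (pred n) (p , q) → IsFinal n (p , q)
          final (inj₁ (e₁ , e₂)) = inj₂ (sym e₁ , sym e₂)
          final (inj₂ (e₁ , e₂)) = inj₁ (sym e₂ , sym e₁)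
  ... | no a≢pn = cons o (ℕ.≤∧≢⇒< (ℕ.<⇒≤pred a<b) a≢pn) ℕ.pred[n]≤n (pred[n]≢n 1≤n) nil , inj₂ (refl , refl)

  reducedTail-chain : ∀ {n} z x hs {p q} → 1 ≤ n → SamePair z x (p , q) → x ≤ n → x ≢ z → Ascending z hs → lastFrom z hs ≡ n →
    (∀ h hs′ → hs ≡ h ∷ hs′ → x ≤ h) →
    Chain n p q (reducedTail n z x hs) × IsFinal n (finalState p q (reducedTail n z x hs))
  reducedTail-chain {n} z x [] 1≤n o x≤n x≢z _ refl _ = zigzag-chain x z [] 1≤n o (ℕ.≤∧≢⇒< x≤n x≢z) tt refl
  reducedTail-chain {n} z x (h ∷ hs) 1≤n o x≤n x≢z (z<h , asc) lst x≤next with x ℕ.≟ h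
  ... | yes refl = zigzag-chain z x hs 1≤n (samePair-swap o) z<h asc lst
  ... | no x≢h with zigzag-chain z h hs 1≤n (inj₂ (refl , refl)) z<h asc lst
  ...   | chain , final =
    cons o (ℕ.≤∧≢⇒< (x≤next h hs refl) x≢h) (ascending-≤-last h hs asc lst) (ℕ.>⇒≢ z<h) chain , final

  zigzag-from≥ : ∀ {n} c d hs → c < d → Ascending d hs → All (λ t → c ≤ from t) (zigzag n c d hs)
  zigzag-from≥ {n} c d (e ∷ hs) c<d (d<e , asc) = ℕ.≤-refl ∷ All.map (ℕ.≤-trans (ℕ.<⇒≤ c<d)) (zigzag-from≥ {n} d e hs d<e asc)
  zigzag-from≥ {n} c d [] c<d _ with c ℕ.≟ pred n
  ... | yes _ = []
  ... | no _  = ℕ.≤-refl ∷ []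

  zigzag-shape : ∀ {n} b c hs → Ascending c hs → All (λ t → (from t ≡ b × fixed t ≡ c) ⊎ c ≤ from t) (zigzag n b c hs)
  zigzag-shape {n} b c (d ∷ hs) (c<d , asc) = inj₁ (refl , refl) ∷ All.map inj₂ (zigzag-from≥ {n} c d hs c<d asc)
  zigzag-shape {n} b c [] _ with b ℕ.≟ pred n
  ... | yes _ = []
  ... | no _  = inj₁ (refl , refl) ∷ []

  shape⇒coherent : ∀ {a b c} t → (from t ≡ b × fixed t ≡ c) ⊎ c ≤ from t → CoherentSteps (step a c b) t
  shape⇒coherent t (inj₁ (_ , fixed≡c)) _   = inj₁ (sym fixed≡c)
  shape⇒coherent t (inj₂ c≤from)       from<c = ⊥-elim (ℕ.<⇒≱ from<c c≤from)

  zigzag-coherent : ∀ {n} a b hs → Ascending b hs → AllPairs CoherentSteps (zigzag n a b hs)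
  zigzag-coherent {n} a b (c ∷ hs) (b<c , asc) =
    All.map (λ {t} → shape⇒coherent {a} {b} {c} t) (zigzag-shape {n} b c hs asc) ∷ zigzag-coherent {n} b c hs asc
  zigzag-coherent {n} a b [] _ with a ℕ.≟ pred n
  ... | yes _ = []
  ... | no _  = [] ∷ []

  reducedTail-coherent : ∀ {n} z x hs → Ascending z hs → AllPairs CoherentSteps (reducedTail n z x hs)
  reducedTail-coherent {n} z x [] _ with x ℕ.≟ pred n
  ... | yes _ = []
  ... | no _  = [] ∷ []
  reducedTail-coherent {n} z x (h ∷ hs) (z<h , asc) with x ℕ.≟ h
  ... | yes refl = zigzag-coherent {n} z x hs asc
  ... | no _     = All.map (λ {t} → shape⇒coherent {x} {z} {h} t) (zigzag-shape {n} z h hs asc) ∷ zigzag-coherent {n} z h hs asc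

  coherent-transfer : ∀ {n s t t′} → to s ≤ n → CoherentSteps s t′ → from t′ ≡ from t →
    fixed t′ ≡ fixed t ⊎ fixed t′ ≡ suc n → CoherentSteps s t
  coherent-transfer {n} {s} {t} {t′} to≤n coh from≡ fixed≡ from<to with coh (subst (_< to s) (sym from≡) from<to)
  ... | inj₂ e = inj₂ (trans (sym from≡) e)
  ... | inj₁ e with fixed≡
  ...   | inj₁ f = inj₁ (trans e f)
  ...   | inj₂ f = ⊥-elim (ℕ.<⇒≢ (s≤s to≤n) (trans e f))

  zigzag-across : ∀ {n s} a b hs → to s ≤ n → All (CoherentSteps s) (topTail (suc n) a (b ∷ hs)) →
    All (CoherentSteps s) (zigzag n a b hs)
  zigzag-across {n} {s} a b (c ∷ hs) to≤n (coh ∷ cohs) =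
    coherent-transfer {n} {s} {step a c b} {step a b (suc n)} to≤n coh refl (inj₂ refl) ∷ zigzag-across {n} {s} b c hs to≤n cohs
  zigzag-across {n} {s} a b [] to≤n (coh ∷ _) with a ℕ.≟ pred n
  ... | yes _ = []
  ... | no _  = coherent-transfer {n} {s} {step a (pred n) b} {step a b (suc n)} to≤n coh refl (inj₂ refl) ∷ []

  reducedTail-across : ∀ {n s} z x hs → to s ≤ n → All (CoherentSteps s) (step x (suc n) z ∷ topTail (suc n) z hs) →
    All (CoherentSteps s) (reducedTail n z x hs)
  reducedTail-across {n} {s} z x [] to≤n (coh ∷ _) with x ℕ.≟ pred n
  ... | yes _ = []
  ... | no _  = coherent-transfer {n} {s} {step x (pred n) z} {step x (suc n) z} to≤n coh refl (inj₁ refl) ∷ []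
  reducedTail-across {n} {s} z x (h ∷ hs) to≤n (coh ∷ cohs) with x ℕ.≟ h
  ... | yes refl = zigzag-across {n} {s} z x hs to≤n cohs
  ... | no _     = coherent-transfer {n} {s} {step x h z} {step x (suc n) z} to≤n coh refl (inj₁ refl) ∷ zigzag-across {n} {s} z h hs to≤n cohs

  reducedTail-across-all : ∀ {n} P z x hs → All (ValidStep n) P →
    CoherentAcross P (step x (suc n) z ∷ topTail (suc n) z hs) → CoherentAcross P (reducedTail n z x hs)
  reducedTail-across-all []      z x hs []              []              = []
  reducedTail-across-all {n} (s ∷ P) z x hs (valid ∷ valids) (coh ∷ cohs) =
    reducedTail-across {n} {s} z x hs (ValidStep.to≤n valid) coh ∷ reducedTail-across-all P z x hs valids cohs

  _∈ₛ_ : ℕ → ℕ × ℕ → Set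
  e ∈ₛ p = e ≡ proj₁ p ⊎ e ≡ proj₂ p

  samePair-∉ : ∀ {a i e p q} → SamePair a i (p , q) → e ≢ a → e ≢ i → ¬ e ∈ₛ (p , q)
  samePair-∉ (inj₁ (refl , refl)) e≢a e≢i (inj₁ e≡) = e≢a e≡
  samePair-∉ (inj₁ (refl , refl)) e≢a e≢i (inj₂ e≡) = e≢i e≡
  samePair-∉ (inj₂ (refl , refl)) e≢a e≢i (inj₁ e≡) = e≢i e≡
  samePair-∉ (inj₂ (refl , refl)) e≢a e≢i (inj₂ e≡) = e≢a e≡

  ∈ₛ[1,2]⇒≤2 : ∀ {e} → e ∈ₛ (1 , 2) → e ≤ 2
  ∈ₛ[1,2]⇒≤2 (inj₁ refl) = s≤s z≤n
  ∈ₛ[1,2]⇒≤2 (inj₂ refl) = ℕ.≤-refl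

  stays-in-state : ∀ {n} P {u v e} → Chain n u v P → e ∈ₛ (u , v) → All (λ s → from s ≢ e) P → e ∈ₛ finalState u v P
  stays-in-state []               nil                  e∈ _           = e∈
  stays-in-state (step i j a ∷ P) {u} {v} {e} (cons o _ _ _ c) e∈ (i≢e ∷ rest) = stays-in-state P c (inj₁ (e≡a o e∈)) rest
    where
      e≡a : SamePair a i (u , v) → e ∈ₛ (u , v) → e ≡ a
      e≡a (inj₁ (a≡u , _))   (inj₁ e≡u) = trans e≡u (sym a≡u)
      e≡a (inj₁ (_ , i≡v))   (inj₂ e≡v) = ⊥-elim (i≢e (trans i≡v (sym e≡v)))
      e≡a (inj₂ (_ , i≡u))   (inj₁ e≡u) = ⊥-elim (i≢e (trans i≡u (sym e≡u)))
      e≡a (inj₂ (a≡v , _))   (inj₂ e≡v) = trans e≡v (sym a≡v)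

  entered-state : ∀ {n} P {u v e} → Chain n u v P → e ∈ₛ finalState u v P →
    e ∈ₛ (u , v) ⊎ (Σ (List EStep) λ P₁ → Σ EStep λ s → Σ (List EStep) λ P₂ →
       P ≡ P₁ ++ s ∷ P₂ × to s ≡ e × Chain n (fixed s) (to s) P₂ × finalState (fixed s) (to s) P₂ ≡ finalState u v P)
  entered-state []               nil              e∈ = inj₁ e∈
  entered-state (step i j a ∷ P) (cons o _ _ _ c) e∈ with entered-state P c e∈
  ... | inj₁ (inj₂ refl) = inj₂ ([] , step i j a , P , refl , refl , c , refl)
  ... | inj₁ (inj₁ refl) = inj₁ (samePair-∈₁ o)
  ... | inj₂ (P₁ , s , P₂ , refl , to≡e , c₂ , final≡) = inj₂ (step i j a ∷ P₁ , s , P₂ , refl , to≡e , c₂ , final≡)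

  module AcrossTopEntry (n : ℕ) (P : List EStep) (x z : ℕ) (hs : List ℕ) (valid : All (ValidStep n) P)
                        (across : CoherentAcross P (step x (suc n) z ∷ topTail (suc n) z hs)) where

    fixed≡from : ∀ {s t₀} → s ∈ P → t₀ ∈ step x (suc n) z ∷ topTail (suc n) z hs → fixed t₀ ≡ suc n →
      from t₀ < to s → fixed s ≡ from t₀
    fixed≡from {s} s∈ t₀∈ fixed≡N from<to with All.lookup (All.lookup across s∈) t₀∈ from<to
    ... | inj₁ e = ⊥-elim (ℕ.<⇒≢ (s≤s (ValidStep.to≤n (All.lookup valid s∈))) (trans e fixed≡N))
    ... | inj₂ e = sym e

    never-leaves : ∀ {t₀} → t₀ ∈ step x (suc n) z ∷ topTail (suc n) z hs → fixed t₀ ≡ suc n →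
      All (λ s → from s ≢ from t₀) P
    never-leaves {t₀} t₀∈ fixed≡N = All.tabulate leaves
      where
        leaves : ∀ {s} → s ∈ P → from s ≢ from t₀
        leaves {s} s∈ e = ValidStep.from≢fixed valid-s (trans e (sym (fixed≡from s∈ t₀∈ fixed≡N (subst (_< to s) e (ValidStep.from<to valid-s)))))
          where valid-s = All.lookup valid s∈

  -- If h < x, coherence with the tail step h → h₂ forces the step of P that brought in x to keep h fixed,
  -- and h is never removed afterwards; so h would be one of z < h < x.
  replaced≤next : ∀ n P x z hs → All (ValidStep n) P → CoherentAcross P (step x (suc n) z ∷ topTail (suc n) z hs) →
    Chain n 1 2 P → SamePair z x (finalState 1 2 P) → 1 ≤ z → x ≤ n → Ascending z hs → lastFrom z hs ≡ n →
    ∀ h hs′ → hs ≡ h ∷ hs′ → x ≤ h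
  replaced≤next n P x z hs valid across chain pair 1≤z x≤n asc lst h hs′ refl with x ℕ.≤? h
  replaced≤next n P x z hs valid across chain pair 1≤z x≤n asc lst h hs′ refl | yes x≤h = x≤h
  replaced≤next n P x z hs valid across chain pair 1≤z x≤n asc lst h [] refl | no x≰h = ⊥-elim (x≰h (subst (x ≤_) (sym lst) x≤n))
  replaced≤next n P x z hs valid across chain pair 1≤z x≤n (z<h , _) lst h (h₂ ∷ hs″) refl | no x≰h
    with entered-state P chain (samePair-∈₂ pair)
  ... | inj₁ x∈[1,2] = ⊥-elim (ℕ.<⇒≱ (ℕ.≤-<-trans (ℕ.≤-<-trans 1≤z z<h) (ℕ.≰⇒> x≰h)) (∈ₛ[1,2]⇒≤2 x∈[1,2]))
  ... | inj₂ (P₁ , s , P₂ , refl , to≡x , chain₂ , final≡) =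
    ⊥-elim (samePair-∉ pair (ℕ.>⇒≢ z<h) (ℕ.<⇒≢ h<x) (subst (h ∈ₛ_) final≡ h-stays))
    where
      open AcrossTopEntry n (P₁ ++ s ∷ P₂) x z (h ∷ h₂ ∷ hs″) valid across
      h<x = ℕ.≰⇒> x≰h
      fixed-s≡h : fixed s ≡ h
      fixed-s≡h = fixed≡from (∈-++⁺ʳ P₁ (here refl)) (there (there (here refl))) refl (subst (h <_) (sym to≡x) h<x)
      h-stays : h ∈ₛ finalState (fixed s) (to s) P₂
      h-stays = stays-in-state P₂ chain₂ (inj₁ (sym fixed-s≡h)) (All.++⁻ʳ (s ∷ []) (All.++⁻ʳ P₁ (never-leaves (there (there (here refl))) refl)))

  -- Here the last step of P is (i → z ; x); the step of P that brought in x > z must have kept z fixed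
  -- (coherence with the tail step z → x), and z is never removed, so z ∈ {x , i}: impossible.
  replaced≡next-unordered-impossible : ∀ n P x z hs′ → All (ValidStep n) P →
    CoherentAcross P (step x (suc n) z ∷ topTail (suc n) z (x ∷ hs′)) →
    Chain n 1 2 P → z < x → z ≡ proj₂ (finalState 1 2 P) → x ≡ proj₁ (finalState 1 2 P) → ⊥
  replaced≡next-unordered-impossible n P x z hs′ valid across chain z<x z≡ x≡ with initLast P
  ... | [] = ℕ.<⇒≱ z<x (subst₂ _≤_ (sym x≡) (sym z≡) (s≤s z≤n))
  ... | P₀ ∷ʳ′ last-step with chain-++⁻ P₀ chain
  ...   | chain₀ , cons {i = i} {j = j} {a = a} o i<j j≤n j≢a nil = result
    where
      open AcrossTopEntry n (P₀ ++ [ step i j a ]) x z (x ∷ hs′) valid across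
      z≡j : z ≡ j
      z≡j = trans z≡ (cong proj₂ (finalState-++ 1 2 P₀ [ step i j a ]))
      x≡a : x ≡ a
      x≡a = trans x≡ (cong proj₁ (finalState-++ 1 2 P₀ [ step i j a ]))
      x∈final₀ : x ∈ₛ finalState 1 2 P₀
      x∈final₀ = [ (λ e → inj₁ (trans x≡a e)) , (λ e → inj₂ (trans x≡a e)) ]′ (samePair-∈₁ o)
      z∉final₀ : ¬ z ∈ₛ finalState 1 2 P₀
      z∉final₀ = samePair-∉ o (λ e → ℕ.<⇒≢ z<x (trans e (sym x≡a))) (λ e → ℕ.>⇒≢ i<j (trans (sym z≡j) e))
      result : ⊥
      result with entered-state P₀ chain₀ x∈final₀
      ... | inj₁ x∈[1,2] =
        ℕ.<⇒≱ (ℕ.≤-<-trans (subst (2 ≤_) (sym z≡j) (ℕ.≤-<-trans (ValidStep.1≤from (All.lookup valid (∈-++⁺ʳ P₀ (here refl)))) i<j)) z<x)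
              (∈ₛ[1,2]⇒≤2 x∈[1,2])
      ... | inj₂ (P₁ , s , P₂ , refl , to≡x , chain₂ , final≡) = z∉final₀ (subst (z ∈ₛ_) final≡ z-stays)
        where
          fixed-s≡z : fixed s ≡ z
          fixed-s≡z = fixed≡from (∈-++⁺ˡ (∈-++⁺ʳ P₁ (here refl))) (there (here refl)) refl (subst (z <_) (sym to≡x) z<x)
          z-stays : z ∈ₛ finalState (fixed s) (to s) P₂
          z-stays = stays-in-state P₂ chain₂ (inj₁ (sym fixed-s≡z))
                      (All.++⁻ʳ (s ∷ []) (All.++⁻ʳ P₁ (All.++⁻ˡ (P₁ ++ s ∷ P₂) (never-leaves (there (here refl)) refl))))

  replaced≡next⇒ordered : ∀ n P x z hs → All (ValidStep n) P → CoherentAcross P (step x (suc n) z ∷ topTail (suc n) z hs) →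
    Chain n 1 2 P → SamePair z x (finalState 1 2 P) → Ascending z hs →
    ∀ h hs′ → hs ≡ h ∷ hs′ → x ≡ h → proj₁ (finalState 1 2 P) ≡ z × proj₂ (finalState 1 2 P) ≡ x
  replaced≡next⇒ordered n P x z hs valid across chain (inj₁ (z≡ , x≡)) asc h hs′ _ _ = sym z≡ , sym x≡
  replaced≡next⇒ordered n P x z .(x ∷ hs′) valid across chain (inj₂ (z≡ , x≡)) (z<x , _) .x hs′ refl refl =
    ⊥-elim (replaced≡next-unordered-impossible n P x z hs′ valid across chain z<x z≡ x≡)

module Arrangements (C : ℕ → ℚ) where

  open import Data.Nat.Base using (_≤_)
  open AffineLines
  open StepChains using (SamePair; finalState)

  opaque
    F : (ℕ → ℚ) → ℕ → ℚ → ℚ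
    F Ω m t = line (Ω m) (C m) t

    F-unfold : ∀ Ω m t → F Ω m t ≡ Ω m ℚ.+ C m ℚ.* t
    F-unfold Ω m t = refl

    F-cong : ∀ {Ω Ω′ m t} → Ω′ m ≡ Ω m → F Ω′ m t ≡ F Ω m t
    F-cong {m = m} {t} e = cong (λ w → line w (C m) t) e

    F-<-between : ∀ Ω p q {t₁ t t₂} → t₁ ℚ.≤ t → t ℚ.≤ t₂ → F Ω q t₁ ℚ.≤ F Ω p t₁ → F Ω q t₂ ℚ.≤ F Ω p t₂ →
      (t ℚ.< t₂ × F Ω q t₁ ℚ.< F Ω p t₁) ⊎ (t₁ ℚ.< t × F Ω q t₂ ℚ.< F Ω p t₂) → F Ω q t ℚ.< F Ω p t
    F-<-between Ω p q = line-<-between {Ω p} {C p} {Ω q} {C q}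

    F-steeper-after : ∀ Ω p q {t₁ t} → C q ℚ.< C p → F Ω q t₁ ℚ.≤ F Ω p t₁ → t₁ ℚ.< t → F Ω q t ℚ.< F Ω p t
    F-steeper-after Ω p q = steeper-above-after {Ω p} {C p} {Ω q} {C q}

    F-steeper-after′ : ∀ Ω p q {t₁ t} → C q ℚ.< C p → F Ω q t₁ ℚ.< F Ω p t₁ → t₁ ℚ.≤ t → F Ω q t ℚ.< F Ω p t
    F-steeper-after′ Ω p q = steeper-above-after′ {Ω p} {C p} {Ω q} {C q}

    F-flatter-before : ∀ Ω p q {t₁ t} → C p ℚ.< C q → F Ω q t₁ ℚ.≤ F Ω p t₁ → t ℚ.< t₁ → F Ω q t ℚ.< F Ω p t
    F-flatter-before Ω p q = flatter-above-before {Ω p} {C p} {Ω q} {C q}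

    F-meet : ∀ Ω p q t₁ → C q ℚ.< C p → F Ω p t₁ ℚ.< F Ω q t₁ → Σ ℚ λ σ → t₁ ℚ.< σ × F Ω p σ ≡ F Ω q σ
    F-meet Ω p q t₁ = steeper-meets-after (Ω p) (C p) (Ω q) (C q) t₁

  OthersBelow₂ : ℕ → (ℕ → ℚ) → ℚ → ℕ → ℕ → ℚ → Set
  OthersBelow₂ n Ω t p q V = ∀ m → 1 ≤ m → m ≤ n → m ≢ p → m ≢ q → F Ω m t ℚ.< V

  OthersBelow₃ : ℕ → (ℕ → ℚ) → ℚ → ℕ → ℕ → ℕ → ℚ → Set
  OthersBelow₃ n Ω t p q r V = ∀ m → 1 ≤ m → m ≤ n → m ≢ p → m ≢ q → m ≢ r → F Ω m t ℚ.< V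

  TopTwo : ℕ → (ℕ → ℚ) → ℚ → ℕ → ℕ → Set
  TopTwo n Ω t u v = F Ω v t ℚ.< F Ω u t × OthersBelow₂ n Ω t u v (F Ω v t)

  TopTie : ℕ → (ℕ → ℚ) → ℚ → ℕ → ℕ → Set
  TopTie n Ω t u v = F Ω u t ≡ F Ω v t × OthersBelow₂ n Ω t u v (F Ω u t)

  SecondTie : ℕ → (ℕ → ℚ) → ℚ → ℕ → ℕ → ℕ → Set
  SecondTie n Ω t i j a = F Ω i t ℚ.< F Ω a t × F Ω i t ≡ F Ω j t × OthersBelow₃ n Ω t a i j (F Ω i t)

  TopTwoOn : ℕ → (ℕ → ℚ) → ℚ → ℚ → ℕ → ℕ → Set
  TopTwoOn n Ω lo θ u v = ∀ t → lo ℚ.< t → t ℚ.≤ θ → TopTwo n Ω t u v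

  KeptOrSwapped : ℕ → (ℕ → ℚ) → ℚ → ℚ → ℕ → ℕ → ℕ → ℕ → Set
  KeptOrSwapped n Ω θL θR u v a i = (a ≡ u × i ≡ v) ⊎ (a ≡ v × i ≡ u × Σ ℚ λ σ → θL ℚ.< σ × σ ℚ.< θR × TopTie n Ω σ u v)

  -- Realises n Ω lo u v S: sweeping t upwards from lo, the two highest of the lines 1 … n are first u above v,
  -- possibly swap (a tie at σ), and then change exactly by the steps of S, each (i → j ; a) being a tie of i and j
  -- just below a; at the end n lies above pred n.
  data Realises (n : ℕ) (Ω : ℕ → ℚ) : ℚ → ℕ → ℕ → List EStep → Set where
    fin  : ∀ {lo u v} (θL θR : ℚ) → lo ℚ.< θL → θL ℚ.≤ θR → TopTwoOn n Ω lo θL u v →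
           TopTwo n Ω θR n (pred n) → KeptOrSwapped n Ω θL θR u v n (pred n) → Realises n Ω lo u v []
    cons : ∀ {lo u v i j a S} (θL θR t : ℚ) → lo ℚ.< θL → θL ℚ.≤ θR → θR ℚ.< t →
           TopTwoOn n Ω lo θL u v → TopTwo n Ω θR a i → KeptOrSwapped n Ω θL θR u v a i →
           SecondTie n Ω t i j a → Realises n Ω t a j S → Realises n Ω lo u v (step i j a ∷ S)

  data RealisesPrefix (n : ℕ) (Ω : ℕ → ℚ) : ℚ → ℕ → ℕ → List EStep → ℚ → ℕ → ℕ → Set where
    nil  : ∀ {lo u v} → RealisesPrefix n Ω lo u v [] lo u v
    cons : ∀ {lo u v i j a S lo′ u′ v′} (θL θR t : ℚ) → lo ℚ.< θL → θL ℚ.≤ θR → θR ℚ.< t →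
           TopTwoOn n Ω lo θL u v → TopTwo n Ω θR a i → KeptOrSwapped n Ω θL θR u v a i →
           SecondTie n Ω t i j a → RealisesPrefix n Ω t a j S lo′ u′ v′ → RealisesPrefix n Ω lo u v (step i j a ∷ S) lo′ u′ v′

  realises-++⁻ : ∀ {n Ω} P {S lo u v} → Realises n Ω lo u v (P ++ S) →
    Σ ℚ λ lo′ → Σ ℕ λ u′ → Σ ℕ λ v′ → RealisesPrefix n Ω lo u v P lo′ u′ v′ × Realises n Ω lo′ u′ v′ S
  realises-++⁻ []      r = _ , _ , _ , nil , r
  realises-++⁻ (_ ∷ P) (cons θL θR t a b c d e f g r) with realises-++⁻ P r
  ... | lo′ , u′ , v′ , prefix , rest = lo′ , u′ , v′ , cons θL θR t a b c d e f g prefix , rest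

  realises-++⁺ : ∀ {n Ω P S lo u v lo′ u′ v′} → RealisesPrefix n Ω lo u v P lo′ u′ v′ → Realises n Ω lo′ u′ v′ S →
    Realises n Ω lo u v (P ++ S)
  realises-++⁺ nil                                 r = r
  realises-++⁺ (cons θL θR t a b c d e f g prefix) r = cons θL θR t a b c d e f g (realises-++⁺ prefix r)

  realisesPrefix-≤ : ∀ {n Ω P lo u v lo′ u′ v′} → RealisesPrefix n Ω lo u v P lo′ u′ v′ → lo ℚ.≤ lo′
  realisesPrefix-≤ nil = ℚ.≤-refl
  realisesPrefix-≤ (cons θL θR t lo<θL θL≤θR θR<t _ _ _ _ prefix) =
    ℚ.≤-trans (ℚ.<⇒≤ (ℚ.<-trans lo<θL (ℚ.≤-<-trans θL≤θR θR<t))) (realisesPrefix-≤ prefix)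

  realisesPrefix-final : ∀ {n Ω P lo u v lo′ u′ v′} → RealisesPrefix n Ω lo u v P lo′ u′ v′ → finalState u v P ≡ (u′ , v′)
  realisesPrefix-final nil                            = refl
  realisesPrefix-final (cons _ _ _ _ _ _ _ _ _ _ prefix) = realisesPrefix-final prefix

  topTwo-≤second : ∀ {n Ω t u v w} → 1 ≤ w → w ≤ n → w ≢ u → TopTwo n Ω t u v → F Ω w t ℚ.≤ F Ω v t
  topTwo-≤second {v = v} {w} 1≤w w≤n w≢u (_ , others) with w ℕ.≟ v
  ... | yes refl = ℚ.≤-refl
  ... | no w≢v   = ℚ.<⇒≤ (others w 1≤w w≤n w≢u w≢v)

  topTwo-<top : ∀ {n Ω t u v m} → TopTwo n Ω t u v → 1 ≤ m → m ≤ n → m ≢ u → F Ω m t ℚ.< F Ω u t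
  topTwo-<top top 1≤m m≤n m≢u = ℚ.≤-<-trans (topTwo-≤second 1≤m m≤n m≢u top) (proj₁ top)

  topTie-≤top : ∀ {n Ω t u v w} → 1 ≤ w → w ≤ n → TopTie n Ω t u v → F Ω w t ℚ.≤ F Ω u t
  topTie-≤top {u = u} {v} {w} 1≤w w≤n (tie , others) with w ℕ.≟ u | w ℕ.≟ v
  ... | yes refl | _        = ℚ.≤-refl
  ... | no _     | yes refl = ℚ.≤-reflexive (sym tie)
  ... | no w≢u   | no w≢v   = ℚ.<⇒≤ (others w 1≤w w≤n w≢u w≢v)

  secondTie-≤second : ∀ {n Ω t i j a w} → 1 ≤ w → w ≤ n → w ≢ a → SecondTie n Ω t i j a → F Ω w t ℚ.≤ F Ω i t
  secondTie-≤second {i = i} {j} {w = w} 1≤w w≤n w≢a (_ , tie , others) with w ℕ.≟ i | w ℕ.≟ j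
  ... | yes refl | _        = ℚ.≤-refl
  ... | no _     | yes refl = ℚ.≤-reflexive (sym tie)
  ... | no w≢i   | no w≢j   = ℚ.<⇒≤ (others w 1≤w w≤n w≢a w≢i w≢j)

  secondTie-<top : ∀ {n Ω t i j a m} → SecondTie n Ω t i j a → 1 ≤ m → m ≤ n → m ≢ a → F Ω m t ℚ.< F Ω a t
  secondTie-<top tie 1≤m m≤n m≢a = ℚ.≤-<-trans (secondTie-≤second 1≤m m≤n m≢a tie) (proj₁ tie)

  topTwo-after-step : ∀ {n Ω t₀ θ i j a} → i ≢ a → i ≢ j → SecondTie n Ω t₀ i j a → TopTwo n Ω θ a j → t₀ ℚ.< θ →
    TopTwoOn n Ω t₀ θ a j
  topTwo-after-step {n} {Ω} {t₀} {θ} {i} {j} {a} i≢a i≢j (i<a , i≡j , others₀) (j<a , others) t₀<θ t t₀<t t≤θ = j<a′ , others′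
    where
      j<a′ : F Ω j t ℚ.< F Ω a t
      j<a′ = F-<-between Ω a j (ℚ.<⇒≤ t₀<t) t≤θ (ℚ.<⇒≤ (subst (ℚ._< F Ω a t₀) i≡j i<a)) (ℚ.<⇒≤ j<a) (inj₂ (t₀<t , j<a))
      others′ : OthersBelow₂ n Ω t a j (F Ω j t)
      others′ m 1≤m m≤n m≢a m≢j with m ℕ.≟ i
      ... | yes refl = F-<-between Ω j m (ℚ.<⇒≤ t₀<t) t≤θ (ℚ.≤-reflexive i≡j) (ℚ.<⇒≤ (others m 1≤m m≤n i≢a i≢j))
                         (inj₂ (t₀<t , others m 1≤m m≤n i≢a i≢j))
      ... | no m≢i   = F-<-between Ω j m (ℚ.<⇒≤ t₀<t) t≤θ (ℚ.<⇒≤ (subst (F Ω m t₀ ℚ.<_) i≡j (others₀ m 1≤m m≤n m≢a m≢i m≢j)))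
                         (ℚ.<⇒≤ (others m 1≤m m≤n m≢a m≢j)) (inj₂ (t₀<t , others m 1≤m m≤n m≢a m≢j))

  secondTie-pair-below : ∀ {n Ω t i j a x y} → SecondTie n Ω t i j a → 1 ≤ x → x ≤ n → 1 ≤ y → y ≤ n → x ≢ y →
    ¬ SamePair x y (a , i) → ¬ SamePair x y (a , j) → F Ω x t ℚ.+ F Ω y t ℚ.< F Ω a t ℚ.+ F Ω i t
  secondTie-pair-below {n} {Ω} {t} {i} {j} {a} {x} {y} tie@(i<a , _ , others) 1≤x x≤n 1≤y y≤n x≢y not-ai not-aj
    with x ℕ.≟ a | y ℕ.≟ a
  ... | yes refl | yes refl = ⊥-elim (x≢y refl)
  ... | yes refl | no y≢a   =
    ℚ.+-monoʳ-< (F Ω x t) (others y 1≤y y≤n y≢a (λ e → not-ai (inj₁ (refl , e))) (λ e → not-aj (inj₁ (refl , e))))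
  ... | no x≢a   | yes refl = subst (F Ω x t ℚ.+ F Ω a t ℚ.<_) (ℚ.+-comm (F Ω i t) (F Ω a t))
    (ℚ.+-monoˡ-< (F Ω a t) (others x 1≤x x≤n x≢a (λ e → not-ai (inj₂ (e , refl))) (λ e → not-aj (inj₂ (e , refl)))))
  ... | no x≢a   | no y≢a   = subst (F Ω x t ℚ.+ F Ω y t ℚ.<_) (ℚ.+-comm (F Ω i t) (F Ω a t))
    (ℚ.+-mono-≤-< (secondTie-≤second 1≤x x≤n x≢a tie) (ℚ.≤-<-trans (secondTie-≤second 1≤y y≤n y≢a tie) i<a))

  ≤suc⇒≤∨≡ : ∀ {m n} → m ≤ suc n → m ≤ n ⊎ m ≡ suc n
  ≤suc⇒≤∨≡ m≤1+n with ℕ.m≤n⇒m<n∨m≡n m≤1+n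
  ... | inj₁ m<1+n = inj₁ (ℕ.≤-pred m<1+n)
  ... | inj₂ m≡1+n = inj₂ m≡1+n

  othersBelow₂-extend : ∀ {n Ω Ω′ t p q V} → (∀ m → m ≤ n → Ω′ m ≡ Ω m) → OthersBelow₂ n Ω t p q V →
    (suc n ≢ p → suc n ≢ q → F Ω′ (suc n) t ℚ.< V) → OthersBelow₂ (suc n) Ω′ t p q V
  othersBelow₂-extend {V = V} agree others new m 1≤m m≤1+n m≢p m≢q with ≤suc⇒≤∨≡ m≤1+n
  ... | inj₁ m≤n  = subst (ℚ._< V) (sym (F-cong (agree m m≤n))) (others m 1≤m m≤n m≢p m≢q)
  ... | inj₂ refl = new m≢p m≢q

  othersBelow₃-extend : ∀ {n Ω Ω′ t p q r V} → (∀ m → m ≤ n → Ω′ m ≡ Ω m) → OthersBelow₃ n Ω t p q r V →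
    (suc n ≢ p → suc n ≢ q → suc n ≢ r → F Ω′ (suc n) t ℚ.< V) → OthersBelow₃ (suc n) Ω′ t p q r V
  othersBelow₃-extend {V = V} agree others new m 1≤m m≤1+n m≢p m≢q m≢r with ≤suc⇒≤∨≡ m≤1+n
  ... | inj₁ m≤n  = subst (ℚ._< V) (sym (F-cong (agree m m≤n))) (others m 1≤m m≤n m≢p m≢q m≢r)
  ... | inj₂ refl = new m≢p m≢q m≢r

  data Bounded (n : ℕ) : ℕ → ℕ → List EStep → Set where
    bnil  : ∀ {u v} → u ≤ n → v ≤ n → Bounded n u v []
    bcons : ∀ {u v i j a S} → u ≤ n → v ≤ n → a ≤ n → i ≤ n → j ≤ n → Bounded n a j S → Bounded n u v (step i j a ∷ S)

  -- A new line that stays below two distinct old lines up to time K does not disturb the top two before K.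
  module AddLineBelow (n : ℕ) (Ω Ω′ : ℕ → ℚ) (agree : ∀ m → m ≤ n → Ω′ m ≡ Ω m)
                      (x z : ℕ) (1≤x : 1 ≤ x) (x≤n : x ≤ n) (1≤z : 1 ≤ z) (z≤n : z ≤ n) (x≢z : x ≢ z)
                      (K : ℚ) (below : ∀ t → t ℚ.≤ K → F Ω′ (suc n) t ℚ.< F Ω x t × F Ω′ (suc n) t ℚ.< F Ω z t) where

    F-agree : ∀ {m t} → m ≤ n → F Ω′ m t ≡ F Ω m t
    F-agree {m} m≤n = F-cong (agree m m≤n)

    new-below-other : ∀ {t u} → t ℚ.≤ K → Σ ℕ λ w → 1 ≤ w × w ≤ n × w ≢ u × F Ω′ (suc n) t ℚ.< F Ω w t
    new-below-other {t} {u} t≤K with x ℕ.≟ u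
    ... | no x≢u   = x , 1≤x , x≤n , x≢u , proj₁ (below t t≤K)
    ... | yes refl = z , 1≤z , z≤n , (λ e → x≢z (sym e)) , proj₂ (below t t≤K)

    lift-topTwo : ∀ {t u v} → u ≤ n → v ≤ n → t ℚ.≤ K → TopTwo n Ω t u v → TopTwo (suc n) Ω′ t u v
    lift-topTwo {t} {u} {v} u≤n v≤n t≤K top@(v<u , others) with new-below-other {t} {u} t≤K
    ... | w , 1≤w , w≤n , w≢u , new<w =
      subst₂ ℚ._<_ (sym (F-agree v≤n)) (sym (F-agree u≤n)) v<u ,
      subst (OthersBelow₂ (suc n) Ω′ t u v) (sym (F-agree v≤n))
        (othersBelow₂-extend agree others (λ _ _ → ℚ.<-≤-trans new<w (topTwo-≤second 1≤w w≤n w≢u top)))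

    lift-topTie : ∀ {t u v} → u ≤ n → v ≤ n → t ℚ.≤ K → TopTie n Ω t u v → TopTie (suc n) Ω′ t u v
    lift-topTie {t} {u} {v} u≤n v≤n t≤K tie@(u≡v , others) with new-below-other {t} {u} t≤K
    ... | w , 1≤w , w≤n , w≢u , new<w =
      trans (F-agree u≤n) (trans u≡v (sym (F-agree v≤n))) ,
      subst (OthersBelow₂ (suc n) Ω′ t u v) (sym (F-agree u≤n))
        (othersBelow₂-extend agree others (λ _ _ → ℚ.<-≤-trans new<w (topTie-≤top 1≤w w≤n tie)))

    lift-secondTie : ∀ {t i j a} → i ≤ n → j ≤ n → a ≤ n → t ℚ.≤ K → SecondTie n Ω t i j a → SecondTie (suc n) Ω′ t i j a
    lift-secondTie {t} {i} {j} {a} i≤n j≤n a≤n t≤K tie@(i<a , i≡j , others) with new-below-other {t} {a} t≤K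
    ... | w , 1≤w , w≤n , w≢a , new<w =
      subst₂ ℚ._<_ (sym (F-agree i≤n)) (sym (F-agree a≤n)) i<a ,
      trans (F-agree i≤n) (trans i≡j (sym (F-agree j≤n))) ,
      subst (OthersBelow₃ (suc n) Ω′ t a i j) (sym (F-agree i≤n))
        (othersBelow₃-extend agree others (λ _ _ _ → ℚ.<-≤-trans new<w (secondTie-≤second 1≤w w≤n w≢a tie)))

    lift-topTwoOn : ∀ {lo θ u v} → u ≤ n → v ≤ n → θ ℚ.≤ K → TopTwoOn n Ω lo θ u v → TopTwoOn (suc n) Ω′ lo θ u v
    lift-topTwoOn u≤n v≤n θ≤K on t lo<t t≤θ = lift-topTwo u≤n v≤n (ℚ.≤-trans t≤θ θ≤K) (on t lo<t t≤θ)

    lift-keptOrSwapped : ∀ {θL θR u v a i} → u ≤ n → v ≤ n → θR ℚ.≤ K → KeptOrSwapped n Ω θL θR u v a i →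
      KeptOrSwapped (suc n) Ω′ θL θR u v a i
    lift-keptOrSwapped u≤n v≤n θR≤K (inj₁ kept) = inj₁ kept
    lift-keptOrSwapped u≤n v≤n θR≤K (inj₂ (a≡v , i≡u , σ , θL<σ , σ<θR , tie)) =
      inj₂ (a≡v , i≡u , σ , θL<σ , σ<θR , lift-topTie u≤n v≤n (ℚ.≤-trans (ℚ.<⇒≤ σ<θR) θR≤K) tie)

    lift-realisesPrefix : ∀ {P lo u v lo′ u′ v′} → Bounded n u v P → lo′ ℚ.≤ K →
      RealisesPrefix n Ω lo u v P lo′ u′ v′ → RealisesPrefix (suc n) Ω′ lo u v P lo′ u′ v′
    lift-realisesPrefix _ _ nil = nil
    lift-realisesPrefix (bcons u≤n v≤n a≤n i≤n j≤n bounded) lo′≤K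
                        (cons θL θR t lo<θL θL≤θR θR<t on top kept tie prefix) =
      cons θL θR t lo<θL θL≤θR θR<t (lift-topTwoOn u≤n v≤n θL≤K on) (lift-topTwo a≤n i≤n θR≤K top)
        (lift-keptOrSwapped u≤n v≤n θR≤K kept) (lift-secondTie i≤n j≤n a≤n t≤K tie) (lift-realisesPrefix bounded lo′≤K prefix)
      where
        t≤K  = ℚ.≤-trans (realisesPrefix-≤ prefix) lo′≤K
        θR≤K = ℚ.≤-trans (ℚ.<⇒≤ θR<t) t≤K
        θL≤K = ℚ.≤-trans θL≤θR θR≤K

-- Ω realises the path with the steepest line N deleted; we choose the intercept of N.
module AddSteepestLine (C : ℕ → ℚ) (n : ℕ) (2≤n : 2 ℕ.≤ n)
    (C-< : ∀ {p q} → 1 ℕ.≤ p → p ℕ.< q → q ℕ.≤ suc n → C p ℚ.< C q) (Ω : ℕ → ℚ) where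

  open import Data.Nat.Base using (_<_; _≤_)
  open AffineLines
  open StepChains
  open Arrangements C

  N : ℕ
  N = suc n

  1≤n : 1 ≤ n
  1≤n = ℕ.≤-trans (s≤s z≤n) 2≤n

  C<C[N] : ∀ {m} → 1 ≤ m → m ≤ n → C m ℚ.< C N
  C<C[N] 1≤m m≤n = C-< 1≤m (s≤s m≤n) ℕ.≤-refl

  C-<ₙ : ∀ {p q} → 1 ≤ p → p < q → q ≤ n → C p ℚ.< C q
  C-<ₙ 1≤p p<q q≤n = C-< 1≤p p<q (ℕ.m≤n⇒m≤1+n q≤n)

  ≤n⇒≢N : ∀ {m} → m ≤ n → m ≢ N
  ≤n⇒≢N m≤n = ℕ.<⇒≢ (s≤s m≤n)

  pred[n]<n : pred n < n
  pred[n]<n = ℕ.≤-reflexive (ℕ.suc-pred n {{ℕ.>-nonZero 1≤n}})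

  <pred[n] : ∀ {m} → m ≤ n → m ≢ n → m ≢ pred n → m < pred n
  <pred[n] m≤n m≢n m≢pred = ℕ.≤∧≢⇒< (ℕ.<⇒≤pred (ℕ.≤∧≢⇒< m≤n m≢n)) m≢pred

  ZigzagNext : ℚ → ℕ → ℕ → List ℕ → Set
  ZigzagNext σ a b []       = ⊤
  ZigzagNext σ a b (c ∷ hs) = Σ ℚ λ t → σ ℚ.< t × SecondTie n Ω t a c b × Realises n Ω t b c (zigzag n b c hs)

  zigzag-head : ∀ {ℓ} a b hs → a ≢ b → (hs ≡ [] → b ≡ n) → Realises n Ω ℓ a b (zigzag n a b hs) →
    Σ ℚ λ θL → Σ ℚ λ σ → ℓ ℚ.< θL × θL ℚ.< σ × TopTwoOn n Ω ℓ θL a b × TopTie n Ω σ a b × ZigzagNext σ a b hs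
  zigzag-head a b (c ∷ hs) a≢b _ (cons θL θR t _ _ _ _ _ (inj₁ (a≡a , _)) _ _) = ⊥-elim (a≢b (sym a≡a))
  zigzag-head a b (c ∷ hs) a≢b _ (cons θL θR t ℓ<θL _ θR<t on _ (inj₂ (_ , _ , σ , θL<σ , σ<θR , swap)) tie realised) =
    θL , σ , ℓ<θL , θL<σ , on , swap , t , ℚ.<-trans σ<θR θR<t , tie , realised
  zigzag-head a b [] a≢b b≡n realised with a ℕ.≟ pred n
  zigzag-head a b [] a≢b b≡n (fin θL θR _ _ _ _ (inj₁ (_ , b≡pred))) | yes _ = ⊥-elim (pred[n]≢n 1≤n (trans b≡pred (b≡n refl)))
  zigzag-head a b [] a≢b b≡n (fin θL θR ℓ<θL _ on _ (inj₂ (_ , _ , σ , θL<σ , _ , swap))) | yes _ = θL , σ , ℓ<θL , θL<σ , on , swap , tt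
  zigzag-head a b [] a≢b b≡n (cons θL θR t _ _ _ _ _ (inj₁ (a≡a , _)) _ _) | no _ = ⊥-elim (a≢b (sym a≡a))
  zigzag-head a b [] a≢b b≡n (cons θL θR t ℓ<θL _ _ on _ (inj₂ (_ , _ , σ , θL<σ , _ , swap)) _ _) | no _ = θL , σ , ℓ<θL , θL<σ , on , swap , tt

  topTwo-before-step : ∀ {θ t T z x y} → TopTwo n Ω θ z x → SecondTie n Ω t x y z → θ ℚ.≤ T → T ℚ.< t → TopTwo n Ω T z x
  topTwo-before-step (x<z , others) tie θ≤T T<t =
    F-<-between Ω _ _ θ≤T (ℚ.<⇒≤ T<t) (ℚ.<⇒≤ x<z) (ℚ.<⇒≤ (proj₁ tie)) (inj₁ (T<t , x<z)) ,
    λ m 1≤m m≤n m≢z m≢x → F-<-between Ω _ m θ≤T (ℚ.<⇒≤ T<t) (ℚ.<⇒≤ (others m 1≤m m≤n m≢z m≢x)) (secondTie-≤second 1≤m m≤n m≢z tie)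
                              (inj₁ (T<t , others m 1≤m m≤n m≢z m≢x))

  final-topTwo-persists : ∀ {θ T} → TopTwo n Ω θ n (pred n) → θ ℚ.≤ T → TopTwo n Ω T n (pred n)
  final-topTwo-persists (pred<n , others) θ≤T =
    F-steeper-after′ Ω n (pred n) (C-<ₙ (ℕ.pred-mono-≤ 2≤n) pred[n]<n ℕ.≤-refl) pred<n θ≤T ,
    λ m 1≤m m≤n m≢n m≢pred → F-steeper-after′ Ω (pred n) m (C-<ₙ 1≤m (<pred[n] m≤n m≢n m≢pred) (ℕ.<⇒≤ pred[n]<n))
                                (others m 1≤m m≤n m≢n m≢pred) θ≤T

  withTop : ℚ → ℕ → ℚ
  withTop w m = if ⌊ m ℕ.≟ N ⌋ then w else Ω m

  withTop-new : ∀ w → withTop w N ≡ w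
  withTop-new w with N ℕ.≟ N
  ... | yes _   = refl
  ... | no N≢N = ⊥-elim (N≢N refl)

  withTop-old : ∀ w m → m ≤ n → withTop w m ≡ Ω m
  withTop-old w m m≤n with m ℕ.≟ N
  ... | yes m≡N = ⊥-elim (≤n⇒≢N m≤n m≡N)
  ... | no _    = refl

  module WithIntercept (w : ℚ) where

    Ω′ : ℕ → ℚ
    Ω′ = withTop w

    F-agree : ∀ {m t} → m ≤ n → F Ω′ m t ≡ F Ω m t
    F-agree {m} m≤n = F-cong (withTop-old w m m≤n)

    new-above-after : ∀ {m t₁ t} → 1 ≤ m → m ≤ n → F Ω m t₁ ℚ.≤ F Ω′ N t₁ → t₁ ℚ.< t → F Ω m t ℚ.< F Ω′ N t
    new-above-after 1≤m m≤n m≤N t₁<t =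
      subst (ℚ._< _) (F-agree m≤n) (F-steeper-after Ω′ N _ (C<C[N] 1≤m m≤n) (subst (ℚ._≤ _) (sym (F-agree m≤n)) m≤N) t₁<t)

    new-above-after′ : ∀ {m t₁ t} → 1 ≤ m → m ≤ n → F Ω m t₁ ℚ.< F Ω′ N t₁ → t₁ ℚ.≤ t → F Ω m t ℚ.< F Ω′ N t
    new-above-after′ 1≤m m≤n m<N t₁≤t =
      subst (ℚ._< _) (F-agree m≤n) (F-steeper-after′ Ω′ N _ (C<C[N] 1≤m m≤n) (subst (ℚ._< _) (sym (F-agree m≤n)) m<N) t₁≤t)

    final-topTwo : ∀ {σ} → F Ω n σ ℚ.≤ F Ω′ N σ → (∀ m → 1 ≤ m → m < n → F Ω m σ ℚ.≤ F Ω n σ) →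
      TopTwo N Ω′ (σ ℚ.+ 1ℚ) N n
    final-topTwo {σ} n≤N m≤n-at-σ =
      subst (ℚ._< F Ω′ N (σ ℚ.+ 1ℚ)) (sym (F-agree ℕ.≤-refl)) (new-above-after 1≤n ℕ.≤-refl n≤N (p<p+1 σ)) ,
      othersBelow₂-extend (withTop-old w)
        (λ m 1≤m m≤n _ m≢n → subst (F Ω m (σ ℚ.+ 1ℚ) ℚ.<_) (sym (F-agree ℕ.≤-refl))
           (F-steeper-after Ω n m (C-<ₙ 1≤m (ℕ.≤∧≢⇒< m≤n m≢n) ℕ.≤-refl) (m≤n-at-σ m 1≤m (ℕ.≤∧≢⇒< m≤n m≢n)) (p<p+1 σ)))
        (λ N≢N _ → ⊥-elim (N≢N refl))

    mutual
      -- After the step (q → a ; N) at lo, N stays on top and a second until a and b swap in the reduced path.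
      realise-topTail : ∀ hs a b {ℓ lo p q} → 1 ≤ a → a < b → Ascending b hs → lastFrom b hs ≡ n →
        SecondTie n Ω ℓ p b a → Realises n Ω ℓ a b (zigzag n a b hs) → lo ℚ.< ℓ →
        q ≢ N → q ≢ a → SecondTie N Ω′ lo q a N → F Ω a ℓ ℚ.< F Ω′ N ℓ →
        Realises N Ω′ lo N a (topTail N a (b ∷ hs))
      realise-topTail hs a b {ℓ} {lo} 1≤a a<b asc lst tie realised lo<ℓ q≢N q≢a previous a<N
        with zigzag-head a b hs (ℕ.<⇒≢ a<b) (λ { refl → lst }) realised
      ... | θL , σ , ℓ<θL , θL<σ , _ , swap , next =
        cons ℓ ℓ σ lo<ℓ ℚ.≤-refl ℓ<σ (topTwo-after-step q≢N q≢a previous top-at-ℓ lo<ℓ) top-at-ℓ (inj₁ (refl , refl))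
          step-at-σ (realise-topTail-after hs a b 1≤a a<b asc lst step-at-σ swap b<N next)
        where
          b≤n = ascending-≤-last b hs asc lst
          a≤n = ℕ.<⇒≤ (ℕ.<-≤-trans a<b b≤n)
          ℓ<σ = ℚ.<-trans ℓ<θL θL<σ
          top-at-ℓ : TopTwo N Ω′ ℓ N a
          top-at-ℓ = subst (ℚ._< F Ω′ N ℓ) (sym (F-agree a≤n)) a<N ,
                     othersBelow₂-extend (withTop-old w)
                       (λ m 1≤m m≤n _ m≢a → subst (F Ω m ℓ ℚ.<_) (sym (F-agree a≤n)) (secondTie-<top tie 1≤m m≤n m≢a))
                       (λ N≢N _ → ⊥-elim (N≢N refl))
          a<N-at-σ : F Ω a σ ℚ.< F Ω′ N σ
          a<N-at-σ = new-above-after′ 1≤a a≤n a<N (ℚ.<⇒≤ ℓ<σ)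
          step-at-σ : SecondTie N Ω′ σ a b N
          step-at-σ = subst (ℚ._< F Ω′ N σ) (sym (F-agree a≤n)) a<N-at-σ ,
                      trans (F-agree a≤n) (trans (proj₁ swap) (sym (F-agree b≤n))) ,
                      othersBelow₃-extend (withTop-old w)
                        (λ m 1≤m m≤n _ m≢a m≢b → subst (F Ω m σ ℚ.<_) (sym (F-agree a≤n)) (proj₂ swap m 1≤m m≤n m≢a m≢b))
                        (λ N≢N _ _ → ⊥-elim (N≢N refl))
          b<N : F Ω b σ ℚ.< F Ω′ N σ
          b<N = subst (ℚ._< F Ω′ N σ) (proj₁ swap) a<N-at-σ

      realise-topTail-after : ∀ hs a b {σ} → 1 ≤ a → a < b → Ascending b hs → lastFrom b hs ≡ n →
        SecondTie N Ω′ σ a b N → TopTie n Ω σ a b → F Ω b σ ℚ.< F Ω′ N σ → ZigzagNext σ a b hs →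
        Realises N Ω′ σ N b (topTail N b hs)
      realise-topTail-after (c ∷ hs) a b 1≤a a<b (b<c , asc) lst a→b swap b<N (t , σ<t , tie , realised) =
        realise-topTail hs b c 1≤b b<c asc lst tie realised σ<t (≤n⇒≢N a≤n) (ℕ.<⇒≢ a<b) a→b
          (new-above-after′ 1≤b b≤n b<N (ℚ.<⇒≤ σ<t))
        where
          b≤n = ascending-≤-last b (c ∷ hs) (b<c , asc) lst
          a≤n = ℕ.<⇒≤ (ℕ.<-≤-trans a<b b≤n)
          1≤b = ℕ.≤-trans 1≤a (ℕ.<⇒≤ a<b)
      realise-topTail-after [] a b {σ} 1≤a a<b _ refl a→b swap b<N _ =
        fin (σ ℚ.+ 1ℚ) (σ ℚ.+ 1ℚ) (p<p+1 σ) ℚ.≤-refl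
          (topTwo-after-step (≤n⇒≢N (ℕ.<⇒≤ a<b)) (ℕ.<⇒≢ a<b) a→b final (p<p+1 σ)) final (inj₁ (refl , refl))
        where
          final : TopTwo N Ω′ (σ ℚ.+ 1ℚ) N n
          final = final-topTwo (ℚ.<⇒≤ b<N) (λ m 1≤m m<n → subst (F Ω m σ ℚ.≤_) (proj₁ swap) (topTie-≤top 1≤m (ℕ.<⇒≤ m<n) swap))

    entry-secondTie : ∀ {T x z} → x ≤ n → z ≤ n → TopTwo n Ω T z x → F Ω′ N T ≡ F Ω x T → SecondTie N Ω′ T x N z
    entry-secondTie {T} x≤n z≤n′ (x<z , others) N≡x =
      subst₂ ℚ._<_ (sym (F-agree x≤n)) (sym (F-agree z≤n′)) x<z ,
      trans (F-agree x≤n) (sym N≡x) ,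
      othersBelow₃-extend (withTop-old w)
        (λ m 1≤m m≤n m≢z m≢x _ → subst (F Ω m T ℚ.<_) (sym (F-agree x≤n)) (others m 1≤m m≤n m≢z m≢x))
        (λ _ _ N≢N → ⊥-elim (N≢N refl))

    -- N enters at T replacing x below z; being steeper it meets z at σ and then stays on top.
    module AfterEntry (z x : ℕ) {T : ℚ} (1≤z : 1 ≤ z) (z≤n′ : z ≤ n) (1≤x : 1 ≤ x) (x≤n : x ≤ n) (x≢z : x ≢ z)
                      (top : TopTwo n Ω T z x) (N≡x : F Ω′ N T ≡ F Ω x T) where

      meeting = F-meet Ω′ N z T (C<C[N] 1≤z z≤n′) (subst₂ ℚ._<_ (sym N≡x) (sym (F-agree z≤n′)) (proj₁ top))

      σ : ℚ
      σ = proj₁ meeting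

      T<σ : T ℚ.< σ
      T<σ = proj₁ (proj₂ meeting)

      N≡z-at-σ : F Ω′ N σ ≡ F Ω′ z σ
      N≡z-at-σ = proj₂ (proj₂ meeting)

      others-below-N : ∀ m → 1 ≤ m → m ≤ n → m ≢ z → ∀ {t} → T ℚ.< t → F Ω m t ℚ.< F Ω′ N t
      others-below-N m 1≤m m≤n m≢z T<t = new-above-after 1≤m m≤n (subst (F Ω m T ℚ.≤_) (sym N≡x) (topTwo-≤second 1≤m m≤n m≢z top)) T<t

      z-over-N : TopTwoOn N Ω′ T (midpoint T σ) z N
      z-over-N = topTwo-after-step x≢z (≤n⇒≢N x≤n) (entry-secondTie x≤n z≤n′ top N≡x) at-midpoint (<midpoint T<σ)
        where
          at-midpoint : TopTwo N Ω′ (midpoint T σ) z N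
          at-midpoint = F-flatter-before Ω′ z N (C<C[N] 1≤z z≤n′) (ℚ.≤-reflexive N≡z-at-σ) (midpoint< T<σ) ,
                        othersBelow₂-extend (withTop-old w) (λ m 1≤m m≤n m≢z _ → others-below-N m 1≤m m≤n m≢z (<midpoint T<σ))
                          (λ _ N≢N → ⊥-elim (N≢N refl))

      swap-at-σ : TopTie N Ω′ σ z N
      swap-at-σ = sym N≡z-at-σ ,
                  othersBelow₂-extend (withTop-old w) (λ m 1≤m m≤n m≢z _ → subst (F Ω m σ ℚ.<_) N≡z-at-σ (others-below-N m 1≤m m≤n m≢z T<σ))
                    (λ _ N≢N → ⊥-elim (N≢N refl))

    realise-after-final-entry : ∀ x {T} → 1 ≤ x → x ≤ n → x ≢ n → TopTwo n Ω T n x → F Ω′ N T ≡ F Ω x T → Realises N Ω′ T n N []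
    realise-after-final-entry x {T} 1≤x x≤n x≢n top N≡x =
      fin (midpoint T σ) (σ ℚ.+ 1ℚ) (<midpoint T<σ) (ℚ.<⇒≤ (ℚ.<-trans (midpoint< T<σ) (p<p+1 σ))) z-over-N final
          (inj₂ (refl , refl , σ , midpoint< T<σ , p<p+1 σ , swap-at-σ))
      where
        open AfterEntry n x 1≤n ℕ.≤-refl 1≤x x≤n x≢n top N≡x
        final : TopTwo N Ω′ (σ ℚ.+ 1ℚ) N n
        final = final-topTwo (subst (ℚ._≤ F Ω′ N σ) (F-agree ℕ.≤-refl) (ℚ.≤-reflexive (sym N≡z-at-σ)))
                  (λ m 1≤m m<n → ℚ.<⇒≤ (subst (F Ω m σ ℚ.<_) (trans N≡z-at-σ (F-agree ℕ.≤-refl))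
                                    (others-below-N m 1≤m (ℕ.<⇒≤ m<n) (ℕ.<⇒≢ m<n) T<σ)))

    realise-after-entry : ∀ z h hs x {T ρ σ₁} → 1 ≤ z → z < h → Ascending h hs → lastFrom h hs ≡ n →
      1 ≤ x → x ≤ n → x ≢ z → TopTie n Ω σ₁ z h → ZigzagNext σ₁ z h hs →
      TopTwo n Ω T z x → F Ω′ N T ≡ F Ω x T → T ℚ.≤ ρ → ρ ℚ.< σ₁ → F Ω h ρ ℚ.≤ F Ω′ N ρ →
      Realises N Ω′ T z N (topTail N z (h ∷ hs))
    realise-after-entry z h hs x {T} {ρ} {σ₁} 1≤z z<h asc lst 1≤x x≤n x≢z swap₁ next top N≡x T≤ρ ρ<σ₁ h≤N =
      cons (midpoint T σ) (midpoint σ σ₁) σ₁ (<midpoint T<σ) (ℚ.<⇒≤ (ℚ.<-trans (midpoint< T<σ) (<midpoint σ<σ₁))) (midpoint< σ<σ₁)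
           z-over-N N-over-z (inj₂ (refl , refl , σ , midpoint< T<σ , <midpoint σ<σ₁ , swap-at-σ)) step-at-σ₁
           (realise-topTail-after hs z h 1≤z z<h asc lst step-at-σ₁ swap₁ h<N next)
      where
        h≤n = ascending-≤-last h hs asc lst
        z≤n′ = ℕ.<⇒≤ (ℕ.<-≤-trans z<h h≤n)
        open AfterEntry z x 1≤z z≤n′ 1≤x x≤n x≢z top N≡x
        h<N : F Ω h σ₁ ℚ.< F Ω′ N σ₁
        h<N = new-above-after (ℕ.≤-trans 1≤z (ℕ.<⇒≤ z<h)) h≤n h≤N ρ<σ₁
        z<N : F Ω z σ₁ ℚ.< F Ω′ N σ₁
        z<N = subst (ℚ._< F Ω′ N σ₁) (sym (proj₁ swap₁)) h<N
        σ<σ₁ : σ ℚ.< σ₁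
        σ<σ₁ with ℚ.<-cmp σ σ₁
        ... | tri< σ<σ₁ _ _ = σ<σ₁
        ... | tri≈ _ σ≡σ₁ _ = ⊥-elim (ℚ.<-irrefl refl
                (subst (F Ω z σ₁ ℚ.<_) (trans (subst (λ s → F Ω′ N s ≡ F Ω′ z s) σ≡σ₁ N≡z-at-σ) (F-agree z≤n′)) z<N))
        ... | tri> _ _ σ₁<σ = ⊥-elim (ℚ.<-asym (subst (F Ω′ N σ₁ ℚ.<_) (F-agree z≤n′)
                (F-flatter-before Ω′ z N (C<C[N] 1≤z z≤n′) (ℚ.≤-reflexive N≡z-at-σ) σ₁<σ)) z<N)
        N-over-z : TopTwo N Ω′ (midpoint σ σ₁) N z
        N-over-z = F-steeper-after Ω′ N z (C<C[N] 1≤z z≤n′) (ℚ.≤-reflexive (sym N≡z-at-σ)) (<midpoint σ<σ₁) ,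
                   othersBelow₂-extend (withTop-old w)
                     (λ m 1≤m m≤n _ m≢z → subst (F Ω m (midpoint σ σ₁) ℚ.<_) (sym (F-agree z≤n′))
                        (F-<-between Ω z m (ℚ.<⇒≤ (ℚ.<-trans T<σ (<midpoint σ<σ₁))) (ℚ.<⇒≤ (midpoint< σ<σ₁))
                           (ℚ.<⇒≤ (topTwo-<top top 1≤m m≤n m≢z)) (topTie-≤top 1≤m m≤n swap₁)
                           (inj₁ (midpoint< σ<σ₁ , topTwo-<top top 1≤m m≤n m≢z))))
                     (λ N≢N _ → ⊥-elim (N≢N refl))
        step-at-σ₁ : SecondTie N Ω′ σ₁ z h N
        step-at-σ₁ = subst (ℚ._< F Ω′ N σ₁) (sym (F-agree z≤n′)) z<N ,
                     trans (F-agree z≤n′) (trans (proj₁ swap₁) (sym (F-agree h≤n))) ,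
                     othersBelow₃-extend (withTop-old w)
                       (λ m 1≤m m≤n _ m≢z m≢h → subst (F Ω m σ₁ ℚ.<_) (sym (F-agree z≤n′)) (proj₂ swap₁ m 1≤m m≤n m≢z m≢h))
                       (λ N≢N _ _ → ⊥-elim (N≢N refl))

  intercept-through : ℕ → ℚ → ℚ
  intercept-through x T = F Ω x T ℚ.- C N ℚ.* T

  new-line-through : ∀ x T → F (withTop (intercept-through x T)) N T ≡ F Ω x T
  new-line-through x T = begin
      F (withTop (intercept-through x T)) N T           ≡⟨ F-unfold (withTop (intercept-through x T)) N T ⟩
      withTop (intercept-through x T) N ℚ.+ C N ℚ.* T   ≡⟨ cong (ℚ._+ C N ℚ.* T) (withTop-new (intercept-through x T)) ⟩
      (F Ω x T ℚ.- C N ℚ.* T) ℚ.+ C N ℚ.* T             ≡⟨ solve 2 (λ a b → (a :- b) :+ b := a) refl (F Ω x T) (C N ℚ.* T) ⟩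
      F Ω x T                                           ∎
    where open ≡-Reasoning
          open +-*-Solver

  new-below-before : ∀ {w x z T} → 1 ≤ x → x ≤ n → 1 ≤ z → z ≤ n → F (withTop w) N T ≡ F Ω x T → TopTwo n Ω T z x →
    ∀ t → t ℚ.< T → F (withTop w) N t ℚ.< F Ω x t × F (withTop w) N t ℚ.< F Ω z t
  new-below-before {w} {x} {z} 1≤x x≤n 1≤z z≤n′ N≡x top t t<T =
    subst (F (withTop w) N t ℚ.<_) (F-agree x≤n)
      (F-flatter-before (withTop w) x N (C<C[N] 1≤x x≤n) (ℚ.≤-reflexive (trans N≡x (sym (F-agree x≤n)))) t<T) ,
    subst (F (withTop w) N t ℚ.<_) (F-agree z≤n′)
      (F-flatter-before (withTop w) z N (C<C[N] 1≤z z≤n′) (ℚ.<⇒≤ (subst₂ ℚ._<_ (sym N≡x) (sym (F-agree z≤n′)) (proj₁ top))) t<T)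
    where open WithIntercept w using (F-agree)

  EntryRealised : ℚ → ℕ → ℕ → ℕ → ℕ → List ℕ → Set
  EntryRealised lo u v z x hs = Σ ℚ λ T → lo ℚ.< T × TopTwo n Ω T z x ×
    Realises N (withTop (intercept-through x T)) lo u v (step x N z ∷ topTail N z hs)

  realise-entry : ∀ z x {T lo u v θL θR S} → 1 ≤ x → x ≤ n → 1 ≤ z → z ≤ n → x ≢ z → SamePair z x (u , v) →
    TopTwo n Ω T z x → lo ℚ.< θL → θL ℚ.≤ θR → θR ℚ.< T →
    TopTwoOn n Ω lo θL u v → TopTwo n Ω θR z x → KeptOrSwapped n Ω θL θR u v z x →
    Realises N (withTop (intercept-through x T)) T z N S → Realises N (withTop (intercept-through x T)) lo u v (step x N z ∷ S)
  realise-entry z x {T} {u = u} {v} {θL} {θR} 1≤x x≤n 1≤z z≤n′ x≢z pair top-at-T lo<θL θL≤θR θR<T on top kept realised =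
    cons θL θR T lo<θL θL≤θR θR<T (lift-topTwoOn u≤n v≤n θL≤θR on) (lift-topTwo z≤n′ x≤n ℚ.≤-refl top)
      (lift-keptOrSwapped u≤n v≤n ℚ.≤-refl kept) (WithIntercept.entry-secondTie (intercept-through x T) x≤n z≤n′ top-at-T (new-line-through x T))
      realised
    where
      u≤n = [ (λ e → subst (_≤ n) (proj₁ e) z≤n′) , (λ e → subst (_≤ n) (proj₂ e) x≤n) ]′ pair
      v≤n = [ (λ e → subst (_≤ n) (proj₂ e) x≤n) , (λ e → subst (_≤ n) (proj₁ e) z≤n′) ]′ pair
      open AddLineBelow n Ω (withTop (intercept-through x T)) (withTop-old (intercept-through x T)) x z 1≤x x≤n 1≤z z≤n′ x≢z θR
             (λ t t≤θR → new-below-before 1≤x x≤n 1≤z z≤n′ (new-line-through x T) top-at-T t (ℚ.≤-<-trans t≤θR θR<T))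

  -- x = pred n is never replaced in the reduced path: N enters after its end.
  entry-after-end : ∀ {lo u v} → SamePair n (pred n) (u , v) → Realises n Ω lo u v [] → EntryRealised lo u v n (pred n) []
  entry-after-end pair (fin θL θR lo<θL θL≤θR on top kept) =
    T , ℚ.<-trans lo<θL (ℚ.≤-<-trans θL≤θR (p<p+1 θR)) , top-at-T ,
    realise-entry n (pred n) 1≤pred (ℕ.<⇒≤ pred[n]<n) 1≤n ℕ.≤-refl (ℕ.<⇒≢ pred[n]<n) pair top-at-T lo<θL θL≤θR (p<p+1 θR) on top kept
      (WithIntercept.realise-after-final-entry (intercept-through (pred n) T) (pred n) 1≤pred (ℕ.<⇒≤ pred[n]<n) (ℕ.<⇒≢ pred[n]<n)
         top-at-T (new-line-through (pred n) T))
    where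
      T = θR ℚ.+ 1ℚ
      1≤pred = ℕ.pred-mono-≤ 2≤n
      top-at-T = final-topTwo-persists top (ℚ.<⇒≤ (p<p+1 θR))

  -- N enters just before the last step x → pred n of the reduced path.
  entry-before-end : ∀ x {lo u v} → 1 ≤ x → x ≤ n → x ≢ n → SamePair n x (u , v) →
    Realises n Ω lo u v [ step x (pred n) n ] → EntryRealised lo u v n x []
  entry-before-end x 1≤x x≤n x≢n pair (cons θL θR t lo<θL θL≤θR θR<t on top kept tie _) =
    T , ℚ.<-trans lo<θL (ℚ.≤-<-trans θL≤θR (<midpoint θR<t)) , top-at-T ,
    realise-entry n x 1≤x x≤n 1≤n ℕ.≤-refl x≢n pair top-at-T lo<θL θL≤θR (<midpoint θR<t) on top kept
      (WithIntercept.realise-after-final-entry (intercept-through x T) x 1≤x x≤n x≢n top-at-T (new-line-through x T))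
    where
      T = midpoint θR t
      top-at-T = topTwo-before-step top tie (ℚ.<⇒≤ (<midpoint θR<t)) (midpoint< θR<t)

  -- N enters just before the step x → h of the reduced path.
  entry-before-replace : ∀ z x h hs {lo u v} → 1 ≤ x → x ≤ n → 1 ≤ z → x ≢ z → z < h → Ascending h hs → lastFrom h hs ≡ n →
    SamePair z x (u , v) → Realises n Ω lo u v (step x h z ∷ zigzag n z h hs) → EntryRealised lo u v z x (h ∷ hs)
  entry-before-replace z x h hs 1≤x x≤n 1≤z x≢z z<h asc lst pair (cons θL θR t lo<θL θL≤θR θR<t on top kept tie realised)
    with zigzag-head z h hs (ℕ.<⇒≢ z<h) (λ { refl → lst }) realised
  ... | θL₂ , σ₁ , t<θL₂ , θL₂<σ₁ , _ , swap₁ , next =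
    T , ℚ.<-trans lo<θL (ℚ.≤-<-trans θL≤θR (<midpoint θR<t)) , top-at-T ,
    realise-entry z x 1≤x x≤n 1≤z z≤n′ x≢z pair top-at-T lo<θL θL≤θR (<midpoint θR<t) on top kept
      (WithIntercept.realise-after-entry w z h hs x 1≤z z<h asc lst 1≤x x≤n x≢z swap₁ next top-at-T (new-line-through x T)
         (ℚ.<⇒≤ (midpoint< θR<t)) (ℚ.<-trans t<θL₂ θL₂<σ₁) h≤N)
    where
      T = midpoint θR t
      w = intercept-through x T
      z≤n′ = ℕ.<⇒≤ (ℕ.<-≤-trans z<h (ascending-≤-last h hs asc lst))
      top-at-T = topTwo-before-step top tie (ℚ.<⇒≤ (<midpoint θR<t)) (midpoint< θR<t)
      h≤N : F Ω h t ℚ.≤ F (withTop w) N t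
      h≤N = ℚ.<⇒≤ (subst (ℚ._< F (withTop w) N t) (proj₁ (proj₂ tie))
              (WithIntercept.new-above-after w 1≤x x≤n (ℚ.≤-reflexive (sym (new-line-through x T))) (midpoint< θR<t)))

  -- Here h = x, so the reduced path keeps x: N enters just before z and x swap.
  entry-at-swap : ∀ z x hs {lo} → 1 ≤ x → x ≤ n → 1 ≤ z → x ≢ z → z < x → Ascending x hs → lastFrom x hs ≡ n →
    Realises n Ω lo z x (zigzag n z x hs) → EntryRealised lo z x z x (x ∷ hs)
  entry-at-swap z x hs {lo} 1≤x x≤n 1≤z x≢z z<x asc lst realised with zigzag-head z x hs (ℕ.<⇒≢ z<x) (λ { refl → lst }) realised
  ... | θL₁ , σ₁ , lo<θL₁ , θL₁<σ₁ , on₁ , swap₁ , next =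
    θL₁ , lo<θL₁ , top-at-T ,
    realise-entry z x 1≤x x≤n 1≤z (ℕ.<⇒≤ (ℕ.<-≤-trans z<x x≤n)) x≢z (inj₁ (refl , refl)) top-at-T (<midpoint lo<θL₁) ℚ.≤-refl (midpoint< lo<θL₁)
      (λ t lo<t t≤m → on₁ t lo<t (ℚ.≤-trans t≤m (ℚ.<⇒≤ (midpoint< lo<θL₁))))
      (on₁ (midpoint lo θL₁) (<midpoint lo<θL₁) (ℚ.<⇒≤ (midpoint< lo<θL₁))) (inj₁ (refl , refl))
      (WithIntercept.realise-after-entry (intercept-through x θL₁) z x hs x 1≤z z<x asc lst 1≤x x≤n x≢z swap₁ next top-at-T
         (new-line-through x θL₁) ℚ.≤-refl θL₁<σ₁ (ℚ.≤-reflexive (sym (new-line-through x θL₁))))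
    where top-at-T = on₁ θL₁ lo<θL₁ ℚ.≤-refl

  realise-from-entry : ∀ z x hs {lo u v} → 1 ≤ x → x ≤ n → 1 ≤ z → x ≢ z → SamePair z x (u , v) →
    Ascending z hs → lastFrom z hs ≡ n → (∀ h hs′ → hs ≡ h ∷ hs′ → x ≤ h × (x ≡ h → u ≡ z × v ≡ x)) →
    Realises n Ω lo u v (reducedTail n z x hs) → EntryRealised lo u v z x hs
  realise-from-entry z x [] 1≤x x≤n 1≤z x≢z pair _ refl _ realised with x ℕ.≟ pred n
  ... | yes refl = entry-after-end pair realised
  ... | no _     = entry-before-end x 1≤x x≤n x≢z pair realised
  realise-from-entry z x (h ∷ hs) 1≤x x≤n 1≤z x≢z pair (z<h , asc) lst next realised with x ℕ.≟ h
  ... | no x≢h   = entry-before-replace z x h hs 1≤x x≤n 1≤z x≢z z<h asc lst pair realised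
  ... | yes refl with proj₂ (next x hs refl) refl
  ...   | refl , refl = entry-at-swap z x hs 1≤x x≤n 1≤z x≢z z<h asc lst realised

  -- Up to the entry time the new line is below x and z, so the realisation of the common prefix survives.
  extend-realisation : ∀ P z x hs {lo u v} → Bounded n u v P → 1 ≤ x → x ≤ n → 1 ≤ z → z ≤ n → x ≢ z →
    Ascending z hs → lastFrom z hs ≡ n → SamePair z x (finalState u v P) →
    (∀ h hs′ → hs ≡ h ∷ hs′ → x ≤ h × (x ≡ h → proj₁ (finalState u v P) ≡ z × proj₂ (finalState u v P) ≡ x)) →
    Realises n Ω lo u v (P ++ reducedTail n z x hs) →
    Σ (ℕ → ℚ) λ Ω′ → Realises N Ω′ lo u v (P ++ step x N z ∷ topTail N z hs)
  extend-realisation P z x hs {lo} {u} {v} bounded 1≤x x≤n 1≤z z≤n′ x≢z asc lst pair next realised =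
    split (realises-++⁻ P realised)
    where
      split : Σ ℚ (λ lo′ → Σ ℕ λ u′ → Σ ℕ λ v′ → RealisesPrefix n Ω lo u v P lo′ u′ v′ × Realises n Ω lo′ u′ v′ (reducedTail n z x hs)) →
              Σ (ℕ → ℚ) λ Ω′ → Realises N Ω′ lo u v (P ++ step x N z ∷ topTail N z hs)
      split (lo′ , u′ , v′ , prefix , rest) = join (realise-from-entry z x hs 1≤x x≤n 1≤z x≢z (subst (SamePair z x) final≡ pair) asc lst next′ rest)
        where
          final≡ = realisesPrefix-final prefix
          next′ : ∀ h hs′ → hs ≡ h ∷ hs′ → x ≤ h × (x ≡ h → u′ ≡ z × v′ ≡ x)
          next′ h hs′ e = proj₁ (next h hs′ e) , λ x≡h → subst (λ q → proj₁ q ≡ z × proj₂ q ≡ x) final≡ (proj₂ (next h hs′ e) x≡h)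
          join : EntryRealised lo′ u′ v′ z x hs → Σ (ℕ → ℚ) λ Ω′ → Realises N Ω′ lo u v (P ++ step x N z ∷ topTail N z hs)
          join (T , lo′<T , top-at-T , realised′) =
            withTop (intercept-through x T) , realises-++⁺ (lift-realisesPrefix bounded ℚ.≤-refl prefix) realised′
            where
              open AddLineBelow n Ω (withTop (intercept-through x T)) (withTop-old (intercept-through x T)) x z 1≤x x≤n 1≤z z≤n′ x≢z lo′
                     (λ t t≤lo′ → new-below-before 1≤x x≤n 1≤z z≤n′ (new-line-through x T) top-at-T t (ℚ.≤-<-trans t≤lo′ lo′<T))

module Realisability (C : ℕ → ℚ) (Nmax : ℕ) (C-< : ∀ {p q} → 1 ℕ.≤ p → p ℕ.< q → q ℕ.≤ Nmax → C p ℚ.< C q) where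

  open import Data.Nat.Base using (_<_; _≤_)
  open EStep
  open StepChains
  open Arrangements C

  CoherentChain : ℕ → List EStep → Set
  CoherentChain n S = Chain n 1 2 S × IsFinal n (finalState 1 2 S) × AllPairs CoherentSteps S

  chain-bounded : ∀ {n u v} P → Chain n u v P → u ≤ n → v ≤ n → Bounded n u v P
  chain-bounded []               nil                      u≤n v≤n = bnil u≤n v≤n
  chain-bounded (step i j a ∷ P) (cons o i<j j≤n j≢a c) u≤n v≤n =
    bcons u≤n v≤n a≤n (samePair-≤ (samePair-swap o) u≤n v≤n) j≤n (chain-bounded P c a≤n j≤n)
    where a≤n = samePair-≤ o u≤n v≤n

  chain-[2]-empty : ∀ S → Chain 2 1 2 S → S ≡ []
  chain-[2]-empty []               _ = refl
  chain-[2]-empty (step i j a ∷ S) (cons (inj₁ (refl , refl)) i<j j≤2 j≢a c) = ⊥-elim (ℕ.<⇒≱ i<j j≤2)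
  chain-[2]-empty (step i j a ∷ S) (cons (inj₂ (refl , refl)) i<j j≤2 j≢a c) = ⊥-elim (j≢a (ℕ.≤-antisym j≤2 i<j))

  Ω₀ : ℕ → ℚ
  Ω₀ _ = 0ℚ

  F-Ω₀ : ∀ m → F Ω₀ m 0ℚ ≡ 0ℚ
  F-Ω₀ m = trans (F-unfold Ω₀ m 0ℚ) (trans (cong (0ℚ ℚ.+_) (ℚ.*-zeroʳ (C m))) (ℚ.+-identityʳ 0ℚ))

  F-Ω₀-≤ : ∀ p q → F Ω₀ p 0ℚ ℚ.≤ F Ω₀ q 0ℚ
  F-Ω₀-≤ p q = ℚ.≤-reflexive (trans (F-Ω₀ p) (sym (F-Ω₀ q)))

  othersBelow₂-[2] : ∀ {Ω t V} → OthersBelow₂ 2 Ω t 1 2 V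
  othersBelow₂-[2] zero                () _ _ _
  othersBelow₂-[2] (suc zero)          _  _ 1≢1 _ = ⊥-elim (1≢1 refl)
  othersBelow₂-[2] (suc (suc zero))    _  _ _ 2≢2 = ⊥-elim (2≢2 refl)
  othersBelow₂-[2] (suc (suc (suc m))) _  (s≤s (s≤s ())) _ _

  othersBelow₂-[2]′ : ∀ {Ω t V} → OthersBelow₂ 2 Ω t 2 1 V
  othersBelow₂-[2]′ m 1≤m m≤2 m≢2 m≢1 = othersBelow₂-[2] m 1≤m m≤2 m≢1 m≢2

  -- With all intercepts 0 the two lines cross at 0; the sweep starts at -2.
  realise-[2] : 2 ≤ Nmax → Realises 2 Ω₀ (ℚ.- 1ℚ ℚ.- 1ℚ) 1 2 []
  realise-[2] 2≤N =
    fin (ℚ.- 1ℚ) 1ℚ (toWitness {a? = (ℚ.- 1ℚ ℚ.- 1ℚ) ℚ.<? ℚ.- 1ℚ} tt) (toWitness {a? = ℚ.- 1ℚ ℚ.≤? 1ℚ} tt) before after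
        (inj₂ (refl , refl , 0ℚ , -1<0 , toWitness {a? = 0ℚ ℚ.<? 1ℚ} tt , ℚ.≤-antisym (F-Ω₀-≤ 1 2) (F-Ω₀-≤ 2 1) , othersBelow₂-[2]))
    where
      -1<0 = toWitness {a? = ℚ.- 1ℚ ℚ.<? 0ℚ} tt
      C₁<C₂ : C 1 ℚ.< C 2
      C₁<C₂ = C-< ℕ.≤-refl ℕ.≤-refl 2≤N
      before : TopTwoOn 2 Ω₀ (ℚ.- 1ℚ ℚ.- 1ℚ) (ℚ.- 1ℚ) 1 2
      before t _ t≤ = F-flatter-before Ω₀ 1 2 C₁<C₂ (F-Ω₀-≤ 2 1) (ℚ.≤-<-trans t≤ -1<0) , othersBelow₂-[2]
      after : TopTwo 2 Ω₀ 1ℚ 2 1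
      after = F-steeper-after Ω₀ 2 1 C₁<C₂ (F-Ω₀-≤ 1 2) (toWitness {a? = 0ℚ ℚ.<? 1ℚ} tt) , othersBelow₂-[2]′

  samePair-bounds : ∀ {n x z p q} → SamePair z x (p , q) → ValidState n (p , q) → 1 ≤ x × x ≤ n × 1 ≤ z × z ≤ n × x ≢ z
  samePair-bounds (inj₁ (refl , refl)) (1≤p , 1≤q , p≤n , q≤n , p≢q) = 1≤q , q≤n , 1≤p , p≤n , λ e → p≢q (sym e)
  samePair-bounds (inj₂ (refl , refl)) (1≤p , 1≤q , p≤n , q≤n , p≢q) = 1≤p , p≤n , 1≤q , q≤n , p≢q

  module DeleteSteepest (n : ℕ) (2≤n : 2 ≤ n) (P : List EStep) (x z : ℕ) (hs : List ℕ)
      (chain : Chain n 1 2 P) (pair : SamePair z x (finalState 1 2 P)) (asc : Ascending z hs) (lst : lastFrom z hs ≡ n)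
      (coherent : AllPairs CoherentSteps (P ++ step x (suc n) z ∷ topTail (suc n) z hs)) where

    1≤n : 1 ≤ n
    1≤n = ℕ.≤-trans (s≤s z≤n) 2≤n

    valid : All (ValidStep n) P × ValidState n (finalState 1 2 P)
    valid = chain-valid P chain (s≤s z≤n , s≤s z≤n , 1≤n , 2≤n , λ ())

    bounds : 1 ≤ x × x ≤ n × 1 ≤ z × z ≤ n × x ≢ z
    bounds = samePair-bounds pair (proj₂ valid)

    across : CoherentAcross P (step x (suc n) z ∷ topTail (suc n) z hs)
    across = proj₂ (proj₂ (allPairs-++⁻ P coherent))

    x≤next : ∀ h hs′ → hs ≡ h ∷ hs′ → x ≤ h
    x≤next = replaced≤next n P x z hs (proj₁ valid) across chain pair (proj₁ (proj₂ (proj₂ bounds))) (proj₁ (proj₂ bounds)) asc lst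

    x≡next⇒ordered : ∀ h hs′ → hs ≡ h ∷ hs′ → x ≡ h → proj₁ (finalState 1 2 P) ≡ z × proj₂ (finalState 1 2 P) ≡ x
    x≡next⇒ordered = replaced≡next⇒ordered n P x z hs (proj₁ valid) across chain pair asc

    reduced : CoherentChain n (P ++ reducedTail n z x hs)
    reduced = chain-++⁺ P chain (proj₁ tail) ,
              subst (IsFinal n) (sym (finalState-++ 1 2 P (reducedTail n z x hs))) (proj₂ tail) ,
              AllPairs.++⁺ (proj₁ (allPairs-++⁻ P coherent)) (reducedTail-coherent {n} z x hs asc)
                           (reducedTail-across-all P z x hs (proj₁ valid) across)
      where tail = reducedTail-chain {n} z x hs 1≤n pair (proj₁ (proj₂ bounds)) (proj₂ (proj₂ (proj₂ (proj₂ bounds)))) asc lst x≤next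

  realisable : ∀ k → suc (suc k) ≤ Nmax → ∀ S → CoherentChain (suc (suc k)) S →
    Σ (ℕ → ℚ) λ Ω → Σ ℚ λ lo → Realises (suc (suc k)) Ω lo 1 2 S
  realisable zero 2≤Nmax S (chain , _ , _) with chain-[2]-empty S chain
  ... | refl = Ω₀ , _ , realise-[2] 2≤Nmax
  realisable (suc k) N≤Nmax S (chain , final , coherent) with split-at-top-entry S chain final (s≤s z≤n) (s≤s (s≤s z≤n))
  ... | P , x , z , hs , refl , chainP , pair , asc , lst = put-back (realisable k (ℕ.≤-trans (ℕ.n≤1+n _) N≤Nmax) _ reduced)
    where
      n = suc (suc k)
      open DeleteSteepest n (s≤s (s≤s z≤n)) P x z hs chainP pair asc lst coherent
      1≤x = proj₁ bounds
      x≤n = proj₁ (proj₂ bounds)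
      1≤z = proj₁ (proj₂ (proj₂ bounds))
      z≤n′ = proj₁ (proj₂ (proj₂ (proj₂ bounds)))
      x≢z = proj₂ (proj₂ (proj₂ (proj₂ bounds)))
      put-back : Σ (ℕ → ℚ) (λ Ω → Σ ℚ λ lo → Realises n Ω lo 1 2 (P ++ reducedTail n z x hs)) →
                 Σ (ℕ → ℚ) (λ Ω → Σ ℚ λ lo → Realises (suc n) Ω lo 1 2 (P ++ step x (suc n) z ∷ topTail (suc n) z hs))
      put-back (Ω , lo , realised) = proj₁ extended , lo , proj₂ extended
        where
          extended = AddSteepestLine.extend-realisation C n (s≤s (s≤s z≤n)) (λ 1≤p p<q q≤N → C-< 1≤p p<q (ℕ.≤-trans q≤N N≤Nmax)) Ω
                       P z x hs (chain-bounded P chainP (s≤s z≤n) (s≤s (s≤s z≤n))) 1≤x x≤n 1≤z z≤n′ x≢z asc lst pair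
                       (λ h hs′ eq → x≤next h hs′ eq , x≡next⇒ordered h hs′ eq) realised

-- Lines are numbered 1 … n as in the paper; the vertex e_a + e_b of Δ(n,2) has the lines lineNo a and lineNo b.
module Vertices (n : ℕ) (n≥3 : 3 ℕ.≤ n) where

  open import Data.Nat.Base using (_<_; _≤_)

  -- out of range, toFin returns the junk value 0
  toFin : ℕ → Fin n
  toFin k with k ℕ.<? n
  ... | yes k<n = fromℕ< k<n
  ... | no _    = fromℕ< (ℕ.≤-trans (s≤s z≤n) n≥3)

  toℕ-toFin : ∀ k → k < n → toℕ (toFin k) ≡ k
  toℕ-toFin k k<n with k ℕ.<? n
  ... | yes k<n′ = Fin.toℕ-fromℕ< k<n′
  ... | no k≮n   = ⊥-elim (k≮n k<n)

  toFin-toℕ : ∀ (a : Fin n) → toFin (toℕ a) ≡ a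
  toFin-toℕ a = Fin.toℕ-injective (toℕ-toFin (toℕ a) (Fin.toℕ<n a))

  lineNo : Fin n → ℕ
  lineNo a = suc (toℕ a)

  lineNo-toFin : ∀ x → 1 ≤ x → x ≤ n → lineNo (toFin (pred x)) ≡ x
  lineNo-toFin (suc x) _ x<n = cong suc (toℕ-toFin x x<n)

  lineNo-injective : ∀ {a b : Fin n} → lineNo a ≡ lineNo b → a ≡ b
  lineNo-injective e = Fin.toℕ-injective (ℕ.suc-injective e)

  lineNo-bounds : ∀ (a : Fin n) → 1 ≤ lineNo a × lineNo a ≤ n
  lineNo-bounds a = s≤s z≤n , Fin.toℕ<n a

  vertexOf : Point → Vertex n
  vertexOf (x , y) = if ⌊ x ℕ.<? y ⌋ then (toFin (pred x) , toFin (pred y)) else (toFin (pred y) , toFin (pred x))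

  HasLines : Vertex n → ℕ → ℕ → Set
  HasLines v x y = (lineNo (proj₁ v) ≡ x × lineNo (proj₂ v) ≡ y) ⊎ (lineNo (proj₁ v) ≡ y × lineNo (proj₂ v) ≡ x)

  hasLines-swap : ∀ {v x y} → HasLines v x y → HasLines v y x
  hasLines-swap (inj₁ (a , b)) = inj₂ (a , b)
  hasLines-swap (inj₂ (a , b)) = inj₁ (a , b)

  inGrid-swap : ∀ {x y} → InGrid n (x , y) → InGrid n (y , x)
  inGrid-swap (x-bounds , y-bounds , x≢y) = y-bounds , x-bounds , λ e → x≢y (sym e)

  pred-<-pred : ∀ {a b} → 1 ≤ a → a < b → pred a < pred b
  pred-<-pred {suc a} {suc b} _ (s≤s a<b) = a<b

  vertexOf-lines : ∀ x y → InGrid n (x , y) → ValidVertex (vertexOf (x , y)) × HasLines (vertexOf (x , y)) x y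
  vertexOf-lines x y ((1≤x , x≤n) , (1≤y , y≤n) , x≢y) with x ℕ.<? y
  ... | yes x<y =
    subst₂ _<_ (sym (cong pred (lineNo-toFin x 1≤x x≤n))) (sym (cong pred (lineNo-toFin y 1≤y y≤n))) (pred-<-pred 1≤x x<y) ,
    inj₁ (lineNo-toFin x 1≤x x≤n , lineNo-toFin y 1≤y y≤n)
  ... | no x≮y =
    subst₂ _<_ (sym (cong pred (lineNo-toFin y 1≤y y≤n))) (sym (cong pred (lineNo-toFin x 1≤x x≤n)))
      (pred-<-pred 1≤y (ℕ.≤∧≢⇒< (ℕ.≮⇒≥ x≮y) (λ e → x≢y (sym e)))) ,
    inj₂ (lineNo-toFin y 1≤y y≤n , lineNo-toFin x 1≤x x≤n)

  lines-determine-vertex : ∀ v w x y → ValidVertex v → ValidVertex w → HasLines v x y → HasLines w x y → v ≡ w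
  lines-determine-vertex (a , b) (a′ , b′) x y _ _ (inj₁ (e₁ , e₂)) (inj₁ (f₁ , f₂)) =
    cong₂ _,_ (lineNo-injective (trans e₁ (sym f₁))) (lineNo-injective (trans e₂ (sym f₂)))
  lines-determine-vertex (a , b) (a′ , b′) x y _ _ (inj₂ (e₁ , e₂)) (inj₂ (f₁ , f₂)) =
    cong₂ _,_ (lineNo-injective (trans e₁ (sym f₁))) (lineNo-injective (trans e₂ (sym f₂)))
  lines-determine-vertex (a , b) (a′ , b′) x y a<b a′<b′ (inj₁ (e₁ , e₂)) (inj₂ (f₁ , f₂)) =
    ⊥-elim (ℕ.<-asym a<b (subst₂ _<_ (ℕ.suc-injective (trans f₁ (sym e₂))) (ℕ.suc-injective (trans f₂ (sym e₁))) a′<b′))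
  lines-determine-vertex (a , b) (a′ , b′) x y a<b a′<b′ (inj₂ (e₁ , e₂)) (inj₁ (f₁ , f₂)) =
    ⊥-elim (ℕ.<-asym a<b (subst₂ _<_ (ℕ.suc-injective (trans f₁ (sym e₂))) (ℕ.suc-injective (trans f₂ (sym e₁))) a′<b′))

  vertexOf-swap : ∀ x y → InGrid n (x , y) → vertexOf (x , y) ≡ vertexOf (y , x)
  vertexOf-swap x y g =
    lines-determine-vertex _ _ x y (proj₁ (vertexOf-lines x y g)) (proj₁ (vertexOf-lines y x (inGrid-swap g)))
      (proj₂ (vertexOf-lines x y g)) (hasLines-swap (proj₂ (vertexOf-lines y x (inGrid-swap g))))

  1+[n∸2]≡n∸1 : suc (n ∸ 2) ≡ n ∸ 1
  1+[n∸2]≡n∸1 = sym (ℕ.+-∸-assoc 1 (ℕ.≤-trans (s≤s (s≤s z≤n)) n≥3))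

  1+[n∸1]≡n : suc (n ∸ 1) ≡ n
  1+[n∸1]≡n = ℕ.m+[n∸m]≡n {1} {n} (ℕ.≤-trans (s≤s z≤n) n≥3)

  start-in-grid : InGrid n (2 , 1)
  start-in-grid = (s≤s z≤n , ℕ.≤-trans (s≤s (s≤s z≤n)) n≥3) , (s≤s z≤n , ℕ.≤-trans (s≤s z≤n) n≥3) , λ ()

  end-in-grid : InGrid n (n ∸ 1 , n)
  end-in-grid = (ℕ.≤-trans (s≤s z≤n) (ℕ.≤-reflexive 1+[n∸2]≡n∸1) , ℕ.m∸n≤m n 1) , (ℕ.≤-trans (s≤s z≤n) n≥3 , ℕ.≤-refl) ,
                λ e → ℕ.<-irrefl (trans e (sym 1+[n∸1]≡n)) (ℕ.n<1+n (n ∸ 1))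

  startVertex≡ : startVertex n n≥3 ≡ vertexOf (2 , 1)
  startVertex≡ = lines-determine-vertex (startVertex n n≥3) (vertexOf (2 , 1)) 2 1 valid (proj₁ (vertexOf-lines 2 1 start-in-grid))
                   lines (proj₂ (vertexOf-lines 2 1 start-in-grid))
    where
      first : toℕ (proj₁ (startVertex n n≥3)) ≡ 0
      first = Fin.toℕ-fromℕ< _
      second : toℕ (proj₂ (startVertex n n≥3)) ≡ 1
      second = Fin.toℕ-fromℕ< _
      valid : ValidVertex (startVertex n n≥3)
      valid = subst₂ _<_ (sym first) (sym second) (s≤s z≤n)
      lines : HasLines (startVertex n n≥3) 2 1
      lines = inj₂ (cong suc first , cong suc second)

  endVertex≡ : endVertex n n≥3 ≡ vertexOf (n ∸ 1 , n)
  endVertex≡ = lines-determine-vertex (endVertex n n≥3) (vertexOf (n ∸ 1 , n)) (n ∸ 1) n valid (proj₁ (vertexOf-lines (n ∸ 1) n end-in-grid))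
                 lines (proj₂ (vertexOf-lines (n ∸ 1) n end-in-grid))
    where
      first : toℕ (proj₁ (endVertex n n≥3)) ≡ n ∸ 2
      first = trans (Fin.opposite-prop _) (cong (λ k → n ∸ suc k) (Fin.toℕ-fromℕ< _))
      second : toℕ (proj₂ (endVertex n n≥3)) ≡ n ∸ 1
      second = trans (Fin.opposite-prop _) (cong (λ k → n ∸ suc k) (Fin.toℕ-fromℕ< _))
      valid : ValidVertex (endVertex n n≥3)
      valid = subst₂ _<_ (sym first) (sym second) (ℕ.≤-reflexive 1+[n∸2]≡n∸1)
      lines : HasLines (endVertex n n≥3) (n ∸ 1) n
      lines = inj₁ (trans (cong suc first) 1+[n∸2]≡n∸1 , trans (cong suc second) 1+[n∸1]≡n)

module LatticeChains (n : ℕ) where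

  open StepChains

  n∸1≡pred[n] : ∀ m → m ∸ 1 ≡ pred m
  n∸1≡pred[n] zero    = refl
  n∸1≡pred[n] (suc m) = refl

  IsEndPoint : Maybe Point → Set
  IsEndPoint m = m ≡ just (n ∸ 1 , n) ⊎ m ≡ just (n , n ∸ 1)

  endPoint-final : ∀ P {u v} → SamePair (proj₁ P) (proj₂ P) (u , v) → IsEndPoint (just P) → IsFinal n (u , v)
  endPoint-final P (inj₁ (refl , refl)) (inj₁ refl) = inj₁ (n∸1≡pred[n] n , refl)
  endPoint-final P (inj₂ (refl , refl)) (inj₁ refl) = inj₂ (refl , n∸1≡pred[n] n)
  endPoint-final P (inj₁ (refl , refl)) (inj₂ refl) = inj₂ (refl , n∸1≡pred[n] n)
  endPoint-final P (inj₂ (refl , refl)) (inj₂ refl) = inj₁ (n∸1≡pred[n] n , refl)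

  lattice-chain : ∀ P R {u v} → SamePair (proj₁ P) (proj₂ P) (u , v) → All (InGrid n) (P ∷ R) → Linked IsStep (P ∷ R) →
    IsEndPoint (last (P ∷ R)) → Chain n u v (steps (P ∷ R)) × IsFinal n (finalState u v (steps (P ∷ R)))
  lattice-chain P [] pair _ _ end = nil , endPoint-final P pair end
  lattice-chain (x , y) ((x′ , y′) ∷ R) pair (_ ∷ g′ ∷ gs) (st ∷ lk) end with x ℕ.≟ x′ | st
  ... | yes refl | inj₂ (_ , x<x) = ⊥-elim (ℕ.<-irrefl refl x<x)
  ... | yes refl | inj₁ (_ , y<y′) with lattice-chain (x , y′) R (inj₁ (refl , refl)) (g′ ∷ gs) lk end
  ...   | chain , final = cons pair y<y′ (proj₂ (proj₁ (proj₂ g′))) (λ e → proj₂ (proj₂ g′) (sym e)) chain , final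
  lattice-chain (x , y) ((x′ , y′) ∷ R) pair (_ ∷ g′ ∷ gs) (st ∷ lk) end | no x≢x′ | inj₁ (x≡x′ , _) = ⊥-elim (x≢x′ x≡x′)
  lattice-chain (x , y) ((x′ , y′) ∷ R) pair (_ ∷ g′ ∷ gs) (st ∷ lk) end | no x≢x′ | inj₂ (refl , x<x′)
    with lattice-chain (x′ , y) R (inj₂ (refl , refl)) (g′ ∷ gs) lk end
  ... | chain , final = cons (samePair-swap pair) x<x′ (proj₂ (proj₁ g′)) (proj₂ (proj₂ g′)) chain , final

  diagonalAvoiding-chain : ∀ L → DiagonalAvoidingPath n L → Chain n 1 2 (steps L) × IsFinal n (finalState 1 2 (steps L))
  diagonalAvoiding-chain []      (_ , () , _)
  diagonalAvoiding-chain (P ∷ R) (gs , refl , end , lk) = lattice-chain P R (inj₂ (refl , refl)) gs lk end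

-- For fixed ω, H l v is the height of v in direction (l , 1); as l grows the maximiser moves to vertices of
-- larger cost ⟪ v , c ⟫, and an upper edge of π^ω(Δ(n,2)) is exactly a parameter l at which two vertices tie.
module Sweep (n : ℕ) (n≥3 : 3 ℕ.≤ n) (c ω : Fin n → ℚ) where

  open import Data.Rational.Base using (_<_; _≤_)
  open AffineLines

  _≟ᵥ_ : (u v : Vertex n) → Dec (u ≡ v)
  _≟ᵥ_ = Product.≡-dec Fin._≟_ Fin._≟_

  opaque
    H : ℚ → Vertex n → ℚ
    H l v = height n n≥3 c ω l v

    H-def : ∀ l v → H l v ≡ height n n≥3 c ω l v
    H-def l v = refl

  cost : Vertex n → ℚ
  cost v = ⟪ v , c ⟫

  opaque
    unfolding H
    H-line : ∀ l v → H l v ≡ line ⟪ v , ω ⟫ (cost v) l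
    H-line l v = trans (ℚ.+-comm (l ℚ.* cost v) ⟪ v , ω ⟫) (cong (⟪ v , ω ⟫ ℚ.+_) (ℚ.*-comm l (cost v)))

    InFace⇒ : ∀ {l x} → InFace n n≥3 c ω l x → ValidVertex x × (∀ w → ValidVertex w → H l w ≤ H l x)
    InFace⇒ h = h

    ⇒InFace : ∀ {l x} → ValidVertex x → (∀ w → ValidVertex w → H l w ≤ H l x) → InFace n n≥3 c ω l x
    ⇒InFace valid max = valid , max

  H-<-between : ∀ {u w t₁ l t₂} → t₁ ≤ l → l ≤ t₂ → H t₁ w ≤ H t₁ u → H t₂ w ≤ H t₂ u →
    (l < t₂ × H t₁ w < H t₁ u) ⊎ (t₁ < l × H t₂ w < H t₂ u) → H l w < H l u
  H-<-between {u} {w} {t₁} {l} {t₂} t₁≤l l≤t₂ g₁ g₂ d =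
    subst₂ _<_ (sym (H-line l w)) (sym (H-line l u))
      (line-<-between {⟪ u , ω ⟫} {cost u} {⟪ w , ω ⟫} {cost w} t₁≤l l≤t₂
        (subst₂ _≤_ (H-line t₁ w) (H-line t₁ u) g₁) (subst₂ _≤_ (H-line t₂ w) (H-line t₂ u) g₂)
        ([ (λ q → inj₁ (proj₁ q , subst₂ _<_ (H-line t₁ w) (H-line t₁ u) (proj₂ q))) ,
           (λ q → inj₂ (proj₁ q , subst₂ _<_ (H-line t₂ w) (H-line t₂ u) (proj₂ q))) ]′ d))

  H-steeper-after : ∀ {u w t₁ l} → cost w < cost u → H t₁ w ≤ H t₁ u → t₁ < l → H l w < H l u
  H-steeper-after {u} {w} {t₁} {l} c< h t₁<l = subst₂ _<_ (sym (H-line l w)) (sym (H-line l u))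
    (steeper-above-after {⟪ u , ω ⟫} {cost u} {⟪ w , ω ⟫} {cost w} c< (subst₂ _≤_ (H-line t₁ w) (H-line t₁ u) h) t₁<l)

  H-flatter-before : ∀ {u w t₁ l} → cost u < cost w → H t₁ w ≤ H t₁ u → l < t₁ → H l w < H l u
  H-flatter-before {u} {w} {t₁} {l} c< h l<t₁ = subst₂ _<_ (sym (H-line l w)) (sym (H-line l u))
    (flatter-above-before {⟪ u , ω ⟫} {cost u} {⟪ w , ω ⟫} {cost w} c< (subst₂ _≤_ (H-line t₁ w) (H-line t₁ u) h) l<t₁)

  record EdgeAt (t : ℚ) (u v : Vertex n) : Set where
    field
      valid₁       : ValidVertex u
      valid₂       : ValidVertex v
      tie          : H t u ≡ H t v
      others-below : ∀ w → ValidVertex w → w ≢ u → w ≢ v → H t w < H t u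
      cost<        : cost u < cost v

  edgeAt-max₁ : ∀ {t u v} → EdgeAt t u v → ∀ w → ValidVertex w → H t w ≤ H t u
  edgeAt-max₁ {t} {u} {v} edge w valid-w with w ≟ᵥ u | w ≟ᵥ v
  ... | yes refl | _        = ℚ.≤-refl
  ... | no _     | yes refl = ℚ.≤-reflexive (sym (EdgeAt.tie edge))
  ... | no w≢u   | no w≢v   = ℚ.<⇒≤ (EdgeAt.others-below edge w valid-w w≢u w≢v)

  edgeAt-max₂ : ∀ {t u v} → EdgeAt t u v → ∀ w → ValidVertex w → H t w ≤ H t v
  edgeAt-max₂ edge w valid-w = subst (H _ w ≤_) (EdgeAt.tie edge) (edgeAt-max₁ edge w valid-w)

  edgeAt-preimage : ∀ {t u v} → EdgeAt t u v → PreimageIs n n≥3 c ω t u v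
  edgeAt-preimage {t} {u} {v} edge x = mk⇔ to from
    where
      to : InFace n n≥3 c ω t x → x ≡ u ⊎ x ≡ v
      to h with x ≟ᵥ u | x ≟ᵥ v
      ... | yes x≡u | _       = inj₁ x≡u
      ... | no _    | yes x≡v = inj₂ x≡v
      ... | no x≢u  | no x≢v  = ⊥-elim (ℚ.<-irrefl refl (ℚ.<-≤-trans (EdgeAt.others-below edge x (proj₁ (InFace⇒ {t} {x} h)) x≢u x≢v)
                                                                   (proj₂ (InFace⇒ {t} {x} h) u (EdgeAt.valid₁ edge))))
      from : x ≡ u ⊎ x ≡ v → InFace n n≥3 c ω t x
      from (inj₁ refl) = ⇒InFace (EdgeAt.valid₁ edge) (edgeAt-max₁ edge)
      from (inj₂ refl) = ⇒InFace (EdgeAt.valid₂ edge) (edgeAt-max₂ edge)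

  edgeAt-upper : ∀ {t u v} → EdgeAt t u v → IsUpperEdge n n≥3 c ω t
  edgeAt-upper {t} {u} {v} edge =
    u , v , ⇒InFace (EdgeAt.valid₁ edge) (edgeAt-max₁ edge) , ⇒InFace (EdgeAt.valid₂ edge) (edgeAt-max₂ edge) ,
    λ eq → ℚ.<-irrefl (cong proj₁ eq) (EdgeAt.cost< edge)

  data SweptPath : ℚ → List (Vertex n) → Set where
    one  : ∀ {lo} v → ValidVertex v → (∀ w → ValidVertex w → w ≢ v → cost w < cost v) → SweptPath lo [ v ]
    cons : ∀ {lo} u v rest t → lo < t → EdgeAt t u v → SweptPath t (v ∷ rest) → SweptPath lo (u ∷ v ∷ rest)

  UniqueMax : ℚ → Vertex n → Set
  UniqueMax l S = ∀ w → ValidVertex w → w ≢ S → H l w < H l S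

  MinimalCost : Vertex n → Set
  MinimalCost S = ∀ w → ValidVertex w → w ≢ S → cost S < cost w

  SweptFace : ℚ → List (Vertex n) → Set
  SweptFace l p = (Σ (List (Vertex n)) λ xs → Σ (List (Vertex n)) λ ys → Σ (Vertex n) λ u → Σ (Vertex n) λ v →
                     p ≡ xs ++ u ∷ v ∷ ys × EdgeAt l u v)
                  ⊎ (Σ (Vertex n) λ S → ValidVertex S × UniqueMax l S)

  swept-face-after : ∀ {lo} u rest → SweptPath lo (u ∷ rest) → (∀ w → ValidVertex w → w ≢ u → H lo w ≤ H lo u) →
    ∀ l → lo < l → SweptFace l (u ∷ rest)
  swept-face-after u [] (one .u valid-u max) u-top l lo<l =
    inj₂ (u , valid-u , λ w valid-w w≢u → H-steeper-after (max w valid-w w≢u) (u-top w valid-w w≢u) lo<l)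
  swept-face-after {lo} u (v ∷ rest) (cons .u .v .rest t lo<t edge swept) u-top l lo<l with ℚ.<-cmp l t
  ... | tri< l<t _ _ = inj₂ (u , EdgeAt.valid₁ edge , u-max)
    where
      u-max : UniqueMax l u
      u-max w valid-w w≢u with w ≟ᵥ v
      ... | yes refl = H-flatter-before (EdgeAt.cost< edge) (ℚ.≤-reflexive (sym (EdgeAt.tie edge))) l<t
      ... | no w≢v   = H-<-between (ℚ.<⇒≤ lo<l) (ℚ.<⇒≤ l<t) (u-top w valid-w w≢u) (edgeAt-max₁ edge w valid-w)
                         (inj₂ (lo<l , EdgeAt.others-below edge w valid-w w≢u w≢v))
  ... | tri≈ _ refl _ = inj₁ ([] , rest , u , v , refl , edge)
  ... | tri> _ _ t<l with swept-face-after v rest swept (λ w valid-w _ → edgeAt-max₂ edge w valid-w) l t<l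
  ...   | inj₁ (xs , ys , a , b , e , edge′) = inj₁ (u ∷ xs , ys , a , b , cong (u ∷_) e , edge′)
  ...   | inj₂ max = inj₂ max

  swept-face : ∀ {lo} u rest → SweptPath lo (u ∷ rest) → MinimalCost u → ∀ l → SweptFace l (u ∷ rest)
  swept-face u [] (one .u valid-u max) u-min l =
    inj₂ (u , valid-u , λ w valid-w w≢u → ⊥-elim (ℚ.<-asym (max w valid-w w≢u) (u-min w valid-w w≢u)))
  swept-face u (v ∷ rest) (cons .u .v .rest t lo<t edge swept) u-min l with l ℚ.<? t
  ... | yes l<t = inj₂ (u , EdgeAt.valid₁ edge , λ w valid-w w≢u → H-flatter-before (u-min w valid-w w≢u) (edgeAt-max₁ edge w valid-w) l<t)
  ... | no l≮t  = swept-face-after u (v ∷ rest) (cons u v rest t (p-1<p t) edge swept) u-top l (ℚ.<-≤-trans (p-1<p t) (ℚ.≮⇒≥ l≮t))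
    where
      u-top : ∀ w → ValidVertex w → w ≢ u → H (t ℚ.- 1ℚ) w ≤ H (t ℚ.- 1ℚ) u
      u-top w valid-w w≢u = ℚ.<⇒≤ (H-flatter-before (u-min w valid-w w≢u) (edgeAt-max₁ edge w valid-w) (p-1<p t))

  pathEdge-edgeAt : ∀ {lo} p xs u v ys → SweptPath lo p → p ≡ xs ++ u ∷ v ∷ ys → Σ ℚ λ t → EdgeAt t u v
  pathEdge-edgeAt (a ∷ [])       []            u v ys (one _ _ _) ()
  pathEdge-edgeAt (a ∷ [])       (x ∷ [])      u v ys (one _ _ _) ()
  pathEdge-edgeAt (a ∷ [])       (x ∷ x′ ∷ xs) u v ys (one _ _ _) ()
  pathEdge-edgeAt (a ∷ b ∷ rest) []            u v ys (cons .a .b .rest t _ edge swept) refl = t , edge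
  pathEdge-edgeAt (a ∷ b ∷ rest) (x ∷ xs)      u v ys (cons .a .b .rest t _ edge swept) e =
    pathEdge-edgeAt (b ∷ rest) xs u v ys swept (proj₂ (List.∷-injective e))

  swept-coherent : ∀ {lo} u rest → SweptPath lo (u ∷ rest) → MinimalCost u →
    (∀ l → IsUpperEdge n n≥3 c ω l → ∃[ a ] ∃[ b ] (PathEdge n n≥3 (u ∷ rest) a b × PreimageIs n n≥3 c ω l a b)) ×
    (∀ a b → PathEdge n n≥3 (u ∷ rest) a b → ∃[ l ] (IsUpperEdge n n≥3 c ω l × PreimageIs n n≥3 c ω l a b))
  swept-coherent u rest swept u-min = upper⇒pathEdge , pathEdge⇒upper
    where
      upper⇒pathEdge : ∀ l → IsUpperEdge n n≥3 c ω l → ∃[ a ] ∃[ b ] (PathEdge n n≥3 (u ∷ rest) a b × PreimageIs n n≥3 c ω l a b)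
      upper⇒pathEdge l (v₁ , v₂ , v₁∈ , v₂∈ , π≢) with swept-face u rest swept u-min l
      ... | inj₁ (xs , ys , a , b , e , edge) = a , b , (xs , ys , e) , edgeAt-preimage edge
      ... | inj₂ (S , valid-S , S-max) = ⊥-elim (π≢ (cong (proj n n≥3 c ω) (trans (≡S v₁ v₁∈) (sym (≡S v₂ v₂∈)))))
        where
          ≡S : ∀ x → InFace n n≥3 c ω l x → x ≡ S
          ≡S x x∈ with x ≟ᵥ S
          ... | yes x≡S = x≡S
          ... | no x≢S  = ⊥-elim (ℚ.<-irrefl refl (ℚ.<-≤-trans (S-max x (proj₁ (InFace⇒ {l} {x} x∈)) x≢S) (proj₂ (InFace⇒ {l} {x} x∈) S valid-S)))
      pathEdge⇒upper : ∀ a b → PathEdge n n≥3 (u ∷ rest) a b → ∃[ l ] (IsUpperEdge n n≥3 c ω l × PreimageIs n n≥3 c ω l a b)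
      pathEdge⇒upper a b (xs , ys , e) with pathEdge-edgeAt (u ∷ rest) xs a b ys swept e
      ... | t , edge = t , edgeAt-upper edge , edgeAt-preimage edge

module Slopes (n : ℕ) (n≥3 : 3 ℕ.≤ n) (c : Fin n → ℚ) (c-inc : StrictlyIncreasing c) where

  open Vertices n n≥3
  open +-*-Solver

  C : ℕ → ℚ
  C k = c (toFin (pred k))

  open Arrangements C public

  C-lineNo : ∀ a → C (lineNo a) ≡ c a
  C-lineNo a = cong c (toFin-toℕ a)

  pred< : ∀ {q} → 1 ℕ.≤ q → q ℕ.≤ n → pred q ℕ.< n
  pred< {suc q} _ q≤n = q≤n

  C-< : ∀ {p q} → 1 ℕ.≤ p → p ℕ.< q → q ℕ.≤ n → C p ℚ.< C q
  C-< {p} {q} 1≤p p<q q≤n = c-inc (toFin (pred p)) (toFin (pred q))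
    (subst₂ ℕ._<_ (sym (toℕ-toFin (pred p) (pred< 1≤p (ℕ.<⇒≤ (ℕ.<-≤-trans p<q q≤n)))))
                  (sym (toℕ-toFin (pred q) (pred< (ℕ.≤-trans 1≤p (ℕ.<⇒≤ p<q)) q≤n))) (pred-<-pred 1≤p p<q))

  C-≤ : ∀ {p q} → 1 ℕ.≤ p → p ℕ.≤ q → q ℕ.≤ n → C p ℚ.≤ C q
  C-≤ {p} {q} 1≤p p≤q q≤n with p ℕ.≟ q
  ... | yes refl = ℚ.≤-refl
  ... | no p≢q   = ℚ.<⇒≤ (C-< 1≤p (ℕ.≤∧≢⇒< p≤q p≢q) q≤n)

  C-<⁻¹ : ∀ {p q} → 1 ℕ.≤ p → p ℕ.≤ n → 1 ℕ.≤ q → q ℕ.≤ n → C p ℚ.< C q → p ℕ.< q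
  C-<⁻¹ {p} {q} 1≤p p≤n 1≤q q≤n C<C with ℕ.<-cmp p q
  ... | tri< p<q _ _ = p<q
  ... | tri≈ _ refl _ = ⊥-elim (ℚ.<-irrefl refl C<C)
  ... | tri> _ _ q<p = ⊥-elim (ℚ.<-asym C<C (C-< 1≤q q<p p≤n))

  weightsOf : (ℕ → ℚ) → Fin n → ℚ
  weightsOf Ω a = Ω (lineNo a)

  height-lines : ∀ Ω t v → height n n≥3 c (weightsOf Ω) t v ≡ F Ω (lineNo (proj₁ v)) t ℚ.+ F Ω (lineNo (proj₂ v)) t
  height-lines Ω t (a , b) = begin
      t ℚ.* (c a ℚ.+ c b) ℚ.+ (Ω (lineNo a) ℚ.+ Ω (lineNo b))
        ≡⟨ solve 5 (λ t ca cb wa wb → t :* (ca :+ cb) :+ (wa :+ wb) := (wa :+ ca :* t) :+ (wb :+ cb :* t))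
                   refl t (c a) (c b) (Ω (lineNo a)) (Ω (lineNo b)) ⟩
      (Ω (lineNo a) ℚ.+ c a ℚ.* t) ℚ.+ (Ω (lineNo b) ℚ.+ c b ℚ.* t)
        ≡⟨ sym (cong₂ (λ x y → (Ω (lineNo a) ℚ.+ x ℚ.* t) ℚ.+ (Ω (lineNo b) ℚ.+ y ℚ.* t)) (C-lineNo a) (C-lineNo b)) ⟩
      (Ω (lineNo a) ℚ.+ C (lineNo a) ℚ.* t) ℚ.+ (Ω (lineNo b) ℚ.+ C (lineNo b) ℚ.* t)
        ≡⟨ sym (cong₂ ℚ._+_ (F-unfold Ω (lineNo a) t) (F-unfold Ω (lineNo b) t)) ⟩
      F Ω (lineNo a) t ℚ.+ F Ω (lineNo b) t ∎
    where open ≡-Reasoning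

  sum-lines : ∀ (f : ℕ → ℚ) v {p q} → HasLines v p q → f (lineNo (proj₁ v)) ℚ.+ f (lineNo (proj₂ v)) ≡ f p ℚ.+ f q
  sum-lines f v (inj₁ (e₁ , e₂)) = cong₂ ℚ._+_ (cong f e₁) (cong f e₂)
  sum-lines f v (inj₂ (e₁ , e₂)) = trans (cong₂ ℚ._+_ (cong f e₁) (cong f e₂)) (ℚ.+-comm (f _) (f _))

  cost-hasLines : ∀ v {p q} → HasLines v p q → ⟪ v , c ⟫ ≡ C p ℚ.+ C q
  cost-hasLines (a , b) l = trans (sym (cong₂ ℚ._+_ (C-lineNo a) (C-lineNo b))) (sum-lines C (a , b) l)

  valid-lineNo-< : ∀ {w} → ValidVertex w → lineNo (proj₁ w) ℕ.< lineNo (proj₂ w)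
  valid-lineNo-< a<b = s≤s a<b

  start-cost-minimal : ∀ s → ValidVertex s → HasLines s 2 1 → ∀ w → ValidVertex w → w ≢ s → ⟪ s , c ⟫ ℚ.< ⟪ w , c ⟫
  start-cost-minimal s valid-s lines-s w valid-w w≢s =
    subst₂ ℚ._<_ (sym (trans (cost-hasLines s lines-s) (ℚ.+-comm (C 2) (C 1)))) (sym (cost-hasLines w (inj₁ (refl , refl))))
      (pair-above (lineNo (proj₁ w)) refl)
    where
      q = lineNo (proj₂ w)
      q≤n = proj₂ (lineNo-bounds (proj₂ w))
      pair-above : ∀ p → p ≡ lineNo (proj₁ w) → C 1 ℚ.+ C 2 ℚ.< C p ℚ.+ C q
      pair-above p p≡ with p ℕ.≟ 1
      ... | yes refl = ℚ.+-monoʳ-< (C 1) (C-< (s≤s z≤n) (ℕ.≤∧≢⇒< 1<q q≢2) q≤n)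
        where
          1<q = subst (ℕ._< q) (sym p≡) (valid-lineNo-< {w} valid-w)
          q≢2 = λ e → w≢s (lines-determine-vertex w s 2 1 valid-w valid-s (inj₂ (sym p≡ , sym e)) lines-s)
      ... | no p≢1 = ℚ.+-mono-<-≤ (C-< (s≤s z≤n) 1<p (subst (ℕ._≤ n) (sym p≡) (proj₂ (lineNo-bounds (proj₁ w)))))
                                   (C-≤ (s≤s z≤n) (ℕ.<-≤-trans 1<p (ℕ.<⇒≤ p<q)) q≤n)
        where
          p<q = subst (ℕ._< q) (sym p≡) (valid-lineNo-< {w} valid-w)
          1<p = ℕ.≤∧≢⇒< (subst (1 ℕ.≤_) (sym p≡) (proj₁ (lineNo-bounds (proj₁ w)))) (λ e → p≢1 (sym e))

  end-cost-maximal : ∀ e → ValidVertex e → HasLines e (pred n) n → ∀ w → ValidVertex w → w ≢ e → ⟪ w , c ⟫ ℚ.< ⟪ e , c ⟫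
  end-cost-maximal e valid-e lines-e w valid-w w≢e =
    subst₂ ℚ._<_ (sym (cost-hasLines w (inj₁ (refl , refl)))) (sym (cost-hasLines e lines-e)) (pair-below (lineNo (proj₂ w)) refl)
    where
      p = lineNo (proj₁ w)
      1≤p = proj₁ (lineNo-bounds (proj₁ w))
      pred[n]<n : pred n ℕ.< n
      pred[n]<n = pred< (ℕ.≤-trans (s≤s z≤n) n≥3) ℕ.≤-refl
      pair-below : ∀ q → q ≡ lineNo (proj₂ w) → C p ℚ.+ C q ℚ.< C (pred n) ℚ.+ C n
      pair-below q q≡ with q ℕ.≟ n
      ... | yes refl = ℚ.+-monoˡ-< (C n) (C-< 1≤p (ℕ.≤∧≢⇒< (ℕ.<⇒≤pred p<n) p≢pred[n]) (ℕ.<⇒≤ pred[n]<n))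
        where
          p<n = subst (p ℕ.<_) (sym q≡) (valid-lineNo-< {w} valid-w)
          p≢pred[n] = λ p≡ → w≢e (lines-determine-vertex w e (pred n) n valid-w valid-e (inj₁ (p≡ , sym q≡)) lines-e)
      ... | no q≢n = ℚ.+-mono-≤-< (C-≤ 1≤p (ℕ.<⇒≤pred (ℕ.<-≤-trans p<q (ℕ.<⇒≤ q<n))) (ℕ.<⇒≤ pred[n]<n))
                                   (C-< (subst (1 ℕ.≤_) (sym q≡) (proj₁ (lineNo-bounds (proj₂ w)))) q<n ℕ.≤-refl)
        where
          p<q = subst (p ℕ.<_) (sym q≡) (valid-lineNo-< {w} valid-w)
          q<n = ℕ.≤∧≢⇒< (subst (ℕ._≤ n) (sym q≡) (proj₂ (lineNo-bounds (proj₂ w)))) q≢n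

module Sufficiency (n : ℕ) (n≥3 : 3 ℕ.≤ n) (c : Fin n → ℚ) (c-inc : StrictlyIncreasing c) where

  open StepChains
  open Vertices n n≥3
  open LatticeChains n
  open Slopes n n≥3 c c-inc

  module SweepOf (Ω : ℕ → ℚ) where

    open Sweep n n≥3 c (weightsOf Ω) public

    H-hasLines : ∀ t v {p q} → HasLines v p q → H t v ≡ F Ω p t ℚ.+ F Ω q t
    H-hasLines t v lines = trans (H-def t v) (trans (height-lines Ω t v) (sum-lines (λ k → F Ω k t) v lines))

    secondTie-edgeAt : ∀ {t i j a u v} → SecondTie n Ω t i j a → 1 ℕ.≤ i → i ℕ.< j → j ℕ.≤ n →
      ValidVertex u → ValidVertex v → HasLines u a i → HasLines v a j → EdgeAt t u v
    secondTie-edgeAt {t} {i} {j} {a} {u} {v} tie 1≤i i<j j≤n valid-u valid-v lines-u lines-v = record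
      { valid₁       = valid-u
      ; valid₂       = valid-v
      ; tie          = trans (H-hasLines t u lines-u) (trans (cong (F Ω a t ℚ.+_) (proj₁ (proj₂ tie))) (sym (H-hasLines t v lines-v)))
      ; others-below = others-below
      ; cost<        = subst₂ ℚ._<_ (sym (cost-hasLines u lines-u)) (sym (cost-hasLines v lines-v)) (ℚ.+-monoʳ-< (C a) (C-< 1≤i i<j j≤n))
      }
      where
        others-below : ∀ w → ValidVertex w → w ≢ u → w ≢ v → H t w ℚ.< H t u
        others-below w valid-w w≢u w≢v =
          subst₂ ℚ._<_ (sym (H-hasLines t w (inj₁ (refl , refl)))) (sym (H-hasLines t u lines-u))
            (secondTie-pair-below tie (proj₁ (lineNo-bounds (proj₁ w))) (proj₂ (lineNo-bounds (proj₁ w)))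
               (proj₁ (lineNo-bounds (proj₂ w))) (proj₂ (lineNo-bounds (proj₂ w))) (ℕ.<⇒≢ (valid-lineNo-< {w} valid-w))
               (λ lines-w → w≢u (lines-determine-vertex w u a i valid-w valid-u lines-w lines-u))
               (λ lines-w → w≢v (lines-determine-vertex w v a j valid-w valid-v lines-w lines-v)))

    endPoint-lines : ∀ x y → InGrid n (x , y) → IsEndPoint (just (x , y)) → HasLines (vertexOf (x , y)) (pred n) n
    endPoint-lines x y g (inj₁ refl) = subst (λ k → HasLines (vertexOf (x , y)) k n) (n∸1≡pred[n] n) (proj₂ (vertexOf-lines x y g))
    endPoint-lines x y g (inj₂ refl) =
      subst (λ k → HasLines (vertexOf (x , y)) k n) (n∸1≡pred[n] n) (hasLines-swap (proj₂ (vertexOf-lines x y g)))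

    swept-path : ∀ P R {lo u v} → All (InGrid n) (P ∷ R) → Linked IsStep (P ∷ R) → IsEndPoint (last (P ∷ R)) →
      Realises n Ω lo u v (steps (P ∷ R)) → SweptPath lo (map vertexOf (P ∷ R))
    swept-path (x , y) [] (g ∷ []) _ end _ =
      one (vertexOf (x , y)) valid (end-cost-maximal (vertexOf (x , y)) valid (endPoint-lines x y g end))
      where valid = proj₁ (vertexOf-lines x y g)
    swept-path (x , y) ((x′ , y′) ∷ R) (g ∷ g′ ∷ gs) (st ∷ lk) end realised with x ℕ.≟ x′ | st | realised
    ... | yes refl | inj₂ (_ , x<x) | _ = ⊥-elim (ℕ.<-irrefl refl x<x)
    ... | yes refl | inj₁ (_ , y<y′) | cons θL θR t lo<θL θL≤θR θR<t _ _ _ tie realised′ =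
      cons (vertexOf (x , y)) (vertexOf (x , y′)) (map vertexOf R) t (ℚ.<-trans lo<θL (ℚ.≤-<-trans θL≤θR θR<t))
        (secondTie-edgeAt tie (proj₁ (proj₁ (proj₂ g))) y<y′ (proj₂ (proj₁ (proj₂ g′)))
           (proj₁ (vertexOf-lines x y g)) (proj₁ (vertexOf-lines x y′ g′))
           (proj₂ (vertexOf-lines x y g)) (proj₂ (vertexOf-lines x y′ g′)))
        (swept-path (x , y′) R (g′ ∷ gs) lk end realised′)
    ... | no x≢x′ | inj₁ (x≡x′ , _) | _ = ⊥-elim (x≢x′ x≡x′)
    ... | no x≢x′ | inj₂ (refl , x<x′) | cons θL θR t lo<θL θL≤θR θR<t _ _ _ tie realised′ =
      cons (vertexOf (x , y)) (vertexOf (x′ , y)) (map vertexOf R) t (ℚ.<-trans lo<θL (ℚ.≤-<-trans θL≤θR θR<t))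
        (secondTie-edgeAt tie (proj₁ (proj₁ g)) x<x′ (proj₂ (proj₁ g′))
           (proj₁ (vertexOf-lines x y g)) (proj₁ (vertexOf-lines x′ y g′))
           (hasLines-swap (proj₂ (vertexOf-lines x y g))) (hasLines-swap (proj₂ (vertexOf-lines x′ y g′))))
        (swept-path (x′ , y) R (g′ ∷ gs) lk end realised′)

  realise-lattice-path : ∀ L → CoherentLatticePath n L → Σ (ℕ → ℚ) λ Ω → Σ ℚ λ lo → Realises n Ω lo 1 2 (steps L)
  realise-lattice-path L (diagonalAvoiding , coherent) = transport (realisable (n ∸ 2) (ℕ.≤-reflexive 2+[n∸2]≡n) (steps L) in-steps)
    where
      open Realisability C n C-<
      2+[n∸2]≡n : suc (suc (n ∸ 2)) ≡ n
      2+[n∸2]≡n = ℕ.m+[n∸m]≡n {2} {n} (ℕ.≤-trans (s≤s (s≤s z≤n)) n≥3)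
      chain = diagonalAvoiding-chain L diagonalAvoiding
      in-steps : CoherentChain (suc (suc (n ∸ 2))) (steps L)
      in-steps = subst (λ m → Chain m 1 2 (steps L)) (sym 2+[n∸2]≡n) (proj₁ chain) ,
                 subst (λ m → IsFinal m (finalState 1 2 (steps L))) (sym 2+[n∸2]≡n) (proj₂ chain) ,
                 coherentSequence⇒allPairs (steps L) coherent
      transport : Σ (ℕ → ℚ) (λ Ω → Σ ℚ λ lo → Realises (suc (suc (n ∸ 2))) Ω lo 1 2 (steps L)) →
                  Σ (ℕ → ℚ) (λ Ω → Σ ℚ λ lo → Realises n Ω lo 1 2 (steps L))
      transport (Ω , lo , realised) = Ω , lo , subst (λ m → Realises m Ω lo 1 2 (steps L)) 2+[n∸2]≡n realised

  coherentLattice⇒coherent : ∀ L → CoherentLatticePath n L → Coherent n n≥3 c (map vertexOf L)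
  coherentLattice⇒coherent []      ((_ , () , _) , _)
  coherentLattice⇒coherent (P ∷ R) lattice@((gs , refl , end , lk) , _) with realise-lattice-path (P ∷ R) lattice
  ... | Ω , lo , realised =
    weightsOf Ω , SweepOf.swept-coherent Ω (vertexOf (2 , 1)) (map vertexOf R) (SweepOf.swept-path Ω (2 , 1) R gs lk end realised)
      (start-cost-minimal (vertexOf (2 , 1)) (proj₁ (vertexOf-lines 2 1 start-in-grid)) (proj₂ (vertexOf-lines 2 1 start-in-grid)))

module Adjacency (n : ℕ) (n≥3 : 3 ℕ.≤ n) where

  open Vertices n n≥3

  _∈ᵥ_ : ℕ → Vertex n → Set
  k ∈ᵥ w = k ≡ lineNo (proj₁ w) ⊎ k ≡ lineNo (proj₂ w)

  memb-true : ∀ e w {p q} → HasLines w p q → lineNo e ≡ p ⊎ lineNo e ≡ q → memb e w ≡ true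
  memb-true e (w₁ , w₂) lines e∈ with e Fin.≟ w₁
  ... | yes _ = refl
  ... | no e≢w₁ with e Fin.≟ w₂
  ...   | yes _ = refl
  ...   | no e≢w₂ = ⊥-elim (absurd lines e∈)
    where
      absurd : HasLines (w₁ , w₂) _ _ → _ → ⊥
      absurd (inj₁ (l₁ , l₂)) (inj₁ e≡) = e≢w₁ (lineNo-injective (trans e≡ (sym l₁)))
      absurd (inj₁ (l₁ , l₂)) (inj₂ e≡) = e≢w₂ (lineNo-injective (trans e≡ (sym l₂)))
      absurd (inj₂ (l₁ , l₂)) (inj₁ e≡) = e≢w₂ (lineNo-injective (trans e≡ (sym l₂)))
      absurd (inj₂ (l₁ , l₂)) (inj₂ e≡) = e≢w₁ (lineNo-injective (trans e≡ (sym l₁)))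

  memb-false : ∀ e w {p q} → HasLines w p q → lineNo e ≢ p → lineNo e ≢ q → memb e w ≡ false
  memb-false e (w₁ , w₂) lines e≢p e≢q with e Fin.≟ w₁
  ... | yes refl = ⊥-elim ([ (λ l → e≢p (proj₁ l)) , (λ l → e≢q (proj₁ l)) ]′ lines)
  ... | no _ with e Fin.≟ w₂
  ...   | yes refl = ⊥-elim ([ (λ l → e≢q (proj₂ l)) , (λ l → e≢p (proj₂ l)) ]′ lines)
  ...   | no _ = refl

  memb-true⇒∈ : ∀ e w → memb e w ≡ true → lineNo e ∈ᵥ w
  memb-true⇒∈ e (w₁ , w₂) h with e Fin.≟ w₁
  ... | yes refl = inj₁ refl
  ... | no _ with e Fin.≟ w₂
  memb-true⇒∈ e (w₁ , w₂) h  | no _ | yes refl = inj₂ refl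
  memb-true⇒∈ e (w₁ , w₂) () | no _ | no _

  memb-false⇒∉ : ∀ e w → memb e w ≡ false → ¬ lineNo e ∈ᵥ w
  memb-false⇒∉ e (w₁ , w₂) h with e Fin.≟ w₁
  memb-false⇒∉ e (w₁ , w₂) () | yes _
  ... | no e≢w₁ with e Fin.≟ w₂
  memb-false⇒∉ e (w₁ , w₂) () | no e≢w₁ | yes _
  ... | no e≢w₂ = [ (λ e≡ → e≢w₁ (lineNo-injective e≡)) , (λ e≡ → e≢w₂ (lineNo-injective e≡)) ]′

  sharedCount≡1 : ∀ v w {s r r′} → HasLines v s r → HasLines w s r′ → r ≢ s → r ≢ r′ → sharedCount v w ≡ 1
  sharedCount≡1 (v₁ , v₂) w (inj₁ (l₁ , l₂)) lines-w r≢s r≢r′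
    rewrite memb-true v₁ w lines-w (inj₁ l₁) | memb-false v₂ w lines-w (λ e → r≢s (trans (sym l₂) e)) (λ e → r≢r′ (trans (sym l₂) e)) = refl
  sharedCount≡1 (v₁ , v₂) w (inj₂ (l₁ , l₂)) lines-w r≢s r≢r′
    rewrite memb-false v₁ w lines-w (λ e → r≢s (trans (sym l₁) e)) (λ e → r≢r′ (trans (sym l₁) e)) | memb-true v₂ w lines-w (inj₁ l₂) = refl

  sharedCount≡1⇒ : ∀ v w {x y} → HasLines v x y → sharedCount v w ≡ 1 → (x ∈ᵥ w × ¬ y ∈ᵥ w) ⊎ (¬ x ∈ᵥ w × y ∈ᵥ w)
  sharedCount≡1⇒ (v₁ , v₂) w lines shared with memb v₁ w in eq₁ | memb v₂ w in eq₂ | shared | lines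
  ... | true  | false | _ | inj₁ (l₁ , l₂) = inj₁ (subst (_∈ᵥ w) l₁ (memb-true⇒∈ v₁ w eq₁) , subst (λ k → ¬ k ∈ᵥ w) l₂ (memb-false⇒∉ v₂ w eq₂))
  ... | true  | false | _ | inj₂ (l₁ , l₂) = inj₂ (subst (λ k → ¬ k ∈ᵥ w) l₂ (memb-false⇒∉ v₂ w eq₂) , subst (_∈ᵥ w) l₁ (memb-true⇒∈ v₁ w eq₁))
  ... | false | true  | _ | inj₁ (l₁ , l₂) = inj₂ (subst (λ k → ¬ k ∈ᵥ w) l₁ (memb-false⇒∉ v₁ w eq₁) , subst (_∈ᵥ w) l₂ (memb-true⇒∈ v₂ w eq₂))
  ... | false | true  | _ | inj₂ (l₁ , l₂) = inj₁ (subst (_∈ᵥ w) l₂ (memb-true⇒∈ v₂ w eq₂) , subst (λ k → ¬ k ∈ᵥ w) l₁ (memb-false⇒∉ v₁ w eq₁))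
  ... | true  | true  | () | _
  ... | false | false | () | _

module Encoding (n : ℕ) (n≥3 : 3 ℕ.≤ n) (c : Fin n → ℚ) (c-inc : StrictlyIncreasing c) where

  open Vertices n n≥3
  open LatticeChains n
  open Adjacency n n≥3
  open Slopes n n≥3 c c-inc using (C; C-<; C-<⁻¹; cost-hasLines; valid-lineNo-<)

  nextPointAB : ℕ → ℕ → ℕ → ℕ → Point
  nextPointAB x y a b =
    if ⌊ x ℕ.≟ a ⌋ then (x , b) else if ⌊ x ℕ.≟ b ⌋ then (x , a) else if ⌊ y ℕ.≟ a ⌋ then (b , y) else (a , y)

  nextPoint : Point → Vertex n → Point
  nextPoint (x , y) w = nextPointAB x y (lineNo (proj₁ w)) (lineNo (proj₂ w))

  trace : Point → List (Vertex n) → List Point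
  trace P []       = [ P ]
  trace P (w ∷ ws) = P ∷ trace (nextPoint P w) ws

  decode : List (Vertex n) → List Point
  decode []       = []
  decode (v ∷ vs) = trace (2 , 1) vs

  nextPointAB-keep₁ : ∀ x y a b y′ → (a ≡ x × b ≡ y′) ⊎ (a ≡ y′ × b ≡ x) → x ≢ y′ → nextPointAB x y a b ≡ (x , y′)
  nextPointAB-keep₁ x y a b y′ lines x≢y′ with x ℕ.≟ a | lines
  ... | yes refl | inj₁ (_ , refl) = refl
  ... | yes refl | inj₂ (x≡y′ , _) = ⊥-elim (x≢y′ x≡y′)
  ... | no x≢a   | inj₁ (a≡x , _) = ⊥-elim (x≢a (sym a≡x))
  ... | no x≢a   | inj₂ (refl , refl) with x ℕ.≟ x
  ...   | yes _  = refl
  ...   | no x≢x = ⊥-elim (x≢x refl)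

  nextPointAB-keep₂ : ∀ x y a b x′ → (a ≡ x′ × b ≡ y) ⊎ (a ≡ y × b ≡ x′) → x ≢ x′ → x ≢ y → x′ ≢ y → nextPointAB x y a b ≡ (x′ , y)
  nextPointAB-keep₂ x y a b x′ lines x≢x′ x≢y x′≢y with x ℕ.≟ a | x ℕ.≟ b
  ... | yes x≡a | _       = ⊥-elim ([ (λ l → x≢x′ (trans x≡a (proj₁ l))) , (λ l → x≢y (trans x≡a (proj₁ l))) ]′ lines)
  ... | no _    | yes x≡b = ⊥-elim ([ (λ l → x≢y (trans x≡b (proj₂ l))) , (λ l → x≢x′ (trans x≡b (proj₂ l))) ]′ lines)
  ... | no _    | no _ with y ℕ.≟ a | lines
  ...   | yes y≡a | inj₁ (a≡x′ , _) = ⊥-elim (x′≢y (sym (trans y≡a a≡x′)))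
  ...   | yes _   | inj₂ (_ , refl) = refl
  ...   | no _    | inj₁ (refl , _) = refl
  ...   | no y≢a  | inj₂ (a≡y , _)  = ⊥-elim (y≢a (sym a≡y))

  nextPoint-vertexOf : ∀ P P′ → IsStep P P′ → InGrid n P → InGrid n P′ → nextPoint P (vertexOf P′) ≡ P′
  nextPoint-vertexOf (x , y) (x′ , y′) (inj₁ (refl , y<y′)) g g′ =
    nextPointAB-keep₁ x y _ _ y′ (proj₂ (vertexOf-lines x y′ g′)) (proj₂ (proj₂ g′))
  nextPoint-vertexOf (x , y) (x′ , y′) (inj₂ (refl , x<x′)) g g′ =
    nextPointAB-keep₂ x y _ _ x′ (proj₂ (vertexOf-lines x′ y g′)) (ℕ.<⇒≢ x<x′) (proj₂ (proj₂ g)) (proj₂ (proj₂ g′))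

  trace-map : ∀ P R → All (InGrid n) (P ∷ R) → Linked IsStep (P ∷ R) → trace P (map vertexOf R) ≡ P ∷ R
  trace-map P []        _            _         = refl
  trace-map P (P′ ∷ R) (g ∷ g′ ∷ gs) (st ∷ lk) =
    cong (P ∷_) (trans (cong (λ Q → trace Q (map vertexOf R)) (nextPoint-vertexOf P P′ st g g′)) (trace-map P′ R (g′ ∷ gs) lk))

  decode-map : ∀ L → DiagonalAvoidingPath n L → decode (map vertexOf L) ≡ L
  decode-map []      _                    = refl
  decode-map (P ∷ R) (gs , refl , _ , lk) = trace-map P R gs lk

  MonotoneEdge : Vertex n → Vertex n → Set
  MonotoneEdge v w = Adjacent v w × ⟪ v , c ⟫ ℚ.< ⟪ w , c ⟫

  step-monotone : ∀ P P′ → IsStep P P′ → InGrid n P → InGrid n P′ → MonotoneEdge (vertexOf P) (vertexOf P′)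
  step-monotone (x , y) (x′ , y′) (inj₁ (refl , y<y′)) g@(_ , (1≤y , _) , x≢y) g′@(_ , (_ , y′≤n) , _) =
    sharedCount≡1 (vertexOf (x , y)) (vertexOf (x , y′)) (proj₂ (vertexOf-lines x y g)) (proj₂ (vertexOf-lines x y′ g′))
      (λ e → x≢y (sym e)) (ℕ.<⇒≢ y<y′) ,
    subst₂ ℚ._<_ (sym (cost-hasLines _ (proj₂ (vertexOf-lines x y g)))) (sym (cost-hasLines _ (proj₂ (vertexOf-lines x y′ g′))))
      (ℚ.+-monoʳ-< (C x) (C-< 1≤y y<y′ y′≤n))
  step-monotone (x , y) (x′ , y′) (inj₂ (refl , x<x′)) g@((1≤x , _) , _ , x≢y) g′@((_ , x′≤n) , _) =
    sharedCount≡1 (vertexOf (x , y)) (vertexOf (x′ , y)) (hasLines-swap (proj₂ (vertexOf-lines x y g)))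
      (hasLines-swap (proj₂ (vertexOf-lines x′ y g′))) x≢y (ℕ.<⇒≢ x<x′) ,
    subst₂ ℚ._<_ (sym (cost-hasLines _ (proj₂ (vertexOf-lines x y g)))) (sym (cost-hasLines _ (proj₂ (vertexOf-lines x′ y g′))))
      (ℚ.+-monoˡ-< (C y) (C-< 1≤x x<x′ x′≤n))

  linked-monotone : ∀ L → All (InGrid n) L → Linked IsStep L → Linked MonotoneEdge (map vertexOf L)
  linked-monotone []            _            _         = []
  linked-monotone (P ∷ [])      _            _         = [-]
  linked-monotone (P ∷ P′ ∷ R) (g ∷ g′ ∷ gs) (st ∷ lk) = step-monotone P P′ st g g′ ∷ linked-monotone (P′ ∷ R) (g′ ∷ gs) lk

  diagonalAvoiding⇒monotone : ∀ L → DiagonalAvoidingPath n L → MonotonePath n n≥3 c (map vertexOf L)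
  diagonalAvoiding⇒monotone []      (_ , () , _)
  diagonalAvoiding⇒monotone (P ∷ R) (gs , refl , end , lk) =
    All.map⁺ (All.map (λ g → proj₁ (vertexOf-lines _ _ g)) gs) ,
    cong just (sym startVertex≡) ,
    trans (List.last-map vertexOf (P ∷ R)) (last≡ end) ,
    linked-monotone (P ∷ R) gs lk
    where
      last≡ : IsEndPoint (last (P ∷ R)) → Maybe.map vertexOf (last (P ∷ R)) ≡ just (endVertex n n≥3)
      last≡ (inj₁ e) = trans (cong (Maybe.map vertexOf) e) (cong just (sym endVertex≡))
      last≡ (inj₂ e) = trans (cong (Maybe.map vertexOf) e)
                             (cong just (trans (vertexOf-swap n (n ∸ 1) (inGrid-swap end-in-grid)) (sym endVertex≡)))

  other-line : ∀ {k a b} → k ≡ a ⊎ k ≡ b → a ℕ.< b → Σ ℕ λ o → ((a ≡ k × b ≡ o) ⊎ (a ≡ o × b ≡ k)) × k ≢ o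
  other-line {k} {a} {b} (inj₁ refl) a<b = b , inj₁ (refl , refl) , ℕ.<⇒≢ a<b
  other-line {k} {a} {b} (inj₂ refl) a<b = a , inj₂ (refl , refl) , ℕ.>⇒≢ a<b

  -- Exactly one of x , y is a line of w (adjacency), and the cost increases, so the step goes up.
  nextPoint-monotone : ∀ x y w → InGrid n (x , y) → ValidVertex w → MonotoneEdge (vertexOf (x , y)) w →
    vertexOf (nextPoint (x , y) w) ≡ w × InGrid n (nextPoint (x , y) w) × IsStep (x , y) (nextPoint (x , y) w)
  nextPoint-monotone x y w g@((1≤x , x≤n) , (1≤y , y≤n) , x≢y) valid-w (adjacent , cost<)
    with sharedCount≡1⇒ (vertexOf (x , y)) w (proj₂ (vertexOf-lines x y g)) adjacent
  ... | inj₁ (x∈w , _) with other-line x∈w (valid-lineNo-< {w} valid-w)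
  ...   | o , lines , x≢o =
    subst (λ P → vertexOf P ≡ w × InGrid n P × IsStep (x , y) P) (sym (nextPointAB-keep₁ x y _ _ o lines x≢o))
      (lines-determine-vertex (vertexOf (x , o)) w x o (proj₁ (vertexOf-lines x o g′)) valid-w (proj₂ (vertexOf-lines x o g′)) lines ,
       g′ , inj₁ (refl , y<o))
    where
      o-bounds : 1 ℕ.≤ o × o ℕ.≤ n
      o-bounds = [ (λ l → subst (λ k → 1 ℕ.≤ k × k ℕ.≤ n) (proj₂ l) (lineNo-bounds (proj₂ w))) ,
                   (λ l → subst (λ k → 1 ℕ.≤ k × k ℕ.≤ n) (proj₁ l) (lineNo-bounds (proj₁ w))) ]′ lines
      g′ : InGrid n (x , o)
      g′ = (1≤x , x≤n) , o-bounds , x≢o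
      y<o : y ℕ.< o
      y<o = C-<⁻¹ 1≤y y≤n (proj₁ o-bounds) (proj₂ o-bounds)
              (AffineLines.+-cancelˡ-< {C x} (subst₂ ℚ._<_ (cost-hasLines _ (proj₂ (vertexOf-lines x y g))) (cost-hasLines w lines) cost<))
  nextPoint-monotone x y w g@((1≤x , x≤n) , (1≤y , y≤n) , x≢y) valid-w (adjacent , cost<)
    | inj₂ (x∉w , y∈w) with other-line y∈w (valid-lineNo-< {w} valid-w)
  ...   | o , lines , y≢o =
    subst (λ P → vertexOf P ≡ w × InGrid n P × IsStep (x , y) P)
      (sym (nextPointAB-keep₂ x y _ _ o (swap lines) x≢o x≢y (λ e → y≢o (sym e))))
      (lines-determine-vertex (vertexOf (o , y)) w o y (proj₁ (vertexOf-lines o y g′)) valid-w (proj₂ (vertexOf-lines o y g′)) (swap lines) ,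
       g′ , inj₂ (refl , x<o))
    where
      swap : ∀ {a b} → (a ≡ y × b ≡ o) ⊎ (a ≡ o × b ≡ y) → (a ≡ o × b ≡ y) ⊎ (a ≡ y × b ≡ o)
      swap (inj₁ l) = inj₂ l
      swap (inj₂ l) = inj₁ l
      o-bounds : 1 ℕ.≤ o × o ℕ.≤ n
      o-bounds = [ (λ l → subst (λ k → 1 ℕ.≤ k × k ℕ.≤ n) (proj₂ l) (lineNo-bounds (proj₂ w))) ,
                   (λ l → subst (λ k → 1 ℕ.≤ k × k ℕ.≤ n) (proj₁ l) (lineNo-bounds (proj₁ w))) ]′ lines
      x≢o : x ≢ o
      x≢o e = x∉w ([ (λ l → inj₂ (trans e (sym (proj₂ l)))) , (λ l → inj₁ (trans e (sym (proj₁ l)))) ]′ lines)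
      g′ : InGrid n (o , y)
      g′ = o-bounds , (1≤y , y≤n) , λ e → y≢o (sym e)
      x<o : x ℕ.< o
      x<o = C-<⁻¹ 1≤x x≤n (proj₁ o-bounds) (proj₂ o-bounds)
              (AffineLines.+-cancelʳ-< {C y} (subst₂ ℚ._<_ (cost-hasLines _ (proj₂ (vertexOf-lines x y g))) (cost-hasLines w (swap lines)) cost<))

  lines-unique : ∀ v {x y p q} → HasLines v x y → HasLines v p q → (x ≡ p × y ≡ q) ⊎ (x ≡ q × y ≡ p)
  lines-unique v (inj₁ (a , b)) (inj₁ (a′ , b′)) = inj₁ (trans (sym a) a′ , trans (sym b) b′)
  lines-unique v (inj₁ (a , b)) (inj₂ (a′ , b′)) = inj₂ (trans (sym a) a′ , trans (sym b) b′)
  lines-unique v (inj₂ (a , b)) (inj₁ (a′ , b′)) = inj₂ (trans (sym b) b′ , trans (sym a) a′)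
  lines-unique v (inj₂ (a , b)) (inj₂ (a′ , b′)) = inj₁ (trans (sym b) b′ , trans (sym a) a′)

  endVertex⇒endPoint : ∀ x y → InGrid n (x , y) → vertexOf (x , y) ≡ endVertex n n≥3 → IsEndPoint (just (x , y))
  endVertex⇒endPoint x y g e
    with lines-unique (vertexOf (x , y)) (proj₂ (vertexOf-lines x y g))
           (subst (λ v → HasLines v (n ∸ 1) n) (sym (trans e endVertex≡)) (proj₂ (vertexOf-lines (n ∸ 1) n end-in-grid)))
  ... | inj₁ (refl , refl) = inj₁ refl
  ... | inj₂ (refl , refl) = inj₂ refl

  trace-valid : ∀ P v vs → InGrid n P → vertexOf P ≡ v → All ValidVertex (v ∷ vs) → Linked MonotoneEdge (v ∷ vs) →
    last (v ∷ vs) ≡ just (endVertex n n≥3) →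
    map vertexOf (trace P vs) ≡ v ∷ vs × All (InGrid n) (trace P vs) × Linked IsStep (trace P vs) × IsEndPoint (last (trace P vs))
  trace-valid (x , y) v [] g e _ _ last≡ =
    cong [_] e , g ∷ [] , [-] , endVertex⇒endPoint x y g (trans e (Maybe.just-injective last≡))
  trace-valid (x , y) v (w ∷ ws) g refl (_ ∷ valid-w ∷ valid) (edge ∷ lk) last≡ with nextPoint-monotone x y w g valid-w edge
  ... | vertex≡ , g′ , st with trace-valid (nextPoint (x , y) w) w ws g′ vertex≡ (valid-w ∷ valid) lk last≡
  ...   | map≡ , gs , steps-lk , end = cong (vertexOf (x , y) ∷_) map≡ , g ∷ gs , linked-cons ws steps-lk , subst IsEndPoint (sym (last-cons ws)) end
    where
      linked-cons : ∀ ws → Linked IsStep (trace (nextPoint (x , y) w) ws) → Linked IsStep ((x , y) ∷ trace (nextPoint (x , y) w) ws)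
      linked-cons []      _  = st ∷ [-]
      linked-cons (_ ∷ _) lk = st ∷ lk
      last-cons : ∀ ws → last ((x , y) ∷ trace (nextPoint (x , y) w) ws) ≡ last (trace (nextPoint (x , y) w) ws)
      last-cons []      = refl
      last-cons (_ ∷ _) = refl

  head-trace : ∀ P ws → head (trace P ws) ≡ just P
  head-trace P []      = refl
  head-trace P (w ∷ ws) = refl

  decode-monotone : ∀ p → MonotonePath n n≥3 c p → map vertexOf (decode p) ≡ p × DiagonalAvoidingPath n (decode p)
  decode-monotone []       (_ , () , _)
  decode-monotone (v ∷ vs) (valid , head≡ , last≡ , lk)
    with trace-valid (2 , 1) v vs start-in-grid (trans (sym startVertex≡) (sym (Maybe.just-injective head≡))) valid lk last≡
  ... | map≡ , gs , steps-lk , end = map≡ , gs , head-trace (2 , 1) vs , end , steps-lk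

module Necessity (n : ℕ) (n≥3 : 3 ℕ.≤ n) (c : Fin n → ℚ) (c-inc : StrictlyIncreasing c) where

  open import Data.Nat.Base using (_<_; _≤_)
  open EStep
  open Vertices n n≥3
  open Slopes n n≥3 c c-inc using (F; F-steeper-after; C-<; height-lines; weightsOf; sum-lines)
  open Encoding n n≥3 c c-inc using (decode; decode-monotone; MonotoneEdge)

  steps-split : ∀ L xs s rest → steps L ≡ xs ++ s ∷ rest →
    Σ (List Point) λ A → Σ Point λ P → Σ Point λ P′ → Σ (List Point) λ R →
      L ≡ A ++ P ∷ P′ ∷ R × s ≡ enhanced P P′ × steps (P′ ∷ R) ≡ rest
  steps-split []            []       s rest ()
  steps-split []            (_ ∷ _)  s rest ()
  steps-split (P ∷ [])      []       s rest ()
  steps-split (P ∷ [])      (_ ∷ _)  s rest ()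
  steps-split (P ∷ P′ ∷ R) []       s rest e = [] , P , P′ , R , refl , sym (proj₁ (List.∷-injective e)) , proj₂ (List.∷-injective e)
  steps-split (P ∷ P′ ∷ R) (_ ∷ xs) s rest e with steps-split (P′ ∷ R) xs s rest (proj₂ (List.∷-injective e))
  ... | A , Q , Q′ , R′ , L≡ , s≡ , rest≡ = P ∷ A , Q , Q′ , R′ , cong (P ∷_) L≡ , s≡ , rest≡

  linked-at : ∀ {A : Set} {R : A → A → Set} (As : List A) {x y rest} → Linked R (As ++ x ∷ y ∷ rest) → R x y
  linked-at []           (r ∷ _)  = r
  linked-at (a ∷ [])     (_ ∷ lk) = linked-at [] lk
  linked-at (a ∷ b ∷ As) (_ ∷ lk) = linked-at (b ∷ As) lk

  linked-drop : ∀ {A : Set} {R : A → A → Set} (As : List A) {xs} → Linked R (As ++ xs) → Linked R xs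
  linked-drop []           lk               = lk
  linked-drop (a ∷ [])     {[]}     lk      = []
  linked-drop (a ∷ [])     {x ∷ xs} (_ ∷ lk) = lk
  linked-drop (a ∷ b ∷ As) (_ ∷ lk)         = linked-drop (b ∷ As) lk

  linked-< : ∀ {A : Set} (f : A → ℚ) {R : A → A → Set} → (∀ {a b} → R a b → f a ℚ.< f b) →
    ∀ x (Cs : List A) {y rest} → Linked R (x ∷ Cs ++ y ∷ rest) → f x ℚ.< f y
  linked-< f mono x []        (r ∷ _)  = mono r
  linked-< f mono x (c′ ∷ Cs) (r ∷ lk) = ℚ.<-trans (mono r) (linked-< f mono c′ Cs lk)

  linked-<-second : ∀ {A : Set} (f : A → ℚ) {R : A → A → Set} → (∀ {a b} → R a b → f a ℚ.< f b) →
    ∀ (B : List A) {y z rest} x xs → Linked R (x ∷ xs) → x ∷ xs ≡ B ++ y ∷ z ∷ rest → f x ℚ.< f z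
  linked-<-second f mono []      x xs        (r ∷ _) refl = mono r
  linked-<-second f mono (b ∷ B) {y} {z} {rest} x xs lk e with List.∷-injective e
  ... | refl , refl = linked-< f mono x (B ++ [ y ]) (subst (Linked _) (cong (x ∷_) (sym (List.++-assoc B [ y ] (z ∷ rest)))) lk)

  all-at₂ : ∀ {A : Set} {P : A → Set} (As : List A) {x y rest} → All P (As ++ x ∷ y ∷ rest) → P x × P y
  all-at₂ As ps with All.++⁻ʳ As ps
  ... | px ∷ py ∷ _ = px , py

  record StepLines (P P′ : Point) (s : EStep) : Set where
    field
      before       : HasLines (vertexOf P) (fixed s) (from s)
      after        : HasLines (vertexOf P′) (fixed s) (to s)
      fixed-bounds : 1 ≤ fixed s × fixed s ≤ n
      from-bounds  : 1 ≤ from s × from s ≤ n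
      to≤n         : to s ≤ n

  step-lines : ∀ P P′ → IsStep P P′ → InGrid n P → InGrid n P′ → StepLines P P′ (enhanced P P′)
  step-lines (x , y) (x′ , y′) st g g′ with x ℕ.≟ x′ | st
  ... | yes refl | inj₁ (_ , y<y′) = record
    { before = proj₂ (vertexOf-lines x y g) ; after = proj₂ (vertexOf-lines x y′ g′)
    ; fixed-bounds = proj₁ g ; from-bounds = proj₁ (proj₂ g) ; to≤n = proj₂ (proj₁ (proj₂ g′)) }
  ... | yes refl | inj₂ (_ , x<x)  = ⊥-elim (ℕ.<-irrefl refl x<x)
  ... | no x≢x′  | inj₁ (x≡x′ , _) = ⊥-elim (x≢x′ x≡x′)
  ... | no _     | inj₂ (refl , x<x′) = record
    { before = hasLines-swap (proj₂ (vertexOf-lines x y g)) ; after = hasLines-swap (proj₂ (vertexOf-lines x′ y g′))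
    ; fixed-bounds = proj₁ (proj₂ g) ; from-bounds = proj₁ g ; to≤n = proj₂ (proj₁ g′) }

  module WithWeights (ω : Fin n → ℚ) where

    open Sweep n n≥3 c ω

    Ω : ℕ → ℚ
    Ω k = ω (toFin (pred k))

    H-hasLines : ∀ l v {p q} → HasLines v p q → H l v ≡ F Ω p l ℚ.+ F Ω q l
    H-hasLines l (a , b) lines =
      trans (H-def l (a , b))
        (trans (cong₂ (λ p q → l ℚ.* (c a ℚ.+ c b) ℚ.+ (p ℚ.+ q)) (cong ω (sym (toFin-toℕ a))) (cong ω (sym (toFin-toℕ b))))
          (trans (height-lines Ω l (a , b)) (sum-lines (λ k → F Ω k l) (a , b) lines)))

    preimage-max₁ : ∀ {l u v} → PreimageIs n n≥3 c ω l u v → ValidVertex u × (∀ w → ValidVertex w → H l w ℚ.≤ H l u)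
    preimage-max₁ {l} {u} {v} preimage = InFace⇒ {l} {u} (Equivalence.from (preimage u) (inj₁ refl))

    preimage-max₂ : ∀ {l u v} → PreimageIs n n≥3 c ω l u v → ValidVertex v × (∀ w → ValidVertex w → H l w ℚ.≤ H l v)
    preimage-max₂ {l} {u} {v} preimage = InFace⇒ {l} {v} (Equivalence.from (preimage v) (inj₂ refl))

    preimage-strict : ∀ {l u v w} → PreimageIs n n≥3 c ω l u v → ValidVertex w → w ≢ u → w ≢ v → H l w ℚ.< H l v
    preimage-strict {l} {u} {v} {w} preimage valid-w w≢u w≢v with ℚ.<-cmp (H l w) (H l v)
    ... | tri< w<v _ _ = w<v
    ... | tri≈ _ w≡v _ = ⊥-elim ([ w≢u , w≢v ]′ (Equivalence.to (preimage w)
                           (⇒InFace {l} {w} valid-w (λ w′ valid-w′ → subst (H l w′ ℚ.≤_) (sym w≡v) (proj₂ (preimage-max₂ {l} {u} {v} preimage) w′ valid-w′)))))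
    ... | tri> _ _ v<w = ⊥-elim (ℚ.<-irrefl refl (ℚ.<-≤-trans v<w (proj₂ (preimage-max₂ {l} {u} {v} preimage) w valid-w)))

    edge-parameters-< : ∀ {l₁ l₂ u₁ v₁ u₂ v₂} → PreimageIs n n≥3 c ω l₁ u₁ v₁ → PreimageIs n n≥3 c ω l₂ u₂ v₂ →
      cost u₁ ℚ.< cost v₁ → cost v₁ ℚ.< cost v₂ → l₁ ℚ.< l₂
    edge-parameters-< {l₁} {l₂} {u₁} {v₁} {u₂} {v₂} preimage₁ preimage₂ c₁ c₂ = order (ℚ.<-cmp l₁ l₂)
      where
        max₁ = preimage-max₂ {l₁} {u₁} {v₁} preimage₁
        max₂ = preimage-max₂ {l₂} {u₂} {v₂} preimage₂
        v₂<v₁ : H l₁ v₂ ℚ.< H l₁ v₁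
        v₂<v₁ = preimage-strict {l₁} {u₁} {v₁} preimage₁ (proj₁ max₂) (λ { refl → ℚ.<-asym c₁ c₂ }) (λ { refl → ℚ.<-irrefl refl c₂ })
        v₁≤v₂ : H l₂ v₁ ℚ.≤ H l₂ v₂
        v₁≤v₂ = proj₂ max₂ v₁ (proj₁ max₁)
        order : Tri (l₁ ℚ.< l₂) (l₁ ≡ l₂) (l₂ ℚ.< l₁) → l₁ ℚ.< l₂
        order (tri< l₁<l₂ _ _) = l₁<l₂
        order (tri≈ _ l₁≡l₂ _) = ⊥-elim (ℚ.<-irrefl refl (ℚ.<-≤-trans v₂<v₁ (subst (λ l → H l v₁ ℚ.≤ H l v₂) (sym l₁≡l₂) v₁≤v₂)))
        order (tri> _ _ l₂<l₁) = ⊥-elim (ℚ.<-irrefl refl (ℚ.<-≤-trans (H-flatter-before c₂ (ℚ.<⇒≤ v₂<v₁) l₂<l₁) v₁≤v₂))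

    -- At l₁ the vertex {a , j} beats {a , x}, so line x lies below the steeper line j; at l₂ > l₁ the vertex
    -- {z , x} beats {z , j}, so x is above j again: impossible.
    incoherent-impossible : ∀ {l₁ l₂ u₁ v₁ u₂ v₂ a j z x} → l₁ ℚ.< l₂ →
      PreimageIs n n≥3 c ω l₁ u₁ v₁ → PreimageIs n n≥3 c ω l₂ u₂ v₂ →
      HasLines v₁ a j → HasLines u₂ z x → x < j → x ≢ a → j ≢ z →
      1 ≤ a × a ≤ n → 1 ≤ x × x ≤ n → j ≤ n → 1 ≤ z × z ≤ n → ⊥
    incoherent-impossible {l₁} {l₂} {u₁} {v₁} {u₂} {v₂} {a} {j} {z} {x} l₁<l₂ preimage₁ preimage₂ lines-v₁ lines-u₂ x<j x≢a j≢z
                          a-bounds x-bounds@(1≤x , _) j≤n z-bounds =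
      ℚ.<-irrefl refl (ℚ.<-≤-trans (F-steeper-after Ω j x (C-< 1≤x x<j j≤n) x≤j-at-l₁ l₁<l₂) j≤x-at-l₂)
      where
        g-ax : InGrid n (a , x)
        g-ax = a-bounds , x-bounds , λ e → x≢a (sym e)
        g-zj : InGrid n (z , j)
        g-zj = z-bounds , (ℕ.≤-trans 1≤x (ℕ.<⇒≤ x<j) , j≤n) , λ e → j≢z (sym e)
        x≤j-at-l₁ : F Ω x l₁ ℚ.≤ F Ω j l₁
        x≤j-at-l₁ = AffineLines.+-cancelˡ-≤ {F Ω a l₁}
          (subst₂ ℚ._≤_ (H-hasLines l₁ (vertexOf (a , x)) (proj₂ (vertexOf-lines a x g-ax))) (H-hasLines l₁ v₁ lines-v₁)
            (proj₂ (preimage-max₂ {l₁} {u₁} {v₁} preimage₁) (vertexOf (a , x)) (proj₁ (vertexOf-lines a x g-ax))))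
        j≤x-at-l₂ : F Ω j l₂ ℚ.≤ F Ω x l₂
        j≤x-at-l₂ = AffineLines.+-cancelˡ-≤ {F Ω z l₂}
          (subst₂ ℚ._≤_ (H-hasLines l₂ (vertexOf (z , j)) (proj₂ (vertexOf-lines z j g-zj))) (H-hasLines l₂ u₂ lines-u₂)
            (proj₂ (preimage-max₁ {l₂} {u₂} {v₂} preimage₂) (vertexOf (z , j)) (proj₁ (vertexOf-lines z j g-zj))))

    lattice-coherent : ∀ L → All (InGrid n) L → Linked IsStep L →
      (∀ u v → PathEdge n n≥3 (map vertexOf L) u v → ∃[ l ] (IsUpperEdge n n≥3 c ω l × PreimageIs n n≥3 c ω l u v)) →
      ∀ xs s ys t zs → steps L ≡ xs ++ s ∷ ys ++ t ∷ zs → CoherentSteps s t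
    lattice-coherent L grid lk upper xs s ys t zs steps≡ with steps-split L xs s (ys ++ t ∷ zs) steps≡
    ... | A , P₁ , P₁′ , R₁ , L≡ , refl , rest≡ with steps-split (P₁′ ∷ R₁) ys t zs rest≡
    ... | B , P₂ , P₂′ , R₂ , R₁≡ , refl , _ = coherent
      where
        L≡′ : L ≡ (A ++ P₁ ∷ B) ++ P₂ ∷ P₂′ ∷ R₂
        L≡′ = trans L≡ (trans (cong (λ q → A ++ P₁ ∷ q) R₁≡) (sym (List.++-assoc A (P₁ ∷ B) (P₂ ∷ P₂′ ∷ R₂))))
        edge-at : ∀ As {P P′ R} → L ≡ As ++ P ∷ P′ ∷ R → PathEdge n n≥3 (map vertexOf L) (vertexOf P) (vertexOf P′)
        edge-at As {P} {P′} {R} e = map vertexOf As , map vertexOf R , trans (cong (map vertexOf) e) (List.map-++ vertexOf As (P ∷ P′ ∷ R))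
        grid₁ = All.++⁻ʳ A (subst (All _) L≡ grid)
        lk₁ = linked-drop A (subst (Linked _) L≡ lk)
        grid₂ = all-at₂ B (subst (All _) R₁≡ (All.tail grid₁))
        lines₁ = step-lines P₁ P₁′ (linked-at [] lk₁) (All.head grid₁) (All.head (All.tail grid₁))
        lines₂ = step-lines P₂ P₂′ (linked-at B (subst (Linked _) R₁≡ (linked-drop [ P₁ ] lk₁))) (proj₁ grid₂) (proj₂ grid₂)
        cost₁ : cost (vertexOf P₁) ℚ.< cost (vertexOf P₁′)
        cost₁ = proj₂ (Encoding.step-monotone n n≥3 c c-inc P₁ P₁′ (linked-at [] lk₁) (All.head grid₁) (All.head (All.tail grid₁)))
        cost₂ : cost (vertexOf P₁′) ℚ.< cost (vertexOf P₂′)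
        cost₂ = linked-<-second cost proj₂ (map vertexOf B) (vertexOf P₁′) (map vertexOf R₁)
                  (Encoding.linked-monotone n n≥3 c c-inc (P₁′ ∷ R₁) (All.tail grid₁) (linked-drop [ P₁ ] lk₁))
                  (trans (cong (map vertexOf) R₁≡) (List.map-++ vertexOf B (P₂ ∷ P₂′ ∷ R₂)))
        edge₁ = upper _ _ (edge-at A L≡)
        edge₂ = upper _ _ (edge-at (A ++ P₁ ∷ B) L≡′)
        l₁ = proj₁ edge₁
        l₂ = proj₁ edge₂
        preimage₁ : PreimageIs n n≥3 c ω l₁ (vertexOf P₁) (vertexOf P₁′)
        preimage₁ = proj₂ (proj₂ edge₁)
        preimage₂ : PreimageIs n n≥3 c ω l₂ (vertexOf P₂) (vertexOf P₂′)
        preimage₂ = proj₂ (proj₂ edge₂)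
        coherent : CoherentSteps (enhanced P₁ P₁′) (enhanced P₂ P₂′)
        coherent x<j with to (enhanced P₁ P₁′) ℕ.≟ fixed (enhanced P₂ P₂′) | from (enhanced P₂ P₂′) ℕ.≟ fixed (enhanced P₁ P₁′)
        ... | yes j≡z | _       = inj₁ j≡z
        ... | no _    | yes x≡a = inj₂ x≡a
        ... | no j≢z  | no x≢a  = ⊥-elim (incoherent-impossible {l₁} {l₂} {vertexOf P₁} {vertexOf P₁′} {vertexOf P₂} {vertexOf P₂′}
                (edge-parameters-< {l₁} {l₂} {vertexOf P₁} {vertexOf P₁′} {vertexOf P₂} {vertexOf P₂′} preimage₁ preimage₂ cost₁ cost₂)
                preimage₁ preimage₂
                (StepLines.after lines₁) (StepLines.before lines₂) x<j x≢a j≢z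
                (StepLines.fixed-bounds lines₁) (StepLines.from-bounds lines₂) (StepLines.to≤n lines₁) (StepLines.fixed-bounds lines₂))

  coherent⇒coherentLattice : ∀ p → CoherentMonotonePath n n≥3 c p → CoherentLatticePath n (decode p)
  coherent⇒coherentLattice p (monotone , ω , _ , edge⇒upper) with decode-monotone p monotone
  ... | map≡ , lattice@(grid , _ , _ , lk) =
    lattice , WithWeights.lattice-coherent ω (decode p) grid lk (λ u v edge → edge⇒upper u v (subst (λ q → PathEdge n n≥3 q u v) map≡ edge))

open import Data.Nat.Base using (_≤_)

theorem4p8 : (n : ℕ) (n≥3 : 3 ≤ n) (c : Fin n → ℚ) → StrictlyIncreasing c →
    Σ (List (Vertex n) → List Point) λ f → ((∀ p → CoherentMonotonePath n n≥3 c p → CoherentLatticePath n (f p)) ×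
            (∀ p q → CoherentMonotonePath n n≥3 c p → CoherentMonotonePath n n≥3 c q →
               f p ≡ f q → p ≡ q) ×
            (∀ L → CoherentLatticePath n L →
               ∃[ p ] (CoherentMonotonePath n n≥3 c p × f p ≡ L)))
theorem4p8 n n≥3 c c-inc = decode , Necessity.coherent⇒coherentLattice n n≥3 c c-inc , injective , surjective
  where
    open Vertices n n≥3 using (vertexOf)
    open Encoding n n≥3 c c-inc using (decode; decode-monotone; decode-map; diagonalAvoiding⇒monotone)

    injective : ∀ p q → CoherentMonotonePath n n≥3 c p → CoherentMonotonePath n n≥3 c q → decode p ≡ decode q → p ≡ q
    injective p q (monotone-p , _) (monotone-q , _) decode≡ = begin
      p                      ≡⟨ sym (proj₁ (decode-monotone p monotone-p)) ⟩
      map vertexOf (decode p) ≡⟨ cong (map vertexOf) decode≡ ⟩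
      map vertexOf (decode q) ≡⟨ proj₁ (decode-monotone q monotone-q) ⟩
      q                      ∎
      where open ≡-Reasoning

    surjective : ∀ L → CoherentLatticePath n L → ∃[ p ] (CoherentMonotonePath n n≥3 c p × decode p ≡ L)
    surjective L lattice@(diagonalAvoiding , _) =
      map vertexOf L ,
      (diagonalAvoiding⇒monotone L diagonalAvoiding , Sufficiency.coherentLattice⇒coherent n n≥3 c c-inc L lattice) ,
      decode-map L diagonalAvoiding
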